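{- Let $(\Omega,a)$ be a binding signature with associated endofunctor $\Sigma$ on $\mathcal S$ and let $[\eta_V,\varphi_V]:V+\Sigma(TV)\to TV$ be an initial $(V+\Sigma)$-algebra. Then $TV$ carries a (canonical) relevant substitution algebra structure: there are morphisms $\sigma:\delta(TV)\hat\otimes TV\to TV$ and $\nu:J\to\delta(TV)$ such that $(TV,\sigma,\nu)$ is a relevant substitution algebra.
   Context: Let $\mathbb{S}$ be the category whose objects are the sets $\mathbf{n}=\{1,\dots,n\}$ ($n\in\mathbb{N}$) and whose morphisms are surjections; strict monoidal with $\mathbf n\otimes\mathbf m=\mathbf{n+m}$ (elements of $\mathbf m$ after those of $\mathbf n$, morphisms blockwise), unit $\mathbf 0$; $s:\mathbf 2\to\mathbf 2$ the transposition, $c:\mathbf 2\to\mathbf 1$ the unique map, $\nabla_n:\mathbf{n+n}\to\mathbf n$ the codiagonal. $\mathcal S=\mathbf{Set}^{\mathbb S}$. Day convolution $(X\hat\otimes Y)(\mathbf n)=\int^{\mathbf m_1,\mathbf m_2}X(\mathbf m_1)\times Y(\mathbf m_2)\times\mathbb S(\mathbf{m_1+m_2},\mathbf n)$, classes $[x,y,f]$, unit $J=\mathbb S(\mathbf 0,-)$; symmetric monoidal; associators suppressed, unitors $\lambda,r$, symmetry $\gamma$; diagonal $d_Z:Z\to Z\hat\otimes Z$, $z\in Z(\mathbf n)\mapsto[z,z,\nabla_n]$. $V=\mathbb S(\mathbf 1,-)$. $\delta:\mathcal S\to\mathcal S$, $\delta(X)(\mathbf n)=X(\mathbf{n+1})$,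 $\delta(X)(f)=X(f\otimes\mathrm{id}_{\mathbf 1})$. $\mathsf{swap}_X:\delta^2X\to\delta^2X$ and $\mathsf{cont}_X:\delta^2X\to\delta X$ have components $X(\mathrm{id}_{\mathbf n}\otimes s)$ and $X(\mathrm{id}_{\mathbf n}\otimes c)$. Left strength $\mathsf{str}'_{X,Y}:X\hat\otimes\delta Y\to\delta(X\hat\otimes Y)$, $[x,y,f]\mapsto[x,y,f\otimes\mathrm{id}_{\mathbf 1}]$; right strength $\mathsf{str}_{X,Y}:\delta X\hat\otimes Y\to\delta(X\hat\otimes Y)$, $[x,y,f]\mapsto[x,y,(f\otimes\mathrm{id}_{\mathbf 1})\circ\theta]$ ($x\in X(\mathbf{m_1+1})$, $y\in Y(\mathbf m_2)$), $\theta:\mathbf{m_1+1+m_2}\to\mathbf{m_1+m_2+1}$ fixing $1..m_1$, $m_1+1\mapsto m_1+m_2+1$, $m_1+1+i\mapsto m_1+i$. $\rho_{X,Y}=\mathsf{cont}_{X\hat\otimes Y}\circ\delta(\mathsf{str}'_{X,Y})\circ\mathsf{str}_{X,\delta Y}:\delta X\hat\otimes\delta Y\to\delta(X\hat\otimes Y)$. $\mathbf{str}^{\mathsf{sub}}_{Y,Z}=(\mathsf{str}_{Y,Z}\hat\otimes\mathrm{id})\circ(\mathrm{id}\hat\otimes\gamma_{Y,Z}\hat\otimes\mathrm{id})\circ(\mathrm{id}\hat\otimes\mathrm{id}\hat\otimes d_Z):\delta Y\hat\otimes Y\hat\otimes Z\to\delta(Y\hat\otimes Z)\hat\otimes(Y\hat\otimes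 Z)$. A relevant substitution algebra is $(X,\sigma,\nu)$ with $\sigma:\delta X\hat\otimes X\to X$, $\nu:J\to\delta X$, such that (a) $\sigma\circ(\nu\hat\otimes\mathrm{id})=\lambda_X$; (b) $\delta(\sigma)\circ\mathsf{str}'_{\delta X,X}\circ(\mathrm{id}\hat\otimes\nu)=r_{\delta X}$; (c) $\sigma\circ(\mathrm{id}_{\delta X}\hat\otimes\sigma)=\sigma\circ(\delta\sigma\hat\otimes\mathrm{id})\circ(\mathsf{str}'_{\delta X,X}\hat\otimes\mathrm{id})$ on $\delta X\hat\otimes\delta X\hat\otimes X$; (d) $\sigma\circ(\delta\sigma\hat\otimes\mathrm{id})\circ(\mathsf{str}_{\delta X,X}\hat\otimes\mathrm{id})=\sigma\circ(\delta\sigma\hat\otimes\mathrm{id})\circ(\mathsf{str}_{\delta X,X}\hat\otimes\mathrm{id})\circ(\mathrm{id}_{\delta^2X}\hat\otimes\gamma_{X,X})\circ(\mathsf{swap}_X\hat\otimes\mathrm{id}_{X\hat\otimes X})$ on $\delta^2X\hat\otimes X\hat\otimes X$; (f) $\sigma\circ(\delta\sigma\hat\otimes\mathrm{id}_X)\circ(\rho_{\delta X,X}\hat\otimes\mathrm{id}_X)=\sigma\circ(\delta\sigma\hat\otimes\sigma)\circ\mathbf{str}^{\mathsf{sub}}_{\delta X,X}\circ(\mathsf{swap}_X\hat\otimes\mathrm{id}_{\delta X}\hat\otimes\mathrm{id}_X)$ on $\delta^2X\hat\otimes\delta X\hat\otimes X$. A binding signature is a set $\Omega$ with $a:\Omega\to\mathbb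 N^*$; for $a(\omega)=(n_1,\dots,n_k)$, $\Sigma_\omega(X)=\delta^{n_1}X\hat\otimes\cdots\hat\otimes\delta^{n_k}X$ ($J$ if $k=0$) and $\Sigma(X)=\coprod_\omega\Sigma_\omega(X)$. -}

module Defs where

open import Data.Nat using (ℕ; zero; suc; _+_)
open import Data.Nat.Properties using (+-assoc; +-identityʳ)
open import Data.Fin using (Fin; zero; suc; _↑ˡ_; _↑ʳ_; splitAt; join; cast)
open import Data.Fin.Properties using (splitAt-↑ˡ; splitAt-join; join-splitAt; cast-involutive)
open import Data.Sum as Sum using (_⊎_; inj₁; inj₂; [_,_]′)
open import Data.Sum.Relation.Binary.Pointwise using (Pointwise)
open import Data.Product using (Σ; ∃; _,_; _×_)
open import Data.List using (List; []; _∷_)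
open import Relation.Binary.PropositionalEquality using (_≡_; refl; sym; trans; cong; _≗_)
open import Relation.Binary.Structures using (IsEquivalence)

-- The category 𝕊 : objects n = Fin n, morphisms = surjections.
-- Equality of morphisms is pointwise equality of the underlying functions.

record Surj (m n : ℕ) : Set where
  constructor mkSurj
  field
    fun  : Fin m → Fin n
    surj : ∀ y → ∃ λ x → fun x ≡ y
open Surj public

idS : ∀ n → Surj n n
idS n = mkSurj (λ x → x) (λ y → y , refl)

infixr 9 _∘S_
_∘S_ : ∀ {l m n} → Surj m n → Surj l m → Surj l n
g ∘S f = mkSurj (λ x → fun g (fun f x)) pr
  where
  pr : ∀ z → ∃ λ x → fun g (fun f x) ≡ z
  pr z with surj g z
  ... | y , p with surj f y
  ... | x , q = x , trans (cong (fun g) q) p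

-- transport along an equation of sizes (a bijection; identity up to strictness)
castS : ∀ {m n} → m ≡ n → Surj m n
castS {m} {n} e = mkSurj (cast e) (λ y → cast (sym e) y , cast-involutive e (sym e) y)

infixr 10 _⊗S_
_⊗S_ : ∀ {m n m' n'} → Surj m n → Surj m' n' → Surj (m + m') (n + n')
_⊗S_ {m} {n} {m'} {n'} f g = mkSurj F pr
  where
  F : Fin (m + m') → Fin (n + n')
  F x = join n n' (Sum.map (fun f) (fun g) (splitAt m x))
  go : ∀ y (s : Fin n ⊎ Fin n') → join n n' s ≡ y → ∃ λ x → F x ≡ y
  go y (inj₁ a) e with surj f a
  ... | x , p = x ↑ˡ m'
              , trans (cong (λ s → join n n' (Sum.map (fun f) (fun g) s)) (splitAt-↑ˡ m x m'))
                      (trans (cong (λ z → z ↑ˡ n') p) e)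
  go y (inj₂ b) e with surj g b
  ... | x , p = m ↑ʳ x
              , trans (cong (λ s → join n n' (Sum.map (fun f) (fun g) s)) (splitAt-join m m' (inj₂ x)))
                      (trans (cong (λ z → n ↑ʳ z) p) e)
  pr : ∀ y → ∃ λ x → F x ≡ y
  pr y = go y (splitAt n y) (join-splitAt n n' y)

swapB : ∀ m n → Surj (m + n) (n + m)
swapB m n = mkSurj (λ x → join n m (Sum.swap (splitAt m x))) pr
  where
  sw : ∀ (s : Fin n ⊎ Fin m) → Sum.swap (Sum.swap s) ≡ s
  sw (inj₁ _) = refl
  sw (inj₂ _) = refl
  pr : ∀ y → ∃ λ x → join n m (Sum.swap (splitAt m x)) ≡ y
  pr y = join m n (Sum.swap (splitAt n y))
       , trans (cong (λ s → join n m (Sum.swap s)) (splitAt-join m n (Sum.swap (splitAt n y))))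
               (trans (cong (join n m) (sw (splitAt n y))) (join-splitAt n m y))

sS : Surj 2 2
sS = mkSurj f pr
  where
  f : Fin 2 → Fin 2
  f zero = suc zero
  f (suc zero) = zero
  pr : ∀ y → ∃ λ x → f x ≡ y
  pr zero = suc zero , refl
  pr (suc zero) = zero , refl

cS : Surj 2 1
cS = mkSurj (λ _ → zero) pr
  where
  pr : ∀ y → ∃ λ x → zero ≡ y
  pr zero = zero , refl

∇S : ∀ n → Surj (n + n) n
∇S n = mkSurj (λ x → [ (λ y → y) , (λ y → y) ]′ (splitAt n x))
              (λ y → y ↑ˡ n , cong [ (λ y → y) , (λ y → y) ]′ (splitAt-↑ˡ n y n))

-- id_n ⊗ s  and  id_n ⊗ c, read on (n+1)+1 = n+2 (strict in the paper)
swapMap : ∀ n → Surj ((n + 1) + 1) ((n + 1) + 1)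
swapMap n = castS (sym (+-assoc n 1 1)) ∘S (idS n ⊗S sS) ∘S castS (+-assoc n 1 1)

contMap : ∀ n → Surj ((n + 1) + 1) (n + 1)
contMap n = (idS n ⊗S cS) ∘S castS (+-assoc n 1 1)

θS : ∀ m₁ m₂ → Surj ((m₁ + 1) + m₂) ((m₁ + m₂) + 1)
θS m₁ m₂ = castS (sym (+-assoc m₁ m₂ 1)) ∘S (idS m₁ ⊗S swapB 1 m₂) ∘S castS (+-assoc m₁ 1 m₂)

-- 𝒮 = Set^𝕊, with sets represented as setoids (no quotient types in Agda).
-- Psh packs the data of a functor; IsPsh its laws.

record Psh : Set₁ where
  field
    Ob  : ℕ → Set
    Eq  : ∀ {n} → Ob n → Ob n → Set
    act : ∀ {m n} → Surj m n → Ob m → Ob n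
open Psh public

record IsPsh (X : Psh) : Set where
  field
    isEquiv  : ∀ {n} → IsEquivalence (Eq X {n})
    act-cong : ∀ {m n} {f g : Surj m n} {x y : Ob X m} →
               fun f ≗ fun g → Eq X x y → Eq X (act X f x) (act X g y)
    act-id   : ∀ {n} (x : Ob X n) → Eq X (act X (idS n) x) x
    act-∘    : ∀ {l m n} (f : Surj l m) (g : Surj m n) (x : Ob X l) →
               Eq X (act X (g ∘S f) x) (act X g (act X f x))

record Hom (X Y : Psh) : Set where
  constructor mkHom
  field
    app : ∀ {n} → Ob X n → Ob Y n
open Hom public

record IsHom {X Y : Psh} (h : Hom X Y) : Set where
  field
    hom-cong : ∀ {n} {x y : Ob X n} → Eq X x y → Eq Y (app h x) (app h y)
    hom-nat  : ∀ {m n} (f : Surj m n) (x : Ob X m) →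
               Eq Y (app h (act X f x)) (act Y f (app h x))

infix 4 _≈h_
_≈h_ : ∀ {X Y} → Hom X Y → Hom X Y → Set
_≈h_ {X} {Y} f g = ∀ {n} (x : Ob X n) → Eq Y (app f x) (app g x)

idh : ∀ {X} → Hom X X
idh = mkHom (λ x → x)

infixr 9 _∘h_
_∘h_ : ∀ {X Y Z} → Hom Y Z → Hom X Y → Hom X Z
g ∘h f = mkHom (λ x → app g (app f x))

-- Day convolution: the coend as the setoid of triples [x , y , f]
-- modulo the equivalence relation generated by the coend identifications.

record DayEl (X Y : Psh) (n : ℕ) : Set where
  constructor ⟨_,_,_⟩
  field
    {m₁ m₂} : ℕ
    elX : Ob X m₁
    elY : Ob Y m₂
    map : Surj (m₁ + m₂) n

data DayEq (X Y : Psh) {n : ℕ} : DayEl X Y n → DayEl X Y n → Set where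
  d-refl  : ∀ {u} → DayEq X Y u u
  d-sym   : ∀ {u v} → DayEq X Y u v → DayEq X Y v u
  d-trans : ∀ {u v w} → DayEq X Y u v → DayEq X Y v w → DayEq X Y u w
  d-cong  : ∀ {m₁ m₂} {x x' : Ob X m₁} {y y' : Ob Y m₂} {f f' : Surj (m₁ + m₂) n} →
            Eq X x x' → Eq Y y y' → fun f ≗ fun f' →
            DayEq X Y ⟨ x , y , f ⟩ ⟨ x' , y' , f' ⟩
  d-left  : ∀ {m₁ m₁' m₂} (g : Surj m₁ m₁') (x : Ob X m₁) (y : Ob Y m₂) (f : Surj (m₁' + m₂) n) →
            DayEq X Y ⟨ act X g x , y , f ⟩ ⟨ x , y , f ∘S (g ⊗S idS m₂) ⟩
  d-right : ∀ {m₁ m₂ m₂'} (g : Surj m₂ m₂') (x : Ob X m₁) (y : Ob Y m₂) (f : Surj (m₁ + m₂') n) →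
            DayEq X Y ⟨ x , act Y g y , f ⟩ ⟨ x , y , f ∘S (idS m₁ ⊗S g) ⟩

infixr 6 _⊗_
_⊗_ : Psh → Psh → Psh
Ob  (X ⊗ Y) = DayEl X Y
Eq  (X ⊗ Y) = DayEq X Y
act (X ⊗ Y) h ⟨ x , y , f ⟩ = ⟨ x , y , h ∘S f ⟩

infixr 6 _⊗h_
_⊗h_ : ∀ {X X' Y Y'} → Hom X X' → Hom Y Y' → Hom (X ⊗ Y) (X' ⊗ Y')
h ⊗h k = mkHom λ { ⟨ x , y , f ⟩ → ⟨ app h x , app k y , f ⟩ }

Rep : ℕ → Psh
Ob  (Rep k) n = Surj k n
Eq  (Rep k) f g = fun f ≗ fun g
act (Rep k) h f = h ∘S f

J : Psh
J = Rep 0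

V : Psh
V = Rep 1

lam : ∀ X → Hom (J ⊗ X) X
lam X = mkHom λ { ⟨ j , x , f ⟩ → act X (f ∘S (j ⊗S idS _)) x }

rho : ∀ X → Hom (X ⊗ J) X
rho X = mkHom λ { (⟨_,_,_⟩ {m₁} x j f) → act X (f ∘S (idS m₁ ⊗S j) ∘S castS (sym (+-identityʳ m₁))) x }

gam : ∀ X Y → Hom (X ⊗ Y) (Y ⊗ X)
gam X Y = mkHom λ { (⟨_,_,_⟩ {m₁} {m₂} x y f) → ⟨ y , x , f ∘S swapB m₂ m₁ ⟩ }

assoc : ∀ X Y Z → Hom ((X ⊗ Y) ⊗ Z) (X ⊗ (Y ⊗ Z))
assoc X Y Z = mkHom λ { (⟨_,_,_⟩ {_} {c} (⟨_,_,_⟩ {a} {b} x y f) z g) →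
  ⟨ x , ⟨ y , z , idS (b + c) ⟩ , g ∘S (f ⊗S idS c) ∘S castS (sym (+-assoc a b c)) ⟩ }

assoc⁻¹ : ∀ X Y Z → Hom (X ⊗ (Y ⊗ Z)) ((X ⊗ Y) ⊗ Z)
assoc⁻¹ X Y Z = mkHom λ { (⟨_,_,_⟩ {a} {_} x (⟨_,_,_⟩ {b} {c} y z f) g) →
  ⟨ ⟨ x , y , idS (a + b) ⟩ , z , g ∘S (idS a ⊗S f) ∘S castS (+-assoc a b c) ⟩ }

diag : ∀ Z → Hom Z (Z ⊗ Z)
diag Z = mkHom λ {n} z → ⟨ z , z , ∇S n ⟩

δ : Psh → Psh
Ob  (δ X) n = Ob X (n + 1)
Eq  (δ X) = Eq X
act (δ X) f = act X (f ⊗S idS 1)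

δh : ∀ {X Y} → Hom X Y → Hom (δ X) (δ Y)
δh h = mkHom (app h)

swapH : ∀ X → Hom (δ (δ X)) (δ (δ X))
swapH X = mkHom λ {n} → act X (swapMap n)

contH : ∀ X → Hom (δ (δ X)) (δ X)
contH X = mkHom λ {n} → act X (contMap n)

strL : ∀ X Y → Hom (X ⊗ δ Y) (δ (X ⊗ Y))
strL X Y = mkHom λ { (⟨_,_,_⟩ {m₁} {m₂} x y f) →
  ⟨ x , y , (f ⊗S idS 1) ∘S castS (sym (+-assoc m₁ m₂ 1)) ⟩ }

strR : ∀ X Y → Hom (δ X ⊗ Y) (δ (X ⊗ Y))
strR X Y = mkHom λ { (⟨_,_,_⟩ {m₁} {m₂} x y f) → ⟨ x , y , (f ⊗S idS 1) ∘S θS m₁ m₂ ⟩ }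

rhoδ : ∀ X Y → Hom (δ X ⊗ δ Y) (δ (X ⊗ Y))
rhoδ X Y = contH (X ⊗ Y) ∘h δh (strL X Y) ∘h strR X (δ Y)

-- str^sub_{Y,Z} : δY ⊗ (Y ⊗ Z) → δ(Y ⊗ Z) ⊗ (Y ⊗ Z)  (associators made explicit)
strSub : ∀ Y Z → Hom (δ Y ⊗ (Y ⊗ Z)) (δ (Y ⊗ Z) ⊗ (Y ⊗ Z))
strSub Y Z =
     (strR Y Z ⊗h idh)
  ∘h assoc⁻¹ (δ Y) Z (Y ⊗ Z)
  ∘h (idh ⊗h assoc Z Y Z)
  ∘h (idh ⊗h (gam Y Z ⊗h idh))
  ∘h (idh ⊗h assoc⁻¹ Y Z Z)
  ∘h (idh ⊗h (idh ⊗h diag Z))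

-- relevant substitution algebras (three-fold products bracketed as A ⊗ (B ⊗ C))

record IsRelSubstAlg (X : Psh) (σ : Hom (δ X ⊗ X) X) (ν : Hom J (δ X)) : Set where
  field
    ax-a : σ ∘h (ν ⊗h idh) ≈h lam X
    ax-b : δh σ ∘h strL (δ X) X ∘h (idh ⊗h ν) ≈h rho (δ X)
    ax-c : σ ∘h (idh ⊗h σ)
           ≈h σ ∘h (δh σ ⊗h idh) ∘h (strL (δ X) X ⊗h idh) ∘h assoc⁻¹ (δ X) (δ X) X
    ax-d : σ ∘h (δh σ ⊗h idh) ∘h (strR (δ X) X ⊗h idh) ∘h assoc⁻¹ (δ (δ X)) X X
           ≈h σ ∘h (δh σ ⊗h idh) ∘h (strR (δ X) X ⊗h idh) ∘h assoc⁻¹ (δ (δ X)) X X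
                ∘h (idh ⊗h gam X X) ∘h (swapH X ⊗h idh)
    ax-f : σ ∘h (δh σ ⊗h idh) ∘h (rhoδ (δ X) X ⊗h idh) ∘h assoc⁻¹ (δ (δ X)) (δ X) X
           ≈h σ ∘h (δh σ ⊗h σ) ∘h strSub (δ X) X ∘h (swapH X ⊗h idh)

record BindingSig : Set₁ where
  field
    Op    : Set
    arity : Op → List ℕ
open BindingSig public

δ^ : ℕ → Psh → Psh
δ^ zero    X = X
δ^ (suc k) X = δ (δ^ k X)

δ^h : ∀ k {X Y} → Hom X Y → Hom (δ^ k X) (δ^ k Y)
δ^h zero    h = h
δ^h (suc k) h = δh (δ^h k h)

prodΣ : List ℕ → Psh → Psh
prodΣ []           X = J
prodΣ (k ∷ [])     X = δ^ k X
prodΣ (k ∷ l ∷ ks) X = δ^ k X ⊗ prodΣ (l ∷ ks) X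

prodΣh : ∀ ks {X Y} → Hom X Y → Hom (prodΣ ks X) (prodΣ ks Y)
prodΣh []           h = idh
prodΣh (k ∷ [])     h = δ^h k h
prodΣh (k ∷ l ∷ ks) h = δ^h k h ⊗h prodΣh (l ∷ ks) h

data ΣEq (S : BindingSig) (X : Psh) {n : ℕ} :
         Σ (Op S) (λ ω → Ob (prodΣ (arity S ω) X) n) →
         Σ (Op S) (λ ω → Ob (prodΣ (arity S ω) X) n) → Set where
  same : ∀ {ω u u'} → Eq (prodΣ (arity S ω) X) u u' → ΣEq S X (ω , u) (ω , u')

ΣF : BindingSig → Psh → Psh
Ob  (ΣF S X) n = Σ (Op S) (λ ω → Ob (prodΣ (arity S ω) X) n)
Eq  (ΣF S X) = ΣEq S X
act (ΣF S X) f (ω , u) = ω , act (prodΣ (arity S ω) X) f u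

ΣFh : ∀ S {X Y} → Hom X Y → Hom (ΣF S X) (ΣF S Y)
ΣFh S h = mkHom λ { (ω , u) → ω , app (prodΣh (arity S ω) h) u }

infixr 5 _⊕_
_⊕_ : Psh → Psh → Psh
Ob  (X ⊕ Y) n = Ob X n ⊎ Ob Y n
Eq  (X ⊕ Y) = Pointwise (Eq X) (Eq Y)
act (X ⊕ Y) f = Sum.map (act X f) (act Y f)

_⊕h_ : ∀ {X X' Y Y'} → Hom X X' → Hom Y Y' → Hom (X ⊕ Y) (X' ⊕ Y')
h ⊕h k = mkHom (Sum.map (app h) (app k))

IsAlgHom : ∀ S {T A} (α : Hom (V ⊕ ΣF S T) T) (β : Hom (V ⊕ ΣF S A) A) → Hom T A → Set
IsAlgHom S α β h = h ∘h α ≈h β ∘h (idh ⊕h ΣFh S h)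

IsInitialAlg : (S : BindingSig) (T : Psh) → Hom (V ⊕ ΣF S T) T → Set₁
IsInitialAlg S T α =
  (A : Psh) → IsPsh A → (β : Hom (V ⊕ ΣF S A) A) → IsHom β →
  Σ (Hom T A) λ h → IsHom h × IsAlgHom S α β h ×
    ((h' : Hom T A) → IsHom h' → IsAlgHom S α β h' → h' ≈h h)

{-# OPTIONS --safe #-}
module Submission where

open import Data.Nat using (ℕ; zero; suc; _+_)
open import Data.Nat.Properties using (+-assoc; +-identityʳ)
open import Data.Fin using (Fin; zero; suc; _↑ˡ_; _↑ʳ_; splitAt; join; cast; toℕ)
open import Data.Fin.Properties using (splitAt-↑ˡ; splitAt-↑ʳ; splitAt⁻¹-↑ˡ; splitAt⁻¹-↑ʳ; splitAt-join; toℕ-cast; toℕ-injective; toℕ-↑ˡ; toℕ-↑ʳ)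
open import Data.Sum as Sum using (_⊎_; inj₁; inj₂; [_,_]′)
open import Data.Sum.Properties using (map-map; inj₁-injective)
import Data.Sum.Relation.Binary.Pointwise as PW
open import Data.Product using (Σ; _×_; _,_; proj₁; proj₂)
open import Data.Empty using (⊥)
open import Data.Unit using (⊤; tt)
open import Data.List using (List; []; _∷_)
open import Function using (id; _∘_)
open import Relation.Binary.PropositionalEquality hiding (J)
open import Relation.Binary.Structures using (IsEquivalence)
open import Relation.Binary.Bundles using (Setoid)
import Relation.Binary.Reasoning.Setoid as SetoidReasoning
open import Defs

-- By initiality TV is isomorphic to the presheaf of relevant terms over the signature:
-- terms in which every free variable occurs and every variable bound by a binder occurs.
-- One direction is the unique algebra map; the other reads a term back bottom-up,
-- realising each subterm in TV over the variables it actually uses and relabelling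
-- along a surjection. Realisations are unique up to a bijection of their variables,
-- which makes readback natural and an algebra map, so initiality makes it the inverse.
-- Transported along this isomorphism, σ is substitution for the last variable, and each
-- axiom becomes a substitution lemma for terms, checked pointwise on variables once the
-- structure maps of 𝕊 occurring in it have been computed in coordinates.

infixr 6 _⊗ᶠ_
_⊗ᶠ_ : ∀ {a a' b b'} → (Fin a → Fin a') → (Fin b → Fin b') → Fin (a + b) → Fin (a' + b')
_⊗ᶠ_ {a} {a'} {b} {b'} f g i = join a' b' (Sum.map f g (splitAt a i))

module _ {a a' b b' : ℕ} where

  ⊗ᶠ-↑ˡ : (f : Fin a → Fin a') (g : Fin b → Fin b') (i : Fin a) → (f ⊗ᶠ g) (i ↑ˡ b) ≡ f i ↑ˡ b'
  ⊗ᶠ-↑ˡ f g i = cong (join a' b' ∘ Sum.map f g) (splitAt-↑ˡ a i b)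

  ⊗ᶠ-↑ʳ : (f : Fin a → Fin a') (g : Fin b → Fin b') (j : Fin b) → (f ⊗ᶠ g) (a ↑ʳ j) ≡ a' ↑ʳ g j
  ⊗ᶠ-↑ʳ f g j = cong (join a' b' ∘ Sum.map f g) (splitAt-↑ʳ a b j)

  ⊗ᶠ-cong : {f f' : Fin a → Fin a'} {g g' : Fin b → Fin b'} → f ≗ f' → g ≗ g' → f ⊗ᶠ g ≗ f' ⊗ᶠ g'
  ⊗ᶠ-cong ef eg i with splitAt a i
  ... | inj₁ x = cong (_↑ˡ b') (ef x)
  ... | inj₂ y = cong (a' ↑ʳ_) (eg y)

⊗ᶠ-∘ : ∀ {a a' a'' b b' b''} (f : Fin a' → Fin a'') (g : Fin b' → Fin b'') (f' : Fin a → Fin a') (g' : Fin b → Fin b') →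
       (f ⊗ᶠ g) ∘ (f' ⊗ᶠ g') ≗ (f ∘ f') ⊗ᶠ (g ∘ g')
⊗ᶠ-∘ {a} f g f' g' i with splitAt a i
... | inj₁ x = ⊗ᶠ-↑ˡ f g (f' x)
... | inj₂ y = ⊗ᶠ-↑ʳ f g (g' y)

⊗ᶠ-id : ∀ {a b} {f : Fin a → Fin a} {g : Fin b → Fin b} → f ≗ id → g ≗ id → f ⊗ᶠ g ≗ id
⊗ᶠ-id {a} {b} ef eg i with splitAt a i in eq
... | inj₁ x = trans (cong (_↑ˡ b) (ef x)) (splitAt⁻¹-↑ˡ eq)
... | inj₂ y = trans (cong (a ↑ʳ_) (eg y)) (splitAt⁻¹-↑ʳ eq)

data SplitView (m n : ℕ) : Fin (m + n) → Set where
  inL : (i : Fin m) → SplitView m n (i ↑ˡ n)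
  inR : (j : Fin n) → SplitView m n (m ↑ʳ j)

splitView : ∀ m n (i : Fin (m + n)) → SplitView m n i
splitView m n i with splitAt m i in eq
... | inj₁ a = subst (SplitView m n) (splitAt⁻¹-↑ˡ eq) (inL a)
... | inj₂ b = subst (SplitView m n) (splitAt⁻¹-↑ʳ eq) (inR b)

≗-split : ∀ {m n} {A : Set} {f g : Fin (m + n) → A} →
          (∀ i → f (i ↑ˡ n) ≡ g (i ↑ˡ n)) → (∀ j → f (m ↑ʳ j) ≡ g (m ↑ʳ j)) → f ≗ g
≗-split {m} {n} onˡ onʳ k with splitView m n k
... | inL i = onˡ i
... | inR j = onʳ j

≗-split₂ : ∀ {m} {A : Set} {f g : Fin ((m + 1) + 1) → A} →
           (∀ i → f ((i ↑ˡ 1) ↑ˡ 1) ≡ g ((i ↑ˡ 1) ↑ˡ 1)) → f ((m ↑ʳ zero) ↑ˡ 1) ≡ g ((m ↑ʳ zero) ↑ˡ 1) →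
           f ((m + 1) ↑ʳ zero) ≡ g ((m + 1) ↑ʳ zero) → f ≗ g
≗-split₂ onˡ onPenultimate onLast = ≗-split (≗-split onˡ λ { zero → onPenultimate }) λ { zero → onLast }

map-≡inj₁ : ∀ {A B C D : Set} (f : A → C) (g : B → D) (s : A ⊎ B) {c} →
            Sum.map f g s ≡ inj₁ c → Σ A λ a → s ≡ inj₁ a × f a ≡ c
map-≡inj₁ f g (inj₁ a) refl = a , refl , refl

map-≡inj₂ : ∀ {A B C D : Set} (f : A → C) (g : B → D) (s : A ⊎ B) {d} →
            Sum.map f g s ≡ inj₂ d → Σ B λ b → s ≡ inj₂ b × g b ≡ d
map-≡inj₂ f g (inj₂ b) refl = b , refl , refl

-- Contexts extended by bound variables

-- Ob (δ^ k X) n lives at extend k n: n followed by k bound variables, of which joinᵏ numbers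
-- the first one added 0.
extend : ℕ → ℕ → ℕ
extend zero    n = n
extend (suc k) n = extend k (n + 1)

lift₁ : ∀ {n m} → (Fin n → Fin m) → Fin (n + 1) → Fin (m + 1)
lift₁ f = f ⊗ᶠ id

liftᵏ : ∀ k {n m} → (Fin n → Fin m) → Fin (extend k n) → Fin (extend k m)
liftᵏ zero    f = f
liftᵏ (suc k) f = liftᵏ k (lift₁ f)

joinᵏ : ∀ k {n} → Fin n ⊎ Fin k → Fin (extend k n)
joinᵏ zero    (inj₁ i)       = i
joinᵏ (suc k) (inj₁ i)       = joinᵏ k (inj₁ (i ↑ˡ 1))
joinᵏ (suc k) {n} (inj₂ zero) = joinᵏ k (inj₁ (n ↑ʳ zero))
joinᵏ (suc k) (inj₂ (suc b)) = joinᵏ k (inj₂ b)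

splitᵏ : ∀ k {n} → Fin (extend k n) → Fin n ⊎ Fin k
splitᵏ zero    i = inj₁ i
splitᵏ (suc k) {n} i = [ [ inj₁ , (λ _ → inj₂ zero) ]′ ∘ splitAt n , inj₂ ∘ suc ]′ (splitᵏ k i)

splitᵏ-joinᵏ : ∀ k {n} (s : Fin n ⊎ Fin k) → splitᵏ k (joinᵏ k s) ≡ s
splitᵏ-joinᵏ zero (inj₁ i) = refl
splitᵏ-joinᵏ (suc k) {n} (inj₁ i)
  rewrite splitᵏ-joinᵏ k (inj₁ (i ↑ˡ 1)) | splitAt-↑ˡ n i 1 = refl
splitᵏ-joinᵏ (suc k) {n} (inj₂ zero)
  rewrite splitᵏ-joinᵏ k {n + 1} (inj₁ (n ↑ʳ zero)) | splitAt-↑ʳ n 1 zero = refl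
splitᵏ-joinᵏ (suc k) {n} (inj₂ (suc b))
  rewrite splitᵏ-joinᵏ k {n + 1} (inj₂ b) = refl

joinᵏ-splitᵏ : ∀ k {n} (i : Fin (extend k n)) → joinᵏ k (splitᵏ k i) ≡ i
joinᵏ-splitᵏ zero i = refl
joinᵏ-splitᵏ (suc k) {n} i with splitᵏ k i in e
... | inj₂ b = trans (cong (joinᵏ k) (sym e)) (joinᵏ-splitᵏ k i)
... | inj₁ j with splitAt n j in e′
...   | inj₁ a    = trans (cong (joinᵏ k ∘ inj₁) (splitAt⁻¹-↑ˡ e′)) (trans (cong (joinᵏ k) (sym e)) (joinᵏ-splitᵏ k i))
...   | inj₂ zero = trans (cong (joinᵏ k ∘ inj₁) (splitAt⁻¹-↑ʳ e′)) (trans (cong (joinᵏ k) (sym e)) (joinᵏ-splitᵏ k i))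

liftᵏ-cong : ∀ k {n m} {f g : Fin n → Fin m} → f ≗ g → liftᵏ k f ≗ liftᵏ k g
liftᵏ-cong zero    e = e
liftᵏ-cong (suc k) e = liftᵏ-cong k (⊗ᶠ-cong e (λ _ → refl))

liftᵏ-∘ : ∀ k {l n m} (f : Fin n → Fin m) (g : Fin l → Fin n) → liftᵏ k f ∘ liftᵏ k g ≗ liftᵏ k (f ∘ g)
liftᵏ-∘ zero    f g x = refl
liftᵏ-∘ (suc k) f g x = trans (liftᵏ-∘ k (lift₁ f) (lift₁ g) x) (liftᵏ-cong k (⊗ᶠ-∘ f id g id) x)

liftᵏ-id : ∀ k {n} {f : Fin n → Fin n} → f ≗ id → liftᵏ k f ≗ id
liftᵏ-id zero    e = e
liftᵏ-id (suc k) e = liftᵏ-id k (⊗ᶠ-id e (λ _ → refl))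

liftᵏ-joinᵏ : ∀ k {n m} (f : Fin n → Fin m) (s : Fin n ⊎ Fin k) → liftᵏ k f (joinᵏ k s) ≡ joinᵏ k (Sum.map₁ f s)
liftᵏ-joinᵏ zero    f (inj₁ i) = refl
liftᵏ-joinᵏ (suc k) f (inj₁ i) =
  trans (liftᵏ-joinᵏ k (lift₁ f) (inj₁ (i ↑ˡ 1))) (cong (joinᵏ k ∘ inj₁) (⊗ᶠ-↑ˡ f id i))
liftᵏ-joinᵏ (suc k) {n} f (inj₂ zero) =
  trans (liftᵏ-joinᵏ k (lift₁ f) (inj₁ (n ↑ʳ zero))) (cong (joinᵏ k ∘ inj₁) (⊗ᶠ-↑ʳ f id zero))
liftᵏ-joinᵏ (suc k) f (inj₂ (suc b)) = liftᵏ-joinᵏ k (lift₁ f) (inj₂ b)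

splitᵏ-liftᵏ : ∀ k {n m} (f : Fin n → Fin m) (i : Fin (extend k n)) → splitᵏ k (liftᵏ k f i) ≡ Sum.map₁ f (splitᵏ k i)
splitᵏ-liftᵏ k f i = begin
  splitᵏ k (liftᵏ k f i)                          ≡⟨ cong (splitᵏ k ∘ liftᵏ k f) (joinᵏ-splitᵏ k i) ⟨
  splitᵏ k (liftᵏ k f (joinᵏ k (splitᵏ k i)))     ≡⟨ cong (splitᵏ k) (liftᵏ-joinᵏ k f (splitᵏ k i)) ⟩
  splitᵏ k (joinᵏ k (Sum.map₁ f (splitᵏ k i)))    ≡⟨ splitᵏ-joinᵏ k _ ⟩
  Sum.map₁ f (splitᵏ k i)                         ∎
  where open ≡-Reasoning

-- Partitions of a finite set along a labelling

record Partition {A B : Set} (m : ℕ) (label : Fin m → A ⊎ B) : Set where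
  field
    size₁ size₂   : ℕ
    split         : Fin m → Fin size₁ ⊎ Fin size₂
    unsplit       : Fin size₁ ⊎ Fin size₂ → Fin m
    unsplit-split : ∀ i → unsplit (split i) ≡ i
    split-unsplit : ∀ s → split (unsplit s) ≡ s
    label₁        : Fin size₁ → A
    label₂        : Fin size₂ → B
    label-split   : ∀ i → Sum.map label₁ label₂ (split i) ≡ label i

module _ {A B : Set} {m : ℕ} {label : Fin (suc m) → A ⊎ B} (P : Partition m (label ∘ suc)) where
  open Partition P

  consˡ : ∀ a → label zero ≡ inj₁ a → Partition (suc m) label
  consˡ a eq = record
    { split = split′ ; unsplit = unsplit′ ; unsplit-split = unsplit-split′ ; split-unsplit = split-unsplit′
    ; label₁ = label₁′ ; label₂ = label₂ ; label-split = label-split′ }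
    where
    split′ : Fin (suc m) → Fin (suc size₁) ⊎ Fin size₂
    split′ zero    = inj₁ zero
    split′ (suc i) = Sum.map₁ suc (split i)
    unsplit′ : Fin (suc size₁) ⊎ Fin size₂ → Fin (suc m)
    unsplit′ (inj₁ zero)    = zero
    unsplit′ (inj₁ (suc j)) = suc (unsplit (inj₁ j))
    unsplit′ (inj₂ j)       = suc (unsplit (inj₂ j))
    unsplit′-shift : ∀ s → unsplit′ (Sum.map₁ suc s) ≡ suc (unsplit s)
    unsplit′-shift (inj₁ j) = refl
    unsplit′-shift (inj₂ j) = refl
    unsplit-split′ : ∀ i → unsplit′ (split′ i) ≡ i
    unsplit-split′ zero    = refl
    unsplit-split′ (suc i) = trans (unsplit′-shift (split i)) (cong suc (unsplit-split i))
    split-unsplit′ : ∀ s → split′ (unsplit′ s) ≡ s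
    split-unsplit′ (inj₁ zero)    = refl
    split-unsplit′ (inj₁ (suc j)) = cong (Sum.map₁ suc) (split-unsplit (inj₁ j))
    split-unsplit′ (inj₂ j)       = cong (Sum.map₁ suc) (split-unsplit (inj₂ j))
    label₁′ : Fin (suc size₁) → A
    label₁′ zero    = a
    label₁′ (suc j) = label₁ j
    label-split′ : ∀ i → Sum.map label₁′ label₂ (split′ i) ≡ label i
    label-split′ zero    = sym eq
    label-split′ (suc i) = trans (map-map (split i)) (label-split i)

  consʳ : ∀ b → label zero ≡ inj₂ b → Partition (suc m) label
  consʳ b eq = record
    { split = split′ ; unsplit = unsplit′ ; unsplit-split = unsplit-split′ ; split-unsplit = split-unsplit′
    ; label₁ = label₁ ; label₂ = label₂′ ; label-split = label-split′ }
    where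
    split′ : Fin (suc m) → Fin size₁ ⊎ Fin (suc size₂)
    split′ zero    = inj₂ zero
    split′ (suc i) = Sum.map₂ suc (split i)
    unsplit′ : Fin size₁ ⊎ Fin (suc size₂) → Fin (suc m)
    unsplit′ (inj₂ zero)    = zero
    unsplit′ (inj₂ (suc j)) = suc (unsplit (inj₂ j))
    unsplit′ (inj₁ j)       = suc (unsplit (inj₁ j))
    unsplit′-shift : ∀ s → unsplit′ (Sum.map₂ suc s) ≡ suc (unsplit s)
    unsplit′-shift (inj₁ j) = refl
    unsplit′-shift (inj₂ j) = refl
    unsplit-split′ : ∀ i → unsplit′ (split′ i) ≡ i
    unsplit-split′ zero    = refl
    unsplit-split′ (suc i) = trans (unsplit′-shift (split i)) (cong suc (unsplit-split i))
    split-unsplit′ : ∀ s → split′ (unsplit′ s) ≡ s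
    split-unsplit′ (inj₂ zero)    = refl
    split-unsplit′ (inj₂ (suc j)) = cong (Sum.map₂ suc) (split-unsplit (inj₂ j))
    split-unsplit′ (inj₁ j)       = cong (Sum.map₂ suc) (split-unsplit (inj₁ j))
    label₂′ : Fin (suc size₂) → B
    label₂′ zero    = b
    label₂′ (suc j) = label₂ j
    label-split′ : ∀ i → Sum.map label₁ label₂′ (split′ i) ≡ label i
    label-split′ zero    = sym eq
    label-split′ (suc i) = trans (map-map (split i)) (label-split i)

partition : ∀ {A B : Set} m (label : Fin m → A ⊎ B) → Partition m label
partition zero label = record
  { size₁ = 0 ; size₂ = 0 ; split = λ () ; unsplit = λ { (inj₁ ()) ; (inj₂ ()) } ; unsplit-split = λ ()
  ; split-unsplit = λ { (inj₁ ()) ; (inj₂ ()) } ; label₁ = λ () ; label₂ = λ () ; label-split = λ () }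
partition (suc m) label with label zero in eq
... | inj₁ a = consˡ (partition m (label ∘ suc)) a eq
... | inj₂ b = consʳ (partition m (label ∘ suc)) b eq

-- Coordinates of the structure maps of 𝕊

⊗S-↑ˡ : ∀ {m n m' n'} (f : Surj m n) (g : Surj m' n') (i : Fin m) → fun (f ⊗S g) (i ↑ˡ m') ≡ fun f i ↑ˡ n'
⊗S-↑ˡ f g = ⊗ᶠ-↑ˡ (fun f) (fun g)

⊗S-↑ʳ : ∀ {m n m' n'} (f : Surj m n) (g : Surj m' n') (j : Fin m') → fun (f ⊗S g) (m ↑ʳ j) ≡ n ↑ʳ fun g j
⊗S-↑ʳ f g = ⊗ᶠ-↑ʳ (fun f) (fun g)

surjOfSection : ∀ {m n} (f : Fin m → Fin n) (g : Fin n → Fin m) → (∀ j → f (g j) ≡ j) → Surj m n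
surjOfSection f g e = mkSurj f (λ j → g j , e j)

cast-≡ : ∀ {m n} .(e : m ≡ n) {i : Fin m} {j : Fin n} → toℕ i ≡ toℕ j → cast e i ≡ j
cast-≡ e {i} t = toℕ-injective (trans (toℕ-cast e i) t)

module _ {a b c : ℕ} where
  open ≡-Reasoning

  toℕ-↑ˡ-↑ˡ : (i : Fin a) → toℕ ((i ↑ˡ b) ↑ˡ c) ≡ toℕ (i ↑ˡ (b + c))
  toℕ-↑ˡ-↑ˡ i = trans (toℕ-↑ˡ (i ↑ˡ b) c) (trans (toℕ-↑ˡ i b) (sym (toℕ-↑ˡ i (b + c))))

  toℕ-↑ʳ-↑ˡ : (j : Fin b) → toℕ ((a ↑ʳ j) ↑ˡ c) ≡ toℕ (a ↑ʳ (j ↑ˡ c))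
  toℕ-↑ʳ-↑ˡ j = begin
    toℕ ((a ↑ʳ j) ↑ˡ c)  ≡⟨ toℕ-↑ˡ (a ↑ʳ j) c ⟩
    toℕ (a ↑ʳ j)         ≡⟨ toℕ-↑ʳ a j ⟩
    a + toℕ j            ≡⟨ cong (a +_) (toℕ-↑ˡ j c) ⟨
    a + toℕ (j ↑ˡ c)     ≡⟨ toℕ-↑ʳ a (j ↑ˡ c) ⟨
    toℕ (a ↑ʳ (j ↑ˡ c))  ∎

  toℕ-+-↑ʳ : (l : Fin c) → toℕ ((a + b) ↑ʳ l) ≡ toℕ (a ↑ʳ (b ↑ʳ l))
  toℕ-+-↑ʳ l = begin
    toℕ ((a + b) ↑ʳ l)   ≡⟨ toℕ-↑ʳ (a + b) l ⟩
    (a + b) + toℕ l      ≡⟨ +-assoc a b (toℕ l) ⟩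
    a + (b + toℕ l)      ≡⟨ cong (a +_) (toℕ-↑ʳ b l) ⟨
    a + toℕ (b ↑ʳ l)     ≡⟨ toℕ-↑ʳ a (b ↑ʳ l) ⟨
    toℕ (a ↑ʳ (b ↑ʳ l))  ∎

  module _ .(e : (a + b) + c ≡ a + (b + c)) where
    cast-↑ˡ-↑ˡ : (i : Fin a) → cast e ((i ↑ˡ b) ↑ˡ c) ≡ i ↑ˡ (b + c)
    cast-↑ˡ-↑ˡ i = cast-≡ e (toℕ-↑ˡ-↑ˡ i)

    cast-↑ʳ-↑ˡ : (j : Fin b) → cast e ((a ↑ʳ j) ↑ˡ c) ≡ a ↑ʳ (j ↑ˡ c)
    cast-↑ʳ-↑ˡ j = cast-≡ e (toℕ-↑ʳ-↑ˡ j)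

    cast-+-↑ʳ : (l : Fin c) → cast e ((a + b) ↑ʳ l) ≡ a ↑ʳ (b ↑ʳ l)
    cast-+-↑ʳ l = cast-≡ e (toℕ-+-↑ʳ l)

  module _ .(e : a + (b + c) ≡ (a + b) + c) where
    cast-↑ˡ-↑ˡ⁻¹ : (i : Fin a) → cast e (i ↑ˡ (b + c)) ≡ (i ↑ˡ b) ↑ˡ c
    cast-↑ˡ-↑ˡ⁻¹ i = cast-≡ e (sym (toℕ-↑ˡ-↑ˡ i))

    cast-↑ʳ-↑ˡ⁻¹ : (j : Fin b) → cast e (a ↑ʳ (j ↑ˡ c)) ≡ (a ↑ʳ j) ↑ˡ c
    cast-↑ʳ-↑ˡ⁻¹ j = cast-≡ e (sym (toℕ-↑ʳ-↑ˡ j))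

    cast-+-↑ʳ⁻¹ : (l : Fin c) → cast e (a ↑ʳ (b ↑ʳ l)) ≡ (a + b) ↑ʳ l
    cast-+-↑ʳ⁻¹ l = cast-≡ e (sym (toℕ-+-↑ʳ l))

cast-↑ˡ0 : ∀ {m} .(e : m ≡ m + 0) (i : Fin m) → cast e i ≡ i ↑ˡ 0
cast-↑ˡ0 e i = cast-≡ e (sym (toℕ-↑ˡ i 0))

swapB-↑ˡ : ∀ m n (i : Fin m) → fun (swapB m n) (i ↑ˡ n) ≡ n ↑ʳ i
swapB-↑ˡ m n i = cong (join n m ∘ Sum.swap) (splitAt-↑ˡ m i n)

swapB-↑ʳ : ∀ m n (j : Fin n) → fun (swapB m n) (m ↑ʳ j) ≡ j ↑ˡ m
swapB-↑ʳ m n j = cong (join n m ∘ Sum.swap) (splitAt-↑ʳ m n j)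

∇S-↑ˡ : ∀ n (i : Fin n) → fun (∇S n) (i ↑ˡ n) ≡ i
∇S-↑ˡ n i = cong [ id , id ]′ (splitAt-↑ˡ n i n)

∇S-↑ʳ : ∀ n (i : Fin n) → fun (∇S n) (n ↑ʳ i) ≡ i
∇S-↑ʳ n i = cong [ id , id ]′ (splitAt-↑ʳ n n i)

module _ (a : ℕ) {b c b' c' : ℕ} (h : Surj (b + c) (b' + c')) where

  reassoc : Surj ((a + b) + c) ((a + b') + c')
  reassoc = castS (sym (+-assoc a b' c')) ∘S (idS a ⊗S h) ∘S castS (+-assoc a b c)

  open ≡-Reasoning

  private
    e₁ : (a + b) + c ≡ a + (b + c)
    e₁ = +-assoc a b c
    e₂ : a + (b' + c') ≡ (a + b') + c'
    e₂ = sym (+-assoc a b' c')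

  reassoc-↑ˡ-↑ˡ : (i : Fin a) → fun reassoc ((i ↑ˡ b) ↑ˡ c) ≡ (i ↑ˡ b') ↑ˡ c'
  reassoc-↑ˡ-↑ˡ i = begin
    cast e₂ (fun (idS a ⊗S h) (cast e₁ ((i ↑ˡ b) ↑ˡ c)))  ≡⟨ cong (cast e₂ ∘ fun (idS a ⊗S h)) (cast-↑ˡ-↑ˡ {a} {b} {c} e₁ i) ⟩
    cast e₂ (fun (idS a ⊗S h) (i ↑ˡ (b + c)))             ≡⟨ cong (cast e₂) (⊗ᶠ-↑ˡ (fun (idS a)) (fun h) i) ⟩
    cast e₂ (i ↑ˡ (b' + c'))                           ≡⟨ cast-↑ˡ-↑ˡ⁻¹ {a} {b'} {c'} e₂ i ⟩
    (i ↑ˡ b') ↑ˡ c'                                    ∎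

  reassoc-↑ʳ-↑ˡ : (j : Fin b) → fun reassoc ((a ↑ʳ j) ↑ˡ c) ≡ cast e₂ (a ↑ʳ fun h (j ↑ˡ c))
  reassoc-↑ʳ-↑ˡ j = cong (cast e₂) (trans (cong (fun (idS a ⊗S h)) (cast-↑ʳ-↑ˡ {a} {b} {c} e₁ j)) (⊗ᶠ-↑ʳ (fun (idS a)) (fun h) (j ↑ˡ c)))

  reassoc-+-↑ʳ : (l : Fin c) → fun reassoc ((a + b) ↑ʳ l) ≡ cast e₂ (a ↑ʳ fun h (b ↑ʳ l))
  reassoc-+-↑ʳ l = cong (cast e₂) (trans (cong (fun (idS a ⊗S h)) (cast-+-↑ʳ {a} {b} {c} e₁ l)) (⊗ᶠ-↑ʳ (fun (idS a)) (fun h) (b ↑ʳ l)))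

swapMap-↑ˡ-↑ˡ : ∀ n (i : Fin n) → fun (swapMap n) ((i ↑ˡ 1) ↑ˡ 1) ≡ (i ↑ˡ 1) ↑ˡ 1
swapMap-↑ˡ-↑ˡ n = reassoc-↑ˡ-↑ˡ n sS

swapMap-penultimate : ∀ n → fun (swapMap n) ((n ↑ʳ zero) ↑ˡ 1) ≡ (n + 1) ↑ʳ zero
swapMap-penultimate n = trans (reassoc-↑ʳ-↑ˡ n sS zero) (cast-+-↑ʳ⁻¹ {n} {1} {1} (sym (+-assoc n 1 1)) zero)

swapMap-last : ∀ n → fun (swapMap n) ((n + 1) ↑ʳ zero) ≡ (n ↑ʳ zero) ↑ˡ 1
swapMap-last n = trans (reassoc-+-↑ʳ n sS zero) (cast-↑ʳ-↑ˡ⁻¹ {n} {1} {1} (sym (+-assoc n 1 1)) zero)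

θS-↑ˡ-↑ˡ : ∀ m₁ m₂ (i : Fin m₁) → fun (θS m₁ m₂) ((i ↑ˡ 1) ↑ˡ m₂) ≡ (i ↑ˡ m₂) ↑ˡ 1
θS-↑ˡ-↑ˡ m₁ m₂ = reassoc-↑ˡ-↑ˡ m₁ (swapB 1 m₂)

θS-bound : ∀ m₁ m₂ → fun (θS m₁ m₂) ((m₁ ↑ʳ zero) ↑ˡ m₂) ≡ (m₁ + m₂) ↑ʳ zero
θS-bound m₁ m₂ = begin
  fun (θS m₁ m₂) ((m₁ ↑ʳ zero) ↑ˡ m₂)             ≡⟨ reassoc-↑ʳ-↑ˡ m₁ (swapB 1 m₂) zero ⟩
  cast e (m₁ ↑ʳ fun (swapB 1 m₂) (zero ↑ˡ m₂))    ≡⟨ cong (cast e ∘ (m₁ ↑ʳ_)) (swapB-↑ˡ 1 m₂ zero) ⟩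
  cast e (m₁ ↑ʳ (m₂ ↑ʳ zero))                     ≡⟨ cast-+-↑ʳ⁻¹ {m₁} {m₂} {1} e zero ⟩
  (m₁ + m₂) ↑ʳ zero                               ∎
  where
  open ≡-Reasoning
  e : m₁ + (m₂ + 1) ≡ (m₁ + m₂) + 1
  e = sym (+-assoc m₁ m₂ 1)

θS-↑ʳ : ∀ m₁ m₂ (l : Fin m₂) → fun (θS m₁ m₂) ((m₁ + 1) ↑ʳ l) ≡ (m₁ ↑ʳ l) ↑ˡ 1
θS-↑ʳ m₁ m₂ l = begin
  fun (θS m₁ m₂) ((m₁ + 1) ↑ʳ l)             ≡⟨ reassoc-+-↑ʳ m₁ (swapB 1 m₂) l ⟩
  cast e (m₁ ↑ʳ fun (swapB 1 m₂) (1 ↑ʳ l))   ≡⟨ cong (cast e ∘ (m₁ ↑ʳ_)) (swapB-↑ʳ 1 m₂ l) ⟩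
  cast e (m₁ ↑ʳ (l ↑ˡ 1))                    ≡⟨ cast-↑ʳ-↑ˡ⁻¹ {m₁} {m₂} {1} e l ⟩
  (m₁ ↑ʳ l) ↑ˡ 1                             ∎
  where
  open ≡-Reasoning
  e : m₁ + (m₂ + 1) ≡ (m₁ + m₂) + 1
  e = sym (+-assoc m₁ m₂ 1)

contMap-↑ˡ-↑ˡ : ∀ n (i : Fin n) → fun (contMap n) ((i ↑ˡ 1) ↑ˡ 1) ≡ i ↑ˡ 1
contMap-↑ˡ-↑ˡ n i = trans (cong (fun (idS n ⊗S cS)) (cast-↑ˡ-↑ˡ {n} (+-assoc n 1 1) i)) (⊗ᶠ-↑ˡ (fun (idS n)) (fun cS) i)

contMap-penultimate : ∀ n → fun (contMap n) ((n ↑ʳ zero) ↑ˡ 1) ≡ n ↑ʳ zero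
contMap-penultimate n = trans (cong (fun (idS n ⊗S cS)) (cast-↑ʳ-↑ˡ {n} {1} {1} (+-assoc n 1 1) zero)) (⊗ᶠ-↑ʳ (fun (idS n)) (fun cS) zero)

contMap-last : ∀ n → fun (contMap n) ((n + 1) ↑ʳ zero) ≡ n ↑ʳ zero
contMap-last n = trans (cong (fun (idS n ⊗S cS)) (cast-+-↑ʳ {n} {1} {1} (+-assoc n 1 1) zero)) (⊗ᶠ-↑ʳ (fun (idS n)) (fun cS) (suc zero))

module _ {a b c d n : ℕ} (F : Surj (a + d) n) (f : Surj (b + c) d) where

  assocMap : Surj ((a + b) + c) n
  assocMap = F ∘S (idS a ⊗S f) ∘S castS (+-assoc a b c)

  assocMap-↑ˡ-↑ˡ : (i : Fin a) → fun assocMap ((i ↑ˡ b) ↑ˡ c) ≡ fun F (i ↑ˡ d)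
  assocMap-↑ˡ-↑ˡ i = cong (fun F) (trans (cong (fun (idS a ⊗S f)) (cast-↑ˡ-↑ˡ {a} {b} {c} (+-assoc a b c) i)) (⊗S-↑ˡ (idS a) f i))

  assocMap-↑ʳ-↑ˡ : (j : Fin b) → fun assocMap ((a ↑ʳ j) ↑ˡ c) ≡ fun F (a ↑ʳ fun f (j ↑ˡ c))
  assocMap-↑ʳ-↑ˡ j = cong (fun F) (trans (cong (fun (idS a ⊗S f)) (cast-↑ʳ-↑ˡ {a} {b} {c} (+-assoc a b c) j)) (⊗S-↑ʳ (idS a) f (j ↑ˡ c)))

  assocMap-+-↑ʳ : (l : Fin c) → fun assocMap ((a + b) ↑ʳ l) ≡ fun F (a ↑ʳ fun f (b ↑ʳ l))
  assocMap-+-↑ʳ l = cong (fun F) (trans (cong (fun (idS a ⊗S f)) (cast-+-↑ʳ {a} {b} {c} (+-assoc a b c) l)) (⊗S-↑ʳ (idS a) f (b ↑ʳ l)))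

module _ {m₁ m₂ n : ℕ} (f : Surj (m₁ + m₂) n) where

  strLMap : Surj (m₁ + (m₂ + 1)) (n + 1)
  strLMap = (f ⊗S idS 1) ∘S castS (sym (+-assoc m₁ m₂ 1))

  strLMap-↑ˡ : (i : Fin m₁) → fun strLMap (i ↑ˡ (m₂ + 1)) ≡ fun f (i ↑ˡ m₂) ↑ˡ 1
  strLMap-↑ˡ i = trans (cong (fun (f ⊗S idS 1)) (cast-↑ˡ-↑ˡ⁻¹ {m₁} {m₂} {1} _ i)) (⊗S-↑ˡ f (idS 1) (i ↑ˡ m₂))

  strLMap-↑ʳ-↑ˡ : (j : Fin m₂) → fun strLMap (m₁ ↑ʳ (j ↑ˡ 1)) ≡ fun f (m₁ ↑ʳ j) ↑ˡ 1
  strLMap-↑ʳ-↑ˡ j = trans (cong (fun (f ⊗S idS 1)) (cast-↑ʳ-↑ˡ⁻¹ {m₁} {m₂} {1} _ j)) (⊗S-↑ˡ f (idS 1) (m₁ ↑ʳ j))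

  strLMap-last : fun strLMap (m₁ ↑ʳ (m₂ ↑ʳ zero)) ≡ n ↑ʳ zero
  strLMap-last = trans (cong (fun (f ⊗S idS 1)) (cast-+-↑ʳ⁻¹ {m₁} {m₂} {1} _ zero)) (⊗S-↑ʳ f (idS 1) zero)

  strRMap : Surj ((m₁ + 1) + m₂) (n + 1)
  strRMap = (f ⊗S idS 1) ∘S θS m₁ m₂

  strRMap-↑ˡ-↑ˡ : (i : Fin m₁) → fun strRMap ((i ↑ˡ 1) ↑ˡ m₂) ≡ fun f (i ↑ˡ m₂) ↑ˡ 1
  strRMap-↑ˡ-↑ˡ i = trans (cong (fun (f ⊗S idS 1)) (θS-↑ˡ-↑ˡ m₁ m₂ i)) (⊗S-↑ˡ f (idS 1) (i ↑ˡ m₂))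

  strRMap-bound : fun strRMap ((m₁ ↑ʳ zero) ↑ˡ m₂) ≡ n ↑ʳ zero
  strRMap-bound = trans (cong (fun (f ⊗S idS 1)) (θS-bound m₁ m₂)) (⊗S-↑ʳ f (idS 1) zero)

  strRMap-↑ʳ : (l : Fin m₂) → fun strRMap ((m₁ + 1) ↑ʳ l) ≡ fun f (m₁ ↑ʳ l) ↑ˡ 1
  strRMap-↑ʳ l = trans (cong (fun (f ⊗S idS 1)) (θS-↑ʳ m₁ m₂ l)) (⊗S-↑ˡ f (idS 1) (m₁ ↑ʳ l))

module _ {b c d : ℕ} (f : Surj (b + c) d) where

  -- What strSub makes of f after the diagonal has duplicated the last c variables.
  dupMap : Surj (c + (b + c)) d
  dupMap = assocMap f (∇S c) ∘S ((idS (b + c) ∘S swapB c b) ⊗S idS c) ∘S castS (sym (+-assoc c b c))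

  open ≡-Reasoning

  private
    e : c + (b + c) ≡ (c + b) + c
    e = sym (+-assoc c b c)
    swap⊗id : Surj ((c + b) + c) ((b + c) + c)
    swap⊗id = (idS (b + c) ∘S swapB c b) ⊗S idS c
    g : Fin ((b + c) + c) → Fin d
    g = fun (assocMap f (∇S c))

  dupMap-↑ˡ : (l : Fin c) → fun dupMap (l ↑ˡ (b + c)) ≡ fun f (b ↑ʳ l)
  dupMap-↑ˡ l = begin
    g (fun swap⊗id (cast e (l ↑ˡ (b + c))))  ≡⟨ cong (g ∘ fun swap⊗id) (cast-↑ˡ-↑ˡ⁻¹ {c} {b} {c} e l) ⟩
    g (fun swap⊗id ((l ↑ˡ b) ↑ˡ c))          ≡⟨ cong g (⊗S-↑ˡ (idS (b + c) ∘S swapB c b) (idS c) (l ↑ˡ b)) ⟩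
    g (fun (swapB c b) (l ↑ˡ b) ↑ˡ c)        ≡⟨ cong (g ∘ (_↑ˡ c)) (swapB-↑ˡ c b l) ⟩
    g ((b ↑ʳ l) ↑ˡ c)                        ≡⟨ assocMap-↑ʳ-↑ˡ f (∇S c) l ⟩
    fun f (b ↑ʳ fun (∇S c) (l ↑ˡ c))         ≡⟨ cong (fun f ∘ (b ↑ʳ_)) (∇S-↑ˡ c l) ⟩
    fun f (b ↑ʳ l)                           ∎

  dupMap-↑ʳ : (l : Fin (b + c)) → fun dupMap (c ↑ʳ l) ≡ fun f l
  dupMap-↑ʳ = ≗-split onˡ onʳ
    where
    onˡ : (l : Fin b) → fun dupMap (c ↑ʳ (l ↑ˡ c)) ≡ fun f (l ↑ˡ c)
    onˡ l = begin
      g (fun swap⊗id (cast e (c ↑ʳ (l ↑ˡ c))))  ≡⟨ cong (g ∘ fun swap⊗id) (cast-↑ʳ-↑ˡ⁻¹ {c} {b} {c} e l) ⟩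
      g (fun swap⊗id ((c ↑ʳ l) ↑ˡ c))           ≡⟨ cong g (⊗S-↑ˡ (idS (b + c) ∘S swapB c b) (idS c) (c ↑ʳ l)) ⟩
      g (fun (swapB c b) (c ↑ʳ l) ↑ˡ c)         ≡⟨ cong (g ∘ (_↑ˡ c)) (swapB-↑ʳ c b l) ⟩
      g ((l ↑ˡ c) ↑ˡ c)                         ≡⟨ assocMap-↑ˡ-↑ˡ f (∇S c) l ⟩
      fun f (l ↑ˡ c)                            ∎

    onʳ : (l : Fin c) → fun dupMap (c ↑ʳ (b ↑ʳ l)) ≡ fun f (b ↑ʳ l)
    onʳ l = begin
      g (fun swap⊗id (cast e (c ↑ʳ (b ↑ʳ l))))  ≡⟨ cong (g ∘ fun swap⊗id) (cast-+-↑ʳ⁻¹ {c} {b} {c} e l) ⟩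
      g (fun swap⊗id ((c + b) ↑ʳ l))            ≡⟨ cong g (⊗S-↑ʳ (idS (b + c) ∘S swapB c b) (idS c) l) ⟩
      g ((b + c) ↑ʳ l)                          ≡⟨ assocMap-+-↑ʳ f (∇S c) l ⟩
      fun f (b ↑ʳ fun (∇S c) (c ↑ʳ l))          ≡⟨ cong (fun f ∘ (b ↑ʳ_)) (∇S-↑ʳ c l) ⟩
      fun f (b ↑ʳ l)                            ∎

module _ (a b : ℕ) where

  -- ρ_{δX,X} acts on [z , y , id] through rhoMap.
  rhoMap : Surj ((a + 1) + (b + 1)) ((a + b) + 1)
  rhoMap = contMap (a + b) ∘S strLMap {a + 1} {b} (strRMap {a} {b} (idS (a + b)))

  open ≡-Reasoning

  private
    K : Surj ((a + 1) + b) ((a + b) + 1)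
    K = strRMap {a} {b} (idS (a + b))
    cont : Fin (((a + b) + 1) + 1) → Fin ((a + b) + 1)
    cont = fun (contMap (a + b))
    L : Fin ((a + 1) + (b + 1)) → Fin (((a + b) + 1) + 1)
    L = fun (strLMap {a + 1} {b} K)

  rhoMap-↑ˡ-↑ˡ : (i : Fin a) → fun rhoMap ((i ↑ˡ 1) ↑ˡ (b + 1)) ≡ (i ↑ˡ b) ↑ˡ 1
  rhoMap-↑ˡ-↑ˡ i = begin
    cont (L ((i ↑ˡ 1) ↑ˡ (b + 1)))      ≡⟨ cong cont (strLMap-↑ˡ {a + 1} {b} K (i ↑ˡ 1)) ⟩
    cont (fun K ((i ↑ˡ 1) ↑ˡ b) ↑ˡ 1)   ≡⟨ cong (cont ∘ (_↑ˡ 1)) (strRMap-↑ˡ-↑ˡ {a} {b} (idS (a + b)) i) ⟩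
    cont (((i ↑ˡ b) ↑ˡ 1) ↑ˡ 1)         ≡⟨ contMap-↑ˡ-↑ˡ (a + b) (i ↑ˡ b) ⟩
    (i ↑ˡ b) ↑ˡ 1                       ∎

  rhoMap-penultimate : fun rhoMap ((a ↑ʳ zero) ↑ˡ (b + 1)) ≡ (a + b) ↑ʳ zero
  rhoMap-penultimate = begin
    cont (L ((a ↑ʳ zero) ↑ˡ (b + 1)))     ≡⟨ cong cont (strLMap-↑ˡ {a + 1} {b} K (a ↑ʳ zero)) ⟩
    cont (fun K ((a ↑ʳ zero) ↑ˡ b) ↑ˡ 1)  ≡⟨ cong (cont ∘ (_↑ˡ 1)) (strRMap-bound {a} {b} (idS (a + b))) ⟩
    cont (((a + b) ↑ʳ zero) ↑ˡ 1)         ≡⟨ contMap-penultimate (a + b) ⟩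
    (a + b) ↑ʳ zero                       ∎

  rhoMap-↑ʳ-↑ˡ : (l : Fin b) → fun rhoMap ((a + 1) ↑ʳ (l ↑ˡ 1)) ≡ (a ↑ʳ l) ↑ˡ 1
  rhoMap-↑ʳ-↑ˡ l = begin
    cont (L ((a + 1) ↑ʳ (l ↑ˡ 1)))      ≡⟨ cong cont (strLMap-↑ʳ-↑ˡ {a + 1} {b} K l) ⟩
    cont (fun K ((a + 1) ↑ʳ l) ↑ˡ 1)    ≡⟨ cong (cont ∘ (_↑ˡ 1)) (strRMap-↑ʳ {a} {b} (idS (a + b)) l) ⟩
    cont (((a ↑ʳ l) ↑ˡ 1) ↑ˡ 1)         ≡⟨ contMap-↑ˡ-↑ˡ (a + b) (a ↑ʳ l) ⟩
    (a ↑ʳ l) ↑ˡ 1                       ∎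

  rhoMap-last : fun rhoMap ((a + 1) ↑ʳ (b ↑ʳ zero)) ≡ (a + b) ↑ʳ zero
  rhoMap-last = trans (cong cont (strLMap-last {a + 1} {b} K)) (contMap-last (a + b))

-- Iterated δ

extendS : ∀ k {m n} → Surj m n → Surj (extend k m) (extend k n)
extendS zero    f = f
extendS (suc k) f = extendS k (f ⊗S idS 1)

fun-extendS : ∀ k {m n} (f : Surj m n) → fun (extendS k f) ≗ liftᵏ k (fun f)
fun-extendS zero    f x = refl
fun-extendS (suc k) f x = fun-extendS k (f ⊗S idS 1) x

module _ {X : Psh} where

  fromδ^ : ∀ k {n} → Ob (δ^ k X) n → Ob X (extend k n)
  fromδ^ zero    x = x
  fromδ^ (suc k) {n} x = fromδ^ k {n + 1} x

  toδ^ : ∀ k {n} → Ob X (extend k n) → Ob (δ^ k X) n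
  toδ^ zero    x = x
  toδ^ (suc k) {n} x = toδ^ k {n + 1} x

  fromδ^-toδ^ : ∀ k {n} (x : Ob X (extend k n)) → fromδ^ k (toδ^ k x) ≡ x
  fromδ^-toδ^ zero    x = refl
  fromδ^-toδ^ (suc k) {n} x = fromδ^-toδ^ k {n + 1} x

  fromδ^-Eq : ∀ k {n} {x y : Ob (δ^ k X) n} → Eq (δ^ k X) x y → Eq X (fromδ^ k x) (fromδ^ k y)
  fromδ^-Eq zero    e = e
  fromδ^-Eq (suc k) {n} e = fromδ^-Eq k {n + 1} e

  Eq-fromδ^ : ∀ k {n} {x y : Ob (δ^ k X) n} → Eq X (fromδ^ k x) (fromδ^ k y) → Eq (δ^ k X) x y
  Eq-fromδ^ zero    e = e
  Eq-fromδ^ (suc k) {n} e = Eq-fromδ^ k {n + 1} e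

  fromδ^-act : ∀ k {m n} (f : Surj m n) (x : Ob (δ^ k X) m) → fromδ^ k (act (δ^ k X) f x) ≡ act X (extendS k f) (fromδ^ k x)
  fromδ^-act zero    f x = refl
  fromδ^-act (suc k) f x = fromδ^-act k (f ⊗S idS 1) x

fromδ^-δ^h : ∀ k {X Y : Psh} (h : Hom X Y) {n} (x : Ob (δ^ k X) n) → fromδ^ k (app (δ^h k h) x) ≡ app h (fromδ^ k x)
fromδ^-δ^h zero    h x = refl
fromδ^-δ^h (suc k) h {n} x = fromδ^-δ^h k h {n + 1} x

module Syntax (S : BindingSig) where

  mutual
    data Tm (n : ℕ) : Set where
      var : Fin n → Tm n
      op  : (ω : Op S) → Args (arity S ω) n → Tm n

    data Args : List ℕ → ℕ → Set where
      nil  : ∀ {n} → Args [] n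
      cons : ∀ {k ks n} → Tm (extend k n) → Args ks n → Args (k ∷ ks) n

  mutual
    ren : ∀ {n m} → (Fin n → Fin m) → Tm n → Tm m
    ren f (var i)   = var (f i)
    ren f (op ω as) = op ω (renA f as)

    renA : ∀ {ks n m} → (Fin n → Fin m) → Args ks n → Args ks m
    renA f nil             = nil
    renA f (cons {k} a as) = cons (ren (liftᵏ k f) a) (renA f as)

  wk₁ : ∀ {m} → Fin m → Fin (m + 1)
  wk₁ j = j ↑ˡ 1

  liftSub₁ : ∀ {n m} → (Fin n → Tm m) → Fin (n + 1) → Tm (m + 1)
  liftSub₁ {n} {m} σ x = [ ren wk₁ ∘ σ , var ∘ (m ↑ʳ_) ]′ (splitAt n x)

  liftSubᵏ : ∀ k {n m} → (Fin n → Tm m) → Fin (extend k n) → Tm (extend k m)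
  liftSubᵏ zero    σ = σ
  liftSubᵏ (suc k) σ = liftSubᵏ k (liftSub₁ σ)

  mutual
    sub : ∀ {n m} → (Fin n → Tm m) → Tm n → Tm m
    sub σ (var i)   = σ i
    sub σ (op ω as) = op ω (subA σ as)

    subA : ∀ {ks n m} → (Fin n → Tm m) → Args ks n → Args ks m
    subA σ nil             = nil
    subA σ (cons {k} a as) = cons (sub (liftSubᵏ k σ) a) (subA σ as)

  mutual
    ren-cong : ∀ {n m} {f g : Fin n → Fin m} → f ≗ g → ren f ≗ ren g
    ren-cong e (var i)   = cong var (e i)
    ren-cong e (op ω as) = cong (op ω) (renA-cong e as)

    renA-cong : ∀ {ks n m} {f g : Fin n → Fin m} → f ≗ g → renA {ks} f ≗ renA g
    renA-cong e nil             = refl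
    renA-cong e (cons {k} a as) = cong₂ cons (ren-cong (liftᵏ-cong k e) a) (renA-cong e as)

  mutual
    ren-id : ∀ {n} {f : Fin n → Fin n} → f ≗ id → ren f ≗ id
    ren-id e (var i)   = cong var (e i)
    ren-id e (op ω as) = cong (op ω) (renA-id e as)

    renA-id : ∀ {ks n} {f : Fin n → Fin n} → f ≗ id → renA {ks} f ≗ id
    renA-id e nil             = refl
    renA-id e (cons {k} a as) = cong₂ cons (ren-id (liftᵏ-id k e) a) (renA-id e as)

  mutual
    ren-∘ : ∀ {l n m} (f : Fin n → Fin m) (g : Fin l → Fin n) → ren f ∘ ren g ≗ ren (f ∘ g)
    ren-∘ f g (var i)   = refl
    ren-∘ f g (op ω as) = cong (op ω) (renA-∘ f g as)

    renA-∘ : ∀ {ks l n m} (f : Fin n → Fin m) (g : Fin l → Fin n) → renA {ks} f ∘ renA g ≗ renA (f ∘ g)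
    renA-∘ f g nil             = refl
    renA-∘ f g (cons {k} a as) =
      cong₂ cons (trans (ren-∘ (liftᵏ k f) (liftᵏ k g) a) (ren-cong (liftᵏ-∘ k f g) a)) (renA-∘ f g as)

  liftSub₁-cong : ∀ {n m} {σ τ : Fin n → Tm m} → σ ≗ τ → liftSub₁ σ ≗ liftSub₁ τ
  liftSub₁-cong {n} e x with splitAt n x
  ... | inj₁ a = cong (ren wk₁) (e a)
  ... | inj₂ b = refl

  liftSubᵏ-cong : ∀ k {n m} {σ τ : Fin n → Tm m} → σ ≗ τ → liftSubᵏ k σ ≗ liftSubᵏ k τ
  liftSubᵏ-cong zero    e = e
  liftSubᵏ-cong (suc k) e = liftSubᵏ-cong k (liftSub₁-cong e)

  mutual
    sub-cong : ∀ {n m} {σ τ : Fin n → Tm m} → σ ≗ τ → sub σ ≗ sub τ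
    sub-cong e (var i)   = e i
    sub-cong e (op ω as) = cong (op ω) (subA-cong e as)

    subA-cong : ∀ {ks n m} {σ τ : Fin n → Tm m} → σ ≗ τ → subA {ks} σ ≗ subA τ
    subA-cong e nil             = refl
    subA-cong e (cons {k} a as) = cong₂ cons (sub-cong (liftSubᵏ-cong k e) a) (subA-cong e as)

  liftSub₁-var : ∀ {n m} {σ : Fin n → Tm m} {f : Fin n → Fin m} → σ ≗ var ∘ f → liftSub₁ σ ≗ var ∘ lift₁ f
  liftSub₁-var {n} e x with splitAt n x
  ... | inj₁ a = cong (ren wk₁) (e a)
  ... | inj₂ b = refl

  liftSubᵏ-var : ∀ k {n m} {σ : Fin n → Tm m} {f : Fin n → Fin m} → σ ≗ var ∘ f → liftSubᵏ k σ ≗ var ∘ liftᵏ k f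
  liftSubᵏ-var zero    e = e
  liftSubᵏ-var (suc k) e = liftSubᵏ-var k (liftSub₁-var e)

  mutual
    sub-var : ∀ {n m} {σ : Fin n → Tm m} {f : Fin n → Fin m} → σ ≗ var ∘ f → sub σ ≗ ren f
    sub-var e (var i)   = e i
    sub-var e (op ω as) = cong (op ω) (subA-var e as)

    subA-var : ∀ {ks n m} {σ : Fin n → Tm m} {f : Fin n → Fin m} → σ ≗ var ∘ f → subA {ks} σ ≗ renA f
    subA-var e nil             = refl
    subA-var e (cons {k} a as) = cong₂ cons (sub-var (liftSubᵏ-var k e) a) (subA-var e as)

  liftSub₁-lift₁ : ∀ {l n m} (σ : Fin n → Tm m) (f : Fin l → Fin n) → liftSub₁ σ ∘ lift₁ f ≗ liftSub₁ (σ ∘ f)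
  liftSub₁-lift₁ {l} {n} σ f x with splitAt l x
  ... | inj₁ a rewrite splitAt-↑ˡ n (f a) 1 = refl
  ... | inj₂ b rewrite splitAt-↑ʳ n 1 b = refl

  liftSubᵏ-liftᵏ : ∀ k {l n m} (σ : Fin n → Tm m) (f : Fin l → Fin n) → liftSubᵏ k σ ∘ liftᵏ k f ≗ liftSubᵏ k (σ ∘ f)
  liftSubᵏ-liftᵏ zero    σ f x = refl
  liftSubᵏ-liftᵏ (suc k) σ f x =
    trans (liftSubᵏ-liftᵏ k (liftSub₁ σ) (lift₁ f) x) (liftSubᵏ-cong k (liftSub₁-lift₁ σ f) x)

  mutual
    sub-ren : ∀ {l n m} (σ : Fin n → Tm m) (f : Fin l → Fin n) → sub σ ∘ ren f ≗ sub (σ ∘ f)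
    sub-ren σ f (var i)   = refl
    sub-ren σ f (op ω as) = cong (op ω) (subA-ren σ f as)

    subA-ren : ∀ {ks l n m} (σ : Fin n → Tm m) (f : Fin l → Fin n) → subA {ks} σ ∘ renA f ≗ subA (σ ∘ f)
    subA-ren σ f nil             = refl
    subA-ren σ f (cons {k} a as) =
      cong₂ cons (trans (sub-ren (liftSubᵏ k σ) (liftᵏ k f) a) (sub-cong (liftSubᵏ-liftᵏ k σ f) a)) (subA-ren σ f as)

  ren-liftSub₁ : ∀ {l n m} (f : Fin n → Fin m) (σ : Fin l → Tm n) → ren (lift₁ f) ∘ liftSub₁ σ ≗ liftSub₁ (ren f ∘ σ)
  ren-liftSub₁ {l} {n} f σ x with splitAt l x
  ... | inj₁ a = trans (ren-∘ (lift₁ f) wk₁ (σ a)) (trans (ren-cong (⊗ᶠ-↑ˡ f id) (σ a)) (sym (ren-∘ wk₁ f (σ a))))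
  ... | inj₂ b rewrite splitAt-↑ʳ n 1 b = refl

  ren-liftSubᵏ : ∀ k {l n m} (f : Fin n → Fin m) (σ : Fin l → Tm n) → ren (liftᵏ k f) ∘ liftSubᵏ k σ ≗ liftSubᵏ k (ren f ∘ σ)
  ren-liftSubᵏ zero    f σ x = refl
  ren-liftSubᵏ (suc k) f σ x =
    trans (ren-liftSubᵏ k (lift₁ f) (liftSub₁ σ) x) (liftSubᵏ-cong k (ren-liftSub₁ f σ) x)

  mutual
    ren-sub : ∀ {l n m} (f : Fin n → Fin m) (σ : Fin l → Tm n) → ren f ∘ sub σ ≗ sub (ren f ∘ σ)
    ren-sub f σ (var i)   = refl
    ren-sub f σ (op ω as) = cong (op ω) (renA-sub f σ as)

    renA-sub : ∀ {ks l n m} (f : Fin n → Fin m) (σ : Fin l → Tm n) → renA {ks} f ∘ subA σ ≗ subA (ren f ∘ σ)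
    renA-sub f σ nil             = refl
    renA-sub f σ (cons {k} a as) =
      cong₂ cons (trans (ren-sub (liftᵏ k f) (liftSubᵏ k σ) a) (sub-cong (ren-liftSubᵏ k f σ) a)) (renA-sub f σ as)

  liftSub₁-wk₁ : ∀ {n m} (τ : Fin n → Tm m) (x : Fin n) → liftSub₁ τ (wk₁ x) ≡ ren wk₁ (τ x)
  liftSub₁-wk₁ {n} τ x = cong [ ren wk₁ ∘ τ , _ ]′ (splitAt-↑ˡ n x 1)

  sub-liftSub₁ : ∀ {l n m} (τ : Fin n → Tm m) (σ : Fin l → Tm n) → sub (liftSub₁ τ) ∘ liftSub₁ σ ≗ liftSub₁ (sub τ ∘ σ)
  sub-liftSub₁ {l} {n} τ σ x with splitAt l x
  ... | inj₁ a = trans (sub-ren (liftSub₁ τ) wk₁ (σ a)) (trans (sub-cong (liftSub₁-wk₁ τ) (σ a)) (sym (ren-sub wk₁ τ (σ a))))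
  ... | inj₂ b rewrite splitAt-↑ʳ n 1 b = refl

  sub-liftSubᵏ : ∀ k {l n m} (τ : Fin n → Tm m) (σ : Fin l → Tm n) → sub (liftSubᵏ k τ) ∘ liftSubᵏ k σ ≗ liftSubᵏ k (sub τ ∘ σ)
  sub-liftSubᵏ zero    τ σ x = refl
  sub-liftSubᵏ (suc k) τ σ x =
    trans (sub-liftSubᵏ k (liftSub₁ τ) (liftSub₁ σ) x) (liftSubᵏ-cong k (sub-liftSub₁ τ σ) x)

  mutual
    sub-sub : ∀ {l n m} (τ : Fin n → Tm m) (σ : Fin l → Tm n) → sub τ ∘ sub σ ≗ sub (sub τ ∘ σ)
    sub-sub τ σ (var i)   = refl
    sub-sub τ σ (op ω as) = cong (op ω) (subA-sub τ σ as)

    subA-sub : ∀ {ks l n m} (τ : Fin n → Tm m) (σ : Fin l → Tm n) → subA {ks} τ ∘ subA σ ≗ subA (sub τ ∘ σ)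
    subA-sub τ σ nil             = refl
    subA-sub τ σ (cons {k} a as) =
      cong₂ cons (trans (sub-sub (liftSubᵏ k τ) (liftSubᵏ k σ) a) (sub-cong (sub-liftSubᵏ k τ σ) a)) (subA-sub τ σ as)

  liftSubᵏ-joinᵏ₁ : ∀ k {n m} (σ : Fin n → Tm m) (i : Fin n) → liftSubᵏ k σ (joinᵏ k (inj₁ i)) ≡ ren (joinᵏ k ∘ inj₁) (σ i)
  liftSubᵏ-joinᵏ₁ zero    σ i = sym (ren-id (λ _ → refl) (σ i))
  liftSubᵏ-joinᵏ₁ (suc k) σ i =
    trans (liftSubᵏ-joinᵏ₁ k (liftSub₁ σ) (wk₁ i))
          (trans (cong (ren (joinᵏ k ∘ inj₁)) (liftSub₁-wk₁ σ i)) (ren-∘ _ wk₁ (σ i)))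

  liftSubᵏ-joinᵏ₂ : ∀ k {n m} (σ : Fin n → Tm m) (b : Fin k) → liftSubᵏ k σ (joinᵏ k (inj₂ b)) ≡ var (joinᵏ k (inj₂ b))
  liftSubᵏ-joinᵏ₂ (suc k) {n} {m} σ zero =
    trans (liftSubᵏ-joinᵏ₁ k (liftSub₁ σ) (n ↑ʳ zero)) (cong (ren (joinᵏ k ∘ inj₁)) (cong [ _ , var ∘ (m ↑ʳ_) ]′ (splitAt-↑ʳ n 1 zero)))
  liftSubᵏ-joinᵏ₂ (suc k) σ (suc b) = liftSubᵏ-joinᵏ₂ k (liftSub₁ σ) b

  mutual
    Occurs : ∀ {n} → Fin n → Tm n → Set
    Occurs i (var j)   = j ≡ i
    Occurs i (op ω as) = OccursA i as

    OccursA : ∀ {ks n} → Fin n → Args ks n → Set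
    OccursA i nil             = ⊥
    OccursA i (cons {k} a as) = Occurs (joinᵏ k (inj₁ i)) a ⊎ OccursA i as

  AllOccur : ∀ {n} → Tm n → Set
  AllOccur {n} t = (i : Fin n) → Occurs i t

  mutual
    BindersUsed : ∀ {n} → Tm n → Set
    BindersUsed (var j)   = ⊤
    BindersUsed (op ω as) = BindersUsedA as

    BindersUsedA : ∀ {ks n} → Args ks n → Set
    BindersUsedA nil             = ⊤
    BindersUsedA (cons {k} a as) = BindersUsed a × (∀ b → Occurs (joinᵏ k (inj₂ b)) a) × BindersUsedA as

  mutual
    occurs-ren : ∀ {n m} (f : Fin n → Fin m) {i} t → Occurs i t → Occurs (f i) (ren f t)
    occurs-ren f (var j)   refl = refl
    occurs-ren f (op ω as) o    = occursA-ren f as o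

    occursA-ren : ∀ {ks n m} (f : Fin n → Fin m) {i} (as : Args ks n) → OccursA i as → OccursA (f i) (renA f as)
    occursA-ren f {i} (cons {k} a as) (inj₁ o) =
      inj₁ (subst (λ z → Occurs z (ren (liftᵏ k f) a)) (liftᵏ-joinᵏ k f (inj₁ i)) (occurs-ren (liftᵏ k f) a o))
    occursA-ren f (cons a as) (inj₂ o) = inj₂ (occursA-ren f as o)

  occurs-ren-bound : ∀ k {n m} (f : Fin n → Fin m) (a : Tm (extend k n)) (b : Fin k) →
                     Occurs (joinᵏ k (inj₂ b)) a → Occurs (joinᵏ k (inj₂ b)) (ren (liftᵏ k f) a)
  occurs-ren-bound k f a b o = subst (λ z → Occurs z (ren (liftᵏ k f) a)) (liftᵏ-joinᵏ k f (inj₂ b)) (occurs-ren (liftᵏ k f) a o)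

  mutual
    bindersUsed-ren : ∀ {n m} (f : Fin n → Fin m) t → BindersUsed t → BindersUsed (ren f t)
    bindersUsed-ren f (var j)   w = tt
    bindersUsed-ren f (op ω as) w = bindersUsedA-ren f as w

    bindersUsedA-ren : ∀ {ks n m} (f : Fin n → Fin m) (as : Args ks n) → BindersUsedA as → BindersUsedA (renA f as)
    bindersUsedA-ren f nil w = tt
    bindersUsedA-ren f (cons {k} a as) (w , bound , ws) =
      bindersUsed-ren (liftᵏ k f) a w , (λ b → occurs-ren-bound k f a b (bound b)) , bindersUsedA-ren f as ws

  mutual
    occurs-sub : ∀ {n m} (σ : Fin n → Tm m) {i j} t → Occurs i t → Occurs j (σ i) → Occurs j (sub σ t)
    occurs-sub σ (var i)   refl o = o
    occurs-sub σ (op ω as) o o′   = occursA-sub σ as o o′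

    occursA-sub : ∀ {ks n m} (σ : Fin n → Tm m) {i j} (as : Args ks n) → OccursA i as → Occurs j (σ i) → OccursA j (subA σ as)
    occursA-sub σ {i} {j} (cons {k} a as) (inj₁ o) o′ =
      inj₁ (occurs-sub (liftSubᵏ k σ) a o
             (subst (Occurs (joinᵏ k (inj₁ j))) (sym (liftSubᵏ-joinᵏ₁ k σ i)) (occurs-ren (joinᵏ k ∘ inj₁) (σ i) o′)))
    occursA-sub σ (cons a as) (inj₂ o) o′ = inj₂ (occursA-sub σ as o o′)

  bindersUsed-liftSubᵏ : ∀ k {n m} (σ : Fin n → Tm m) → (∀ i → BindersUsed (σ i)) → ∀ x → BindersUsed (liftSubᵏ k σ x)
  bindersUsed-liftSubᵏ k σ w x = subst (BindersUsed ∘ liftSubᵏ k σ) (joinᵏ-splitᵏ k x) (onJoin (splitᵏ k x))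
    where
    onJoin : ∀ s → BindersUsed (liftSubᵏ k σ (joinᵏ k s))
    onJoin (inj₁ i) = subst BindersUsed (sym (liftSubᵏ-joinᵏ₁ k σ i)) (bindersUsed-ren _ (σ i) (w i))
    onJoin (inj₂ b) = subst BindersUsed (sym (liftSubᵏ-joinᵏ₂ k σ b)) tt

  mutual
    bindersUsed-sub : ∀ {n m} (σ : Fin n → Tm m) t → (∀ i → BindersUsed (σ i)) → BindersUsed t → BindersUsed (sub σ t)
    bindersUsed-sub σ (var i)   w _  = w i
    bindersUsed-sub σ (op ω as) w wt = bindersUsedA-sub σ as w wt

    bindersUsedA-sub : ∀ {ks n m} (σ : Fin n → Tm m) (as : Args ks n) → (∀ i → BindersUsed (σ i)) → BindersUsedA as → BindersUsedA (subA σ as)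
    bindersUsedA-sub σ nil w _ = tt
    bindersUsedA-sub σ (cons {k} a as) w (wa , bound , ws) =
      bindersUsed-sub (liftSubᵏ k σ) a (bindersUsed-liftSubᵏ k σ w) wa
      , (λ b → occurs-sub (liftSubᵏ k σ) a (bound b) (subst (Occurs (joinᵏ k (inj₂ b))) (sym (liftSubᵏ-joinᵏ₂ k σ b)) refl))
      , bindersUsedA-sub σ as w ws

module Plugging (S : BindingSig) where
  open Syntax S
  open ≡-Reasoning

  -- plug Y X F is σ [y , x , F] on terms: X replaces the last variable of Y, and F
  -- places the other variables of Y and those of X.
  plugSub : ∀ {m₁ m₂ n} → Tm m₂ → (Fin (m₁ + m₂) → Fin n) → Fin (m₁ + 1) → Tm n
  plugSub {m₁} {m₂} X F = [ var ∘ F ∘ (_↑ˡ m₂) , (λ _ → ren (F ∘ (m₁ ↑ʳ_)) X) ]′ ∘ splitAt m₁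

  plug : ∀ {m₁ m₂ n} → Tm (m₁ + 1) → Tm m₂ → (Fin (m₁ + m₂) → Fin n) → Tm n
  plug {m₁} Y X F = sub (plugSub {m₁} X F) Y

  module _ {m₁ m₂ n : ℕ} (X : Tm m₂) (F : Fin (m₁ + m₂) → Fin n) where

    plugSub-↑ˡ : (i : Fin m₁) → plugSub {m₁} X F (i ↑ˡ 1) ≡ var (F (i ↑ˡ m₂))
    plugSub-↑ˡ i = cong [ var ∘ F ∘ (_↑ˡ m₂) , _ ]′ (splitAt-↑ˡ m₁ i 1)

    plugSub-last : plugSub {m₁} X F (m₁ ↑ʳ zero) ≡ ren (F ∘ (m₁ ↑ʳ_)) X
    plugSub-last = cong [ _ , (λ _ → ren (F ∘ (m₁ ↑ʳ_)) X) ]′ (splitAt-↑ʳ m₁ 1 zero)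

  plugSub-unique : ∀ {m₁ m₂ n} (X : Tm m₂) (F : Fin (m₁ + m₂) → Fin n) {τ : Fin (m₁ + 1) → Tm n} →
                   (∀ i → τ (i ↑ˡ 1) ≡ var (F (i ↑ˡ m₂))) → τ (m₁ ↑ʳ zero) ≡ ren (F ∘ (m₁ ↑ʳ_)) X → τ ≗ plugSub X F
  plugSub-unique {m₁} X F onˡ onLast = ≗-split (λ i → trans (onˡ i) (sym (plugSub-↑ˡ X F i)))
                                               (λ { zero → trans onLast (sym (plugSub-last {m₁} X F)) })

  plug-cong : ∀ {m₁ m₂ n} (Y : Tm (m₁ + 1)) (X : Tm m₂) {F F′ : Fin (m₁ + m₂) → Fin n} → F ≗ F′ → plug {m₁} Y X F ≡ plug Y X F′
  plug-cong {m₁} Y X {F} {F′} e =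
    sub-cong (plugSub-unique X F′ (λ i → trans (plugSub-↑ˡ X F i) (cong var (e _)))
                                  (trans (plugSub-last {m₁} X F) (ren-cong (e ∘ (m₁ ↑ʳ_)) X))) Y

  plug-renˡ : ∀ {m₁ m₁′ m₂ n} (g : Fin m₁ → Fin m₁′) (Y : Tm (m₁ + 1)) (X : Tm m₂) (F : Fin (m₁′ + m₂) → Fin n) →
              plug {m₁′} (ren (g ⊗ᶠ id) Y) X F ≡ plug {m₁} Y X (F ∘ (g ⊗ᶠ id))
  plug-renˡ {m₁} {m₁′} {m₂} g Y X F = trans (sub-ren (plugSub X F) (g ⊗ᶠ id) Y) (sub-cong (plugSub-unique X (F ∘ (g ⊗ᶠ id)) onˡ onLast) Y)
    where
    onˡ : ∀ i → plugSub X F ((g ⊗ᶠ id) (i ↑ˡ 1)) ≡ var (F ((g ⊗ᶠ id) (i ↑ˡ m₂)))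
    onˡ i = begin
      plugSub X F ((g ⊗ᶠ id) (i ↑ˡ 1))  ≡⟨ cong (plugSub X F) (⊗ᶠ-↑ˡ g id i) ⟩
      plugSub X F (g i ↑ˡ 1)            ≡⟨ plugSub-↑ˡ X F (g i) ⟩
      var (F (g i ↑ˡ m₂))               ≡⟨ cong (var ∘ F) (⊗ᶠ-↑ˡ g id i) ⟨
      var (F ((g ⊗ᶠ id) (i ↑ˡ m₂)))     ∎
    onLast : plugSub X F ((g ⊗ᶠ id) (m₁ ↑ʳ zero)) ≡ ren (F ∘ (g ⊗ᶠ id) ∘ (m₁ ↑ʳ_)) X
    onLast = begin
      plugSub X F ((g ⊗ᶠ id) (m₁ ↑ʳ zero))  ≡⟨ cong (plugSub X F) (⊗ᶠ-↑ʳ g id zero) ⟩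
      plugSub X F (m₁′ ↑ʳ zero)             ≡⟨ plugSub-last {m₁′} X F ⟩
      ren (F ∘ (m₁′ ↑ʳ_)) X                 ≡⟨ ren-cong (cong F ∘ ⊗ᶠ-↑ʳ g id) X ⟨
      ren (F ∘ (g ⊗ᶠ id) ∘ (m₁ ↑ʳ_)) X      ∎

  plug-renʳ : ∀ {m₁ m₂ m₂′ n} (g : Fin m₂ → Fin m₂′) (Y : Tm (m₁ + 1)) (X : Tm m₂) (F : Fin (m₁ + m₂′) → Fin n) →
              plug {m₁} Y (ren g X) F ≡ plug {m₁} Y X (F ∘ (id ⊗ᶠ g))
  plug-renʳ {m₁} {m₂} g Y X F = sub-cong (plugSub-unique X (F ∘ (id ⊗ᶠ g)) onˡ onLast) Y
    where
    onˡ : ∀ i → plugSub {m₁} (ren g X) F (i ↑ˡ 1) ≡ var (F ((id ⊗ᶠ g) (i ↑ˡ m₂)))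
    onˡ i = trans (plugSub-↑ˡ (ren g X) F i) (cong (var ∘ F) (sym (⊗ᶠ-↑ˡ id g i)))
    onLast : plugSub {m₁} (ren g X) F (m₁ ↑ʳ zero) ≡ ren (F ∘ (id ⊗ᶠ g) ∘ (m₁ ↑ʳ_)) X
    onLast = begin
      plugSub {m₁} (ren g X) F (m₁ ↑ʳ zero)  ≡⟨ plugSub-last {m₁} (ren g X) F ⟩
      ren (F ∘ (m₁ ↑ʳ_)) (ren g X)           ≡⟨ ren-∘ (F ∘ (m₁ ↑ʳ_)) g X ⟩
      ren (F ∘ (m₁ ↑ʳ_) ∘ g) X               ≡⟨ ren-cong (cong F ∘ ⊗ᶠ-↑ʳ id g) X ⟨
      ren (F ∘ (id ⊗ᶠ g) ∘ (m₁ ↑ʳ_)) X       ∎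

  ren-plug : ∀ {m₁ m₂ n n′} (f : Fin n → Fin n′) (Y : Tm (m₁ + 1)) (X : Tm m₂) (F : Fin (m₁ + m₂) → Fin n) →
             ren f (plug {m₁} Y X F) ≡ plug {m₁} Y X (f ∘ F)
  ren-plug {m₁} f Y X F = trans (ren-sub f (plugSub X F) Y) (sub-cong (plugSub-unique X (f ∘ F) onˡ onLast) Y)
    where
    onˡ : ∀ i → ren f (plugSub {m₁} X F (i ↑ˡ 1)) ≡ var (f (F (i ↑ˡ _)))
    onˡ i = cong (ren f) (plugSub-↑ˡ X F i)
    onLast : ren f (plugSub {m₁} X F (m₁ ↑ʳ zero)) ≡ ren (f ∘ F ∘ (m₁ ↑ʳ_)) X
    onLast = trans (cong (ren f) (plugSub-last {m₁} X F)) (ren-∘ f _ X)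

  module _ {a b c d n : ℕ} (Y : Tm (a + 1)) (Y′ : Tm (b + 1)) (X : Tm c) (f : Surj (b + c) d) (F : Surj (a + d) n) where
    private
      H : Fin (a + (b + 1)) → Fin ((a + b) + 1)
      H = fun (strLMap {a} {b} (idS (a + b)))
      G : Fin ((a + b) + c) → Fin n
      G = fun (assocMap {a} {b} {c} F f)
      ρG : Fin ((a + b) + 1) → Tm n
      ρG = plugSub {a + b} X G
      Fʳ : Fin d → Fin n
      Fʳ = fun F ∘ (a ↑ʳ_)

    plug-inner : ρG ∘ H ∘ (a ↑ʳ_) ≗ ren Fʳ ∘ plugSub {b} X (fun f)
    plug-inner = ≗-split onˡ λ { zero → onLast }
      where
      onˡ : ∀ j → ρG (H (a ↑ʳ (j ↑ˡ 1))) ≡ ren Fʳ (plugSub {b} X (fun f) (j ↑ˡ 1))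
      onˡ j = begin
        ρG (H (a ↑ʳ (j ↑ˡ 1)))                  ≡⟨ cong ρG (strLMap-↑ʳ-↑ˡ {a} {b} (idS (a + b)) j) ⟩
        ρG ((a ↑ʳ j) ↑ˡ 1)                      ≡⟨ plugSub-↑ˡ X G (a ↑ʳ j) ⟩
        var (G ((a ↑ʳ j) ↑ˡ c))                 ≡⟨ cong var (assocMap-↑ʳ-↑ˡ {a} {b} {c} F f j) ⟩
        var (Fʳ (fun f (j ↑ˡ c)))               ≡⟨ cong (ren Fʳ) (plugSub-↑ˡ X (fun f) j) ⟨
        ren Fʳ (plugSub {b} X (fun f) (j ↑ˡ 1)) ∎
      onLast : ρG (H (a ↑ʳ (b ↑ʳ zero))) ≡ ren Fʳ (plugSub {b} X (fun f) (b ↑ʳ zero))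
      onLast = begin
        ρG (H (a ↑ʳ (b ↑ʳ zero)))                   ≡⟨ cong ρG (strLMap-last {a} {b} (idS (a + b))) ⟩
        ρG ((a + b) ↑ʳ zero)                        ≡⟨ plugSub-last {a + b} X G ⟩
        ren (G ∘ ((a + b) ↑ʳ_)) X                   ≡⟨ ren-cong (assocMap-+-↑ʳ {a} {b} {c} F f) X ⟩
        ren (Fʳ ∘ fun f ∘ (b ↑ʳ_)) X                ≡⟨ ren-∘ Fʳ (fun f ∘ (b ↑ʳ_)) X ⟨
        ren Fʳ (ren (fun f ∘ (b ↑ʳ_)) X)            ≡⟨ cong (ren Fʳ) (plugSub-last {b} X (fun f)) ⟨
        ren Fʳ (plugSub {b} X (fun f) (b ↑ʳ zero))  ∎

    plug-assoc : plug {a + b} (plug {a} Y Y′ H) X G ≡ plug {a} Y (plug {b} Y′ X (fun f)) (fun F)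
    plug-assoc = begin
      sub ρG (sub (plugSub {a} Y′ H) Y)      ≡⟨ sub-sub ρG (plugSub Y′ H) Y ⟩
      sub (sub ρG ∘ plugSub {a} Y′ H) Y      ≡⟨ sub-cong (plugSub-unique (plug {b} Y′ X (fun f)) (fun F) onˡ onLast) Y ⟩
      plug {a} Y (plug {b} Y′ X (fun f)) (fun F) ∎
      where
      onˡ : ∀ i → sub ρG (plugSub {a} Y′ H (i ↑ˡ 1)) ≡ var (fun F (i ↑ˡ d))
      onˡ i = begin
        sub ρG (plugSub {a} Y′ H (i ↑ˡ 1))  ≡⟨ cong (sub ρG) (plugSub-↑ˡ Y′ H i) ⟩
        ρG (H (i ↑ˡ (b + 1)))               ≡⟨ cong ρG (strLMap-↑ˡ {a} {b} (idS (a + b)) i) ⟩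
        ρG ((i ↑ˡ b) ↑ˡ 1)                  ≡⟨ plugSub-↑ˡ X G (i ↑ˡ b) ⟩
        var (G ((i ↑ˡ b) ↑ˡ c))             ≡⟨ cong var (assocMap-↑ˡ-↑ˡ {a} {b} {c} F f i) ⟩
        var (fun F (i ↑ˡ d))                ∎
      onLast : sub ρG (plugSub {a} Y′ H (a ↑ʳ zero)) ≡ ren Fʳ (plug {b} Y′ X (fun f))
      onLast = begin
        sub ρG (plugSub {a} Y′ H (a ↑ʳ zero))       ≡⟨ cong (sub ρG) (plugSub-last {a} Y′ H) ⟩
        sub ρG (ren (H ∘ (a ↑ʳ_)) Y′)               ≡⟨ sub-ren ρG (H ∘ (a ↑ʳ_)) Y′ ⟩
        sub (ρG ∘ H ∘ (a ↑ʳ_)) Y′                   ≡⟨ sub-cong plug-inner Y′ ⟩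
        sub (ren Fʳ ∘ plugSub {b} X (fun f)) Y′     ≡⟨ ren-sub Fʳ (plugSub X (fun f)) Y′ ⟨
        ren Fʳ (plug {b} Y′ X (fun f))              ∎

  -- plugTwice is σ ∘ (δσ ⊗ id) ∘ (str ⊗ id) ∘ assoc⁻¹ on [z , [x , x′ , f] , F]: x replaces the
  -- last and x′ the penultimate variable of z.
  plugTwice : ∀ {a b c d n} → Tm ((a + 1) + 1) → Tm b → Tm c → Surj (b + c) d → Surj (a + d) n → Tm n
  plugTwice {a} {b} Z X X′ f F = plug {a + b} (plug {a + 1} Z X (fun (strRMap {a} {b} (idS (a + b))))) X′ (fun (assocMap {a} {b} F f))

  plugTwiceSub : ∀ {a b c d n} → Tm b → Tm c → Surj (b + c) d → Surj (a + d) n → Fin ((a + 1) + 1) → Tm n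
  plugTwiceSub {a} {b} X X′ f F = sub (plugSub {a + b} X′ (fun (assocMap {a} {b} F f))) ∘ plugSub {a + 1} X (fun (strRMap {a} {b} (idS (a + b))))

  module _ {a b c d n : ℕ} (X : Tm b) (X′ : Tm c) (f : Surj (b + c) d) (F : Surj (a + d) n) where
    private
      K : Fin ((a + 1) + b) → Fin ((a + b) + 1)
      K = fun (strRMap {a} {b} (idS (a + b)))
      G : Fin ((a + b) + c) → Fin n
      G = fun (assocMap {a} {b} {c} F f)
      ρG : Fin ((a + b) + 1) → Tm n
      ρG = plugSub {a + b} X′ G

    plugTwiceSub-↑ˡ-↑ˡ : (i : Fin a) → plugTwiceSub X X′ f F ((i ↑ˡ 1) ↑ˡ 1) ≡ var (fun F (i ↑ˡ d))
    plugTwiceSub-↑ˡ-↑ˡ i = begin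
      sub ρG (plugSub {a + 1} X K ((i ↑ˡ 1) ↑ˡ 1))  ≡⟨ cong (sub ρG) (plugSub-↑ˡ X K (i ↑ˡ 1)) ⟩
      ρG (K ((i ↑ˡ 1) ↑ˡ b))                        ≡⟨ cong ρG (strRMap-↑ˡ-↑ˡ {a} {b} (idS (a + b)) i) ⟩
      ρG ((i ↑ˡ b) ↑ˡ 1)                            ≡⟨ plugSub-↑ˡ X′ G (i ↑ˡ b) ⟩
      var (G ((i ↑ˡ b) ↑ˡ c))                       ≡⟨ cong var (assocMap-↑ˡ-↑ˡ {a} {b} {c} F f i) ⟩
      var (fun F (i ↑ˡ d))                          ∎

    plugTwiceSub-penultimate : plugTwiceSub X X′ f F ((a ↑ʳ zero) ↑ˡ 1) ≡ ren (fun F ∘ (a ↑ʳ_) ∘ fun f ∘ (b ↑ʳ_)) X′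
    plugTwiceSub-penultimate = begin
      sub ρG (plugSub {a + 1} X K ((a ↑ʳ zero) ↑ˡ 1))  ≡⟨ cong (sub ρG) (plugSub-↑ˡ X K (a ↑ʳ zero)) ⟩
      ρG (K ((a ↑ʳ zero) ↑ˡ b))                        ≡⟨ cong ρG (strRMap-bound {a} {b} (idS (a + b))) ⟩
      ρG ((a + b) ↑ʳ zero)                             ≡⟨ plugSub-last {a + b} X′ G ⟩
      ren (G ∘ ((a + b) ↑ʳ_)) X′                       ≡⟨ ren-cong (assocMap-+-↑ʳ {a} {b} {c} F f) X′ ⟩
      ren (fun F ∘ (a ↑ʳ_) ∘ fun f ∘ (b ↑ʳ_)) X′       ∎

    plugTwiceSub-last : plugTwiceSub X X′ f F ((a + 1) ↑ʳ zero) ≡ ren (fun F ∘ (a ↑ʳ_) ∘ fun f ∘ (_↑ˡ c)) X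
    plugTwiceSub-last = begin
      sub ρG (plugSub {a + 1} X K ((a + 1) ↑ʳ zero))  ≡⟨ cong (sub ρG) (plugSub-last {a + 1} X K) ⟩
      sub ρG (ren (K ∘ ((a + 1) ↑ʳ_)) X)              ≡⟨ sub-ren ρG (K ∘ ((a + 1) ↑ʳ_)) X ⟩
      sub (ρG ∘ K ∘ ((a + 1) ↑ʳ_)) X                  ≡⟨ sub-var onVar X ⟩
      ren (fun F ∘ (a ↑ʳ_) ∘ fun f ∘ (_↑ˡ c)) X       ∎
      where
      onVar : ∀ l → ρG (K ((a + 1) ↑ʳ l)) ≡ var (fun F (a ↑ʳ fun f (l ↑ˡ c)))
      onVar l = begin
        ρG (K ((a + 1) ↑ʳ l))            ≡⟨ cong ρG (strRMap-↑ʳ {a} {b} (idS (a + b)) l) ⟩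
        ρG ((a ↑ʳ l) ↑ˡ 1)               ≡⟨ plugSub-↑ˡ X′ G (a ↑ʳ l) ⟩
        var (G ((a ↑ʳ l) ↑ˡ c))          ≡⟨ cong var (assocMap-↑ʳ-↑ˡ {a} {b} {c} F f l) ⟩
        var (fun F (a ↑ʳ fun f (l ↑ˡ c))) ∎

  plugTwice-sub : ∀ {a b c d n} (Z : Tm ((a + 1) + 1)) (X : Tm b) (X′ : Tm c) (f : Surj (b + c) d) (F : Surj (a + d) n) →
                  plugTwice Z X X′ f F ≡ sub (plugTwiceSub {a} X X′ f F) Z
  plugTwice-sub {a} {b} Z X X′ f F = sub-sub (plugSub {a + b} X′ (fun (assocMap {a} {b} F f))) _ Z

  plug-exchange : ∀ {a b c d n} (Z : Tm ((a + 1) + 1)) (X₁ : Tm b) (X₂ : Tm c) (f : Surj (b + c) d) (F : Surj (a + d) n) →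
                  plugTwice Z X₁ X₂ f F ≡ plugTwice (ren (fun (swapMap a)) Z) X₂ X₁ (f ∘S swapB c b) F
  plug-exchange {a} {b} {c} {d} Z X₁ X₂ f F = begin
    plugTwice Z X₁ X₂ f F                     ≡⟨ plugTwice-sub Z X₁ X₂ f F ⟩
    sub τ Z                                   ≡⟨ sub-cong (≗-split₂ onˡ onPenultimate onLast) Z ⟩
    sub (τ′ ∘ sw) Z                           ≡⟨ sub-ren τ′ sw Z ⟨
    sub τ′ (ren sw Z)                         ≡⟨ plugTwice-sub (ren sw Z) X₂ X₁ (f ∘S swapB c b) F ⟨
    plugTwice (ren sw Z) X₂ X₁ (f ∘S swapB c b) F ∎
    where
    sw : Fin ((a + 1) + 1) → Fin ((a + 1) + 1)
    sw = fun (swapMap a)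
    τ τ′ : Fin ((a + 1) + 1) → Tm _
    τ  = plugTwiceSub {a} X₁ X₂ f F
    τ′ = plugTwiceSub {a} X₂ X₁ (f ∘S swapB c b) F
    onˡ : ∀ i → τ ((i ↑ˡ 1) ↑ˡ 1) ≡ τ′ (sw ((i ↑ˡ 1) ↑ˡ 1))
    onˡ i = begin
      τ ((i ↑ˡ 1) ↑ˡ 1)        ≡⟨ plugTwiceSub-↑ˡ-↑ˡ X₁ X₂ f F i ⟩
      var (fun F (i ↑ˡ d))     ≡⟨ plugTwiceSub-↑ˡ-↑ˡ X₂ X₁ (f ∘S swapB c b) F i ⟨
      τ′ ((i ↑ˡ 1) ↑ˡ 1)       ≡⟨ cong τ′ (swapMap-↑ˡ-↑ˡ a i) ⟨
      τ′ (sw ((i ↑ˡ 1) ↑ˡ 1))  ∎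
    onPenultimate : τ ((a ↑ʳ zero) ↑ˡ 1) ≡ τ′ (sw ((a ↑ʳ zero) ↑ˡ 1))
    onPenultimate = begin
      τ ((a ↑ʳ zero) ↑ˡ 1)                                           ≡⟨ plugTwiceSub-penultimate X₁ X₂ f F ⟩
      ren (fun F ∘ (a ↑ʳ_) ∘ fun f ∘ (b ↑ʳ_)) X₂                     ≡⟨ ren-cong (cong (fun F ∘ (a ↑ʳ_) ∘ fun f) ∘ swapB-↑ˡ c b) X₂ ⟨
      ren (fun F ∘ (a ↑ʳ_) ∘ fun (f ∘S swapB c b) ∘ (_↑ˡ b)) X₂      ≡⟨ plugTwiceSub-last X₂ X₁ (f ∘S swapB c b) F ⟨
      τ′ ((a + 1) ↑ʳ zero)                                           ≡⟨ cong τ′ (swapMap-penultimate a) ⟨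
      τ′ (sw ((a ↑ʳ zero) ↑ˡ 1))                                     ∎
    onLast : τ ((a + 1) ↑ʳ zero) ≡ τ′ (sw ((a + 1) ↑ʳ zero))
    onLast = begin
      τ ((a + 1) ↑ʳ zero)                                            ≡⟨ plugTwiceSub-last X₁ X₂ f F ⟩
      ren (fun F ∘ (a ↑ʳ_) ∘ fun f ∘ (_↑ˡ c)) X₁                     ≡⟨ ren-cong (cong (fun F ∘ (a ↑ʳ_) ∘ fun f) ∘ swapB-↑ʳ c b) X₁ ⟨
      ren (fun F ∘ (a ↑ʳ_) ∘ fun (f ∘S swapB c b) ∘ (c ↑ʳ_)) X₁      ≡⟨ plugTwiceSub-penultimate X₂ X₁ (f ∘S swapB c b) F ⟨
      τ′ ((a ↑ʳ zero) ↑ˡ 1)                                          ≡⟨ cong τ′ (swapMap-last a) ⟨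
      τ′ (sw ((a + 1) ↑ʳ zero))                                      ∎

  module _ {a b c d n : ℕ} (Y : Tm (b + 1)) (X : Tm c) (f : Surj (b + c) d) (F : Surj (a + d) n) where
    private
      G : Fin ((a + b) + c) → Fin n
      G = fun (assocMap {a} {b} {c} F f)
      ρG : Fin ((a + b) + 1) → Tm n
      ρG = plugSub {a + b} X G

    contractSub : Fin ((a + 1) + 1) → Tm n
    contractSub = sub ρG ∘ plugSub {a + 1} Y (fun (rhoMap a b))

    contractSub-↑ˡ-↑ˡ : (i : Fin a) → contractSub ((i ↑ˡ 1) ↑ˡ 1) ≡ var (fun F (i ↑ˡ d))
    contractSub-↑ˡ-↑ˡ i = begin
      sub ρG (plugSub {a + 1} Y (fun (rhoMap a b)) ((i ↑ˡ 1) ↑ˡ 1))  ≡⟨ cong (sub ρG) (plugSub-↑ˡ Y (fun (rhoMap a b)) (i ↑ˡ 1)) ⟩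
      ρG (fun (rhoMap a b) ((i ↑ˡ 1) ↑ˡ (b + 1)))                    ≡⟨ cong ρG (rhoMap-↑ˡ-↑ˡ a b i) ⟩
      ρG ((i ↑ˡ b) ↑ˡ 1)                                             ≡⟨ plugSub-↑ˡ X G (i ↑ˡ b) ⟩
      var (G ((i ↑ˡ b) ↑ˡ c))                                        ≡⟨ cong var (assocMap-↑ˡ-↑ˡ {a} {b} F f i) ⟩
      var (fun F (i ↑ˡ d))                                           ∎

    contractSub-penultimate : contractSub ((a ↑ʳ zero) ↑ˡ 1) ≡ ren (fun F ∘ (a ↑ʳ_) ∘ fun f ∘ (b ↑ʳ_)) X
    contractSub-penultimate = begin
      sub ρG (plugSub {a + 1} Y (fun (rhoMap a b)) ((a ↑ʳ zero) ↑ˡ 1))  ≡⟨ cong (sub ρG) (plugSub-↑ˡ Y (fun (rhoMap a b)) (a ↑ʳ zero)) ⟩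
      ρG (fun (rhoMap a b) ((a ↑ʳ zero) ↑ˡ (b + 1)))                    ≡⟨ cong ρG (rhoMap-penultimate a b) ⟩
      ρG ((a + b) ↑ʳ zero)                                              ≡⟨ plugSub-last {a + b} X G ⟩
      ren (G ∘ ((a + b) ↑ʳ_)) X                                         ≡⟨ ren-cong (assocMap-+-↑ʳ {a} {b} F f) X ⟩
      ren (fun F ∘ (a ↑ʳ_) ∘ fun f ∘ (b ↑ʳ_)) X                         ∎

    contractSub-last : contractSub ((a + 1) ↑ʳ zero) ≡ plug {b} Y X (fun F ∘ (a ↑ʳ_) ∘ fun f)
    contractSub-last = begin
      sub ρG (plugSub {a + 1} Y (fun (rhoMap a b)) ((a + 1) ↑ʳ zero))  ≡⟨ cong (sub ρG) (plugSub-last {a + 1} Y (fun (rhoMap a b))) ⟩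
      sub ρG (ren (fun (rhoMap a b) ∘ ((a + 1) ↑ʳ_)) Y)                ≡⟨ sub-ren ρG _ Y ⟩
      sub (ρG ∘ fun (rhoMap a b) ∘ ((a + 1) ↑ʳ_)) Y                    ≡⟨ sub-cong (plugSub-unique X (fun F ∘ (a ↑ʳ_) ∘ fun f) onˡ onLast) Y ⟩
      plug {b} Y X (fun F ∘ (a ↑ʳ_) ∘ fun f)                           ∎
      where
      onˡ : ∀ l → ρG (fun (rhoMap a b) ((a + 1) ↑ʳ (l ↑ˡ 1))) ≡ var (fun F (a ↑ʳ fun f (l ↑ˡ c)))
      onˡ l = begin
        ρG (fun (rhoMap a b) ((a + 1) ↑ʳ (l ↑ˡ 1)))  ≡⟨ cong ρG (rhoMap-↑ʳ-↑ˡ a b l) ⟩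
        ρG ((a ↑ʳ l) ↑ˡ 1)                           ≡⟨ plugSub-↑ˡ X G (a ↑ʳ l) ⟩
        var (G ((a ↑ʳ l) ↑ˡ c))                      ≡⟨ cong var (assocMap-↑ʳ-↑ˡ {a} {b} F f l) ⟩
        var (fun F (a ↑ʳ fun f (l ↑ˡ c)))            ∎
      onLast : ρG (fun (rhoMap a b) ((a + 1) ↑ʳ (b ↑ʳ zero))) ≡ ren (fun F ∘ (a ↑ʳ_) ∘ fun f ∘ (b ↑ʳ_)) X
      onLast = begin
        ρG (fun (rhoMap a b) ((a + 1) ↑ʳ (b ↑ʳ zero)))  ≡⟨ cong ρG (rhoMap-last a b) ⟩
        ρG ((a + b) ↑ʳ zero)                            ≡⟨ plugSub-last {a + b} X G ⟩
        ren (G ∘ ((a + b) ↑ʳ_)) X                       ≡⟨ ren-cong (assocMap-+-↑ʳ {a} {b} F f) X ⟩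
        ren (fun F ∘ (a ↑ʳ_) ∘ fun f ∘ (b ↑ʳ_)) X       ∎

  plug-contract : ∀ {a b c d n} (Z : Tm ((a + 1) + 1)) (Y : Tm (b + 1)) (X : Tm c) (f : Surj (b + c) d) (F : Surj (a + d) n) →
                  plug {a + b} (plug {a + 1} Z Y (fun (rhoMap a b))) X (fun (assocMap {a} {b} F f))
                  ≡ plugTwice (ren (fun (swapMap a)) Z) X (plug {b} Y X id) (dupMap {b} {c} f) F
  plug-contract {a} {b} {c} {d} Z Y X f F = begin
    plug {a + b} (plug {a + 1} Z Y (fun (rhoMap a b))) X (fun (assocMap {a} {b} F f))
                                            ≡⟨ sub-sub (plugSub {a + b} X (fun (assocMap {a} {b} F f))) _ Z ⟩
    sub (contractSub {a} Y X f F) Z         ≡⟨ sub-cong (≗-split₂ onˡ onPenultimate onLast) Z ⟩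
    sub (τ ∘ sw) Z                          ≡⟨ sub-ren τ sw Z ⟨
    sub τ (ren sw Z)                        ≡⟨ plugTwice-sub (ren sw Z) X W (dupMap {b} {c} f) F ⟨
    plugTwice (ren sw Z) X W (dupMap {b} {c} f) F ∎
    where
    sw : Fin ((a + 1) + 1) → Fin ((a + 1) + 1)
    sw = fun (swapMap a)
    W : Tm (b + c)
    W = plug {b} Y X id
    τ : Fin ((a + 1) + 1) → Tm _
    τ = plugTwiceSub {a} X W (dupMap {b} {c} f) F
    onˡ : ∀ i → contractSub Y X f F ((i ↑ˡ 1) ↑ˡ 1) ≡ τ (sw ((i ↑ˡ 1) ↑ˡ 1))
    onˡ i = begin
      contractSub Y X f F ((i ↑ˡ 1) ↑ˡ 1)  ≡⟨ contractSub-↑ˡ-↑ˡ Y X f F i ⟩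
      var (fun F (i ↑ˡ d))                 ≡⟨ plugTwiceSub-↑ˡ-↑ˡ X W (dupMap {b} {c} f) F i ⟨
      τ ((i ↑ˡ 1) ↑ˡ 1)                    ≡⟨ cong τ (swapMap-↑ˡ-↑ˡ a i) ⟨
      τ (sw ((i ↑ˡ 1) ↑ˡ 1))               ∎
    onPenultimate : contractSub Y X f F ((a ↑ʳ zero) ↑ˡ 1) ≡ τ (sw ((a ↑ʳ zero) ↑ˡ 1))
    onPenultimate = begin
      contractSub Y X f F ((a ↑ʳ zero) ↑ˡ 1)                             ≡⟨ contractSub-penultimate Y X f F ⟩
      ren (fun F ∘ (a ↑ʳ_) ∘ fun f ∘ (b ↑ʳ_)) X                           ≡⟨ ren-cong (cong (fun F ∘ (a ↑ʳ_)) ∘ dupMap-↑ˡ {b} {c} f) X ⟨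
      ren (fun F ∘ (a ↑ʳ_) ∘ fun (dupMap {b} {c} f) ∘ (_↑ˡ (b + c))) X   ≡⟨ plugTwiceSub-last X W (dupMap {b} {c} f) F ⟨
      τ ((a + 1) ↑ʳ zero)                                                ≡⟨ cong τ (swapMap-penultimate a) ⟨
      τ (sw ((a ↑ʳ zero) ↑ˡ 1))                                          ∎
    onLast : contractSub Y X f F ((a + 1) ↑ʳ zero) ≡ τ (sw ((a + 1) ↑ʳ zero))
    onLast = begin
      contractSub Y X f F ((a + 1) ↑ʳ zero)                          ≡⟨ contractSub-last Y X f F ⟩
      plug {b} Y X (fun F ∘ (a ↑ʳ_) ∘ fun f)                         ≡⟨ plug-cong Y X (cong (fun F ∘ (a ↑ʳ_)) ∘ dupMap-↑ʳ {b} {c} f) ⟨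
      plug {b} Y X (fun F ∘ (a ↑ʳ_) ∘ fun (dupMap {b} {c} f) ∘ (c ↑ʳ_)) ≡⟨ ren-plug _ Y X id ⟨
      ren (fun F ∘ (a ↑ʳ_) ∘ fun (dupMap {b} {c} f) ∘ (c ↑ʳ_)) W     ≡⟨ plugTwiceSub-penultimate X W (dupMap {b} {c} f) F ⟨
      τ ((a ↑ʳ zero) ↑ˡ 1)                                           ≡⟨ cong τ (swapMap-last a) ⟨
      τ (sw ((a + 1) ↑ʳ zero))                                       ∎

module RelevantTerms (S : BindingSig) where
  open Syntax S
  open Plugging S

  record RTm (n : ℕ) : Set where
    constructor rtm
    field
      tm          : Tm n
      allOccur    : AllOccur tm
      bindersUsed : BindersUsed tm
  open RTm public

  renR : ∀ {m n} → Surj m n → RTm m → RTm n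
  renR f (rtm t occ used) = rtm (ren (fun f) t) occ′ (bindersUsed-ren (fun f) t used)
    where
    occ′ : AllOccur (ren (fun f) t)
    occ′ j with surj f j
    ... | i , e = subst (λ z → Occurs z (ren (fun f) t)) e (occurs-ren (fun f) t (occ i))

  RTmPsh : Psh
  Ob  RTmPsh = RTm
  Eq  RTmPsh u v = tm u ≡ tm v
  act RTmPsh = renR

  RTmPsh-isPsh : IsPsh RTmPsh
  RTmPsh-isPsh = record
    { isEquiv  = record { refl = refl ; sym = sym ; trans = trans }
    ; act-cong = λ {_} {_} {f} {g} {x} e x≡y → trans (ren-cong e (tm x)) (cong (ren (fun g)) x≡y)
    ; act-id   = λ x → ren-id (λ _ → refl) (tm x)
    ; act-∘    = λ f g x → sym (ren-∘ (fun g) (fun f) (tm x))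
    }

  tmᵏ : ∀ k {n} → Ob (δ^ k RTmPsh) n → Tm (extend k n)
  tmᵏ k u = tm (fromδ^ k u)

  tmᵏ-act : ∀ k {m n} (g : Surj m n) (x : Ob (δ^ k RTmPsh) m) → tmᵏ k (act (δ^ k RTmPsh) g x) ≡ ren (liftᵏ k (fun g)) (tmᵏ k x)
  tmᵏ-act k g x = trans (cong tm (fromδ^-act k g x)) (ren-cong (fun-extendS k g) (tmᵏ k x))

  toArgs : ∀ ks {m n} → Ob (prodΣ ks RTmPsh) m → (Fin m → Fin n) → Args ks n
  toArgs []           u ρ = nil
  toArgs (k ∷ [])     u ρ = cons (ren (liftᵏ k ρ) (tmᵏ k u)) nil
  toArgs (k ∷ l ∷ ks) (⟨_,_,_⟩ {m₁} {m₂} a r F) ρ =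
    cons (ren (liftᵏ k (ρ ∘ fun F ∘ (_↑ˡ m₂))) (tmᵏ k a)) (toArgs (l ∷ ks) r (ρ ∘ fun F ∘ (m₁ ↑ʳ_)))

  toArgs-≗ : ∀ ks {m n} (u : Ob (prodΣ ks RTmPsh) m) {ρ ρ′ : Fin m → Fin n} → ρ ≗ ρ′ → toArgs ks u ρ ≡ toArgs ks u ρ′
  toArgs-≗ []           u e = refl
  toArgs-≗ (k ∷ [])     u e = cong (λ z → cons z nil) (ren-cong (liftᵏ-cong k e) (tmᵏ k u))
  toArgs-≗ (k ∷ l ∷ ks) (⟨_,_,_⟩ {m₁} {m₂} a r F) e =
    cong₂ cons (ren-cong (liftᵏ-cong k (e ∘ fun F ∘ (_↑ˡ m₂))) (tmᵏ k a)) (toArgs-≗ (l ∷ ks) r (e ∘ fun F ∘ (m₁ ↑ʳ_)))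

  renA-toArgs : ∀ ks {m n n′} (u : Ob (prodΣ ks RTmPsh) m) (ρ : Fin m → Fin n) (f : Fin n → Fin n′) →
                renA f (toArgs ks u ρ) ≡ toArgs ks u (f ∘ ρ)
  renA-toArgs [] u ρ f = refl
  renA-toArgs (k ∷ []) u ρ f =
    cong (λ z → cons z nil) (trans (ren-∘ (liftᵏ k f) (liftᵏ k ρ) (tmᵏ k u)) (ren-cong (liftᵏ-∘ k f ρ) (tmᵏ k u)))
  renA-toArgs (k ∷ l ∷ ks) (⟨_,_,_⟩ a r F) ρ f =
    cong₂ cons (trans (ren-∘ (liftᵏ k f) _ (tmᵏ k a)) (ren-cong (liftᵏ-∘ k f _) (tmᵏ k a))) (renA-toArgs (l ∷ ks) r _ f)

  toArgs-act : ∀ ks {l m n} (f : Surj l m) (u : Ob (prodΣ ks RTmPsh) l) (ρ : Fin m → Fin n) →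
               toArgs ks (act (prodΣ ks RTmPsh) f u) ρ ≡ toArgs ks u (ρ ∘ fun f)
  toArgs-act [] f u ρ = refl
  toArgs-act (k ∷ []) f u ρ = cong (λ z → cons z nil) (begin
    ren (liftᵏ k ρ) (tmᵏ k (act (δ^ k RTmPsh) f u))    ≡⟨ cong (ren (liftᵏ k ρ)) (tmᵏ-act k f u) ⟩
    ren (liftᵏ k ρ) (ren (liftᵏ k (fun f)) (tmᵏ k u))  ≡⟨ ren-∘ (liftᵏ k ρ) _ (tmᵏ k u) ⟩
    ren (liftᵏ k ρ ∘ liftᵏ k (fun f)) (tmᵏ k u)        ≡⟨ ren-cong (liftᵏ-∘ k ρ (fun f)) (tmᵏ k u) ⟩
    ren (liftᵏ k (ρ ∘ fun f)) (tmᵏ k u)                ∎)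
    where open ≡-Reasoning
  toArgs-act (k ∷ l ∷ ks) f (⟨_,_,_⟩ a r F) ρ = refl

  toArgs-resp-Eq : ∀ ks {m n} {u u′ : Ob (prodΣ ks RTmPsh) m} → Eq (prodΣ ks RTmPsh) u u′ → (ρ : Fin m → Fin n) →
                   toArgs ks u ρ ≡ toArgs ks u′ ρ
  toArgs-resp-Eq [] e ρ = refl
  toArgs-resp-Eq (k ∷ []) e ρ = cong (λ z → cons (ren (liftᵏ k ρ) z) nil) (fromδ^-Eq k e)
  toArgs-resp-Eq (k ∷ l ∷ ks) d-refl ρ = refl
  toArgs-resp-Eq (k ∷ l ∷ ks) (d-sym e) ρ = sym (toArgs-resp-Eq (k ∷ l ∷ ks) e ρ)
  toArgs-resp-Eq (k ∷ l ∷ ks) (d-trans e e′) ρ = trans (toArgs-resp-Eq (k ∷ l ∷ ks) e ρ) (toArgs-resp-Eq (k ∷ l ∷ ks) e′ ρ)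
  toArgs-resp-Eq (k ∷ l ∷ ks) (d-cong {m₁} {m₂} {x' = x′} {y' = y′} ex ey ef) ρ =
    cong₂ cons (trans (cong (ren _) (fromδ^-Eq k ex)) (ren-cong (liftᵏ-cong k (cong ρ ∘ ef ∘ (_↑ˡ m₂))) (tmᵏ k x′)))
               (trans (toArgs-resp-Eq (l ∷ ks) ey _) (toArgs-≗ (l ∷ ks) y′ (cong ρ ∘ ef ∘ (m₁ ↑ʳ_))))
  toArgs-resp-Eq (k ∷ l ∷ ks) (d-left {m₁} {m₂ = m₂} g x y f) ρ =
    cong₂ cons (trans (cong (ren _) (tmᵏ-act k g x))
                 (trans (ren-∘ _ _ (tmᵏ k x))
                   (ren-cong (λ z → trans (liftᵏ-∘ k _ _ z) (liftᵏ-cong k (λ i → cong (ρ ∘ fun f) (sym (⊗S-↑ˡ g (idS m₂) i))) z)) (tmᵏ k x))))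
               (toArgs-≗ (l ∷ ks) y (λ j → cong (ρ ∘ fun f) (sym (⊗S-↑ʳ g (idS m₂) j))))
  toArgs-resp-Eq (k ∷ l ∷ ks) (d-right {m₁} g x y f) ρ =
    cong₂ cons (ren-cong (liftᵏ-cong k (λ i → cong (ρ ∘ fun f) (sym (⊗S-↑ˡ (idS m₁) g i)))) (tmᵏ k x))
               (trans (toArgs-act (l ∷ ks) g y _) (toArgs-≗ (l ∷ ks) y (λ j → cong (ρ ∘ fun f) (sym (⊗S-↑ʳ (idS m₁) g j)))))

  body-allOccur : ∀ k {m n} (a : Ob (δ^ k RTmPsh) m) (ρ : Fin m → Fin n) (i : Fin m) →
                  Occurs (joinᵏ k (inj₁ (ρ i))) (ren (liftᵏ k ρ) (tmᵏ k a))
  body-allOccur k a ρ i =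
    subst (λ z → Occurs z (ren (liftᵏ k ρ) (tmᵏ k a))) (liftᵏ-joinᵏ k ρ (inj₁ i)) (occurs-ren (liftᵏ k ρ) (tmᵏ k a) (allOccur (fromδ^ k a) _))

  body-bindersUsed : ∀ k {m n} (a : Ob (δ^ k RTmPsh) m) (ρ : Fin m → Fin n) →
                     BindersUsed (ren (liftᵏ k ρ) (tmᵏ k a)) × (∀ b → Occurs (joinᵏ k (inj₂ b)) (ren (liftᵏ k ρ) (tmᵏ k a)))
  body-bindersUsed k a ρ =
    bindersUsed-ren (liftᵏ k ρ) (tmᵏ k a) (bindersUsed (fromδ^ k a)) , λ b → occurs-ren-bound k ρ (tmᵏ k a) b (allOccur (fromδ^ k a) _)

  cons-allOccur : ∀ k {l ks m₁ m₂ m n} (a : Ob (δ^ k RTmPsh) m₁) (r : Ob (prodΣ (l ∷ ks) RTmPsh) m₂)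
                  (F : Surj (m₁ + m₂) m) (ρ : Fin m → Fin n) →
                  (∀ i → OccursA (ρ (fun F (m₁ ↑ʳ i))) (toArgs (l ∷ ks) r (ρ ∘ fun F ∘ (m₁ ↑ʳ_)))) →
                  ∀ j → OccursA (ρ j) (toArgs (k ∷ l ∷ ks) ⟨ a , r , F ⟩ ρ)
  cons-allOccur k {m₁ = m₁} {m₂} a r F ρ rest j with surj F j
  ... | x , refl with splitView m₁ m₂ x
  ...   | inL i = inj₁ (body-allOccur k a _ i)
  ...   | inR i = inj₂ (rest i)

  toArgs-allOccur : ∀ ks {m n} (u : Ob (prodΣ ks RTmPsh) m) (ρ : Fin m → Fin n) (j : Fin m) → OccursA (ρ j) (toArgs ks u ρ)
  toArgs-allOccur [] u ρ j with surj u j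
  ... | () , _
  toArgs-allOccur (k ∷ []) u ρ j = inj₁ (body-allOccur k u ρ j)
  toArgs-allOccur (k ∷ l ∷ ks) (⟨_,_,_⟩ {m₁} a r F) ρ =
    cons-allOccur k a r F ρ (toArgs-allOccur (l ∷ ks) r (ρ ∘ fun F ∘ (m₁ ↑ʳ_)))

  toArgs-bindersUsed : ∀ ks {m n} (u : Ob (prodΣ ks RTmPsh) m) (ρ : Fin m → Fin n) → BindersUsedA (toArgs ks u ρ)
  toArgs-bindersUsed [] u ρ = tt
  toArgs-bindersUsed (k ∷ []) u ρ = proj₁ (body-bindersUsed k u ρ) , proj₂ (body-bindersUsed k u ρ) , tt
  toArgs-bindersUsed (k ∷ l ∷ ks) (⟨_,_,_⟩ a r F) ρ =
    proj₁ (body-bindersUsed k a _) , proj₂ (body-bindersUsed k a _) , toArgs-bindersUsed (l ∷ ks) r _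

  var-allOccur : ∀ {n} (v : Surj 1 n) → AllOccur (var (fun v zero))
  var-allOccur v i with surj v i
  ... | zero , e = e

  opR : ∀ {n} ω → Ob (prodΣ (arity S ω) RTmPsh) n → RTm n
  opR ω u = rtm (op ω (toArgs (arity S ω) u id)) (toArgs-allOccur (arity S ω) u id) (toArgs-bindersUsed (arity S ω) u id)

  syntaxAlg : Hom (V ⊕ ΣF S RTmPsh) RTmPsh
  syntaxAlg = mkHom λ where
    (inj₁ v)       → rtm (var (fun v zero)) (var-allOccur v) tt
    (inj₂ (ω , u)) → opR ω u

  syntaxAlg-isHom : IsHom syntaxAlg
  syntaxAlg-isHom = record { hom-cong = respects ; hom-nat = natural }
    where
    respects : ∀ {n} {x y : Ob (V ⊕ ΣF S RTmPsh) n} → Eq (V ⊕ ΣF S RTmPsh) x y → tm (app syntaxAlg x) ≡ tm (app syntaxAlg y)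
    respects (PW.inj₁ e)            = cong var (e zero)
    respects (PW.inj₂ (same {ω} e)) = cong (op ω) (toArgs-resp-Eq (arity S ω) e id)
    natural : ∀ {m n} (f : Surj m n) (x : Ob (V ⊕ ΣF S RTmPsh) m) →
          tm (app syntaxAlg (act (V ⊕ ΣF S RTmPsh) f x)) ≡ tm (renR f (app syntaxAlg x))
    natural f (inj₁ v)       = refl
    natural f (inj₂ (ω , u)) = cong (op ω) (trans (toArgs-act (arity S ω) f u id) (sym (renA-toArgs (arity S ω) u id (fun f))))

  plugR : ∀ {m₁ m₂ n} → RTm (m₁ + 1) → RTm m₂ → Surj (m₁ + m₂) n → RTm n
  plugR {m₁} {m₂} {n} Y X F = rtm (plug {m₁} (tm Y) (tm X) (fun F)) occ used
    where
    ρ : Fin (m₁ + 1) → Tm n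
    ρ = plugSub {m₁} (tm X) (fun F)
    occ : AllOccur (plug {m₁} (tm Y) (tm X) (fun F))
    occ j with surj F j
    ... | x , refl with splitView m₁ m₂ x
    ...   | inL i = occurs-sub ρ (tm Y) (allOccur Y (i ↑ˡ 1)) (subst (Occurs _) (sym (plugSub-↑ˡ (tm X) (fun F) i)) refl)
    ...   | inR i = occurs-sub ρ (tm Y) (allOccur Y (m₁ ↑ʳ zero))
                      (subst (Occurs _) (sym (plugSub-last {m₁} (tm X) (fun F))) (occurs-ren _ (tm X) (allOccur X i)))
    usedAt : ∀ j → BindersUsed (ρ j)
    usedAt j with splitView m₁ 1 j
    ... | inL i    = subst BindersUsed (sym (plugSub-↑ˡ (tm X) (fun F) i)) tt
    ... | inR zero = subst BindersUsed (sym (plugSub-last {m₁} (tm X) (fun F))) (bindersUsed-ren _ (tm X) (bindersUsed X))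
    used : BindersUsed (plug {m₁} (tm Y) (tm X) (fun F))
    used = bindersUsed-sub ρ (tm Y) usedAt (bindersUsed Y)

module InitialAlgebra (S : BindingSig) (TV : Psh) (TV-psh : IsPsh TV) (α : Hom (V ⊕ ΣF S TV) TV) (α-hom : IsHom α)
             (initial : IsInitialAlg S TV α) where
  open Syntax S
  open Plugging S
  open RelevantTerms S
  open IsPsh TV-psh

  module ≈ {n} = IsEquivalence (isEquiv {n})

  TVₛ : ℕ → Setoid _ _
  TVₛ n = record { Carrier = Ob TV n ; _≈_ = Eq TV ; isEquivalence = isEquiv }

  module ≈-Reasoning {n} = SetoidReasoning (TVₛ n)

  infix 4 _≈_
  _≈_ : ∀ {n} → Ob TV n → Ob TV n → Set
  _≈_ = Eq TV

  ≡⇒≈ : ∀ {n} {x y : Ob TV n} → x ≡ y → x ≈ y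
  ≡⇒≈ refl = ≈.refl

  act-≗ : ∀ {m n} {f g : Surj m n} (x : Ob TV m) → fun f ≗ fun g → act TV f x ≈ act TV g x
  act-≗ x e = act-cong e ≈.refl

  act-act : ∀ {l m n} (f : Surj l m) (g : Surj m n) (h : Surj l n) (x : Ob TV l) →
            fun g ∘ fun f ≗ fun h → act TV g (act TV f x) ≈ act TV h x
  act-act f g h x e = ≈.trans (≈.sym (act-∘ f g x)) (act-≗ x e)

  toRTm : Hom TV RTmPsh
  toRTm = proj₁ (initial RTmPsh RTmPsh-isPsh syntaxAlg syntaxAlg-isHom)

  toRTm-isHom : IsHom toRTm
  toRTm-isHom = proj₁ (proj₂ (initial RTmPsh RTmPsh-isPsh syntaxAlg syntaxAlg-isHom))

  toRTm-isAlgHom : IsAlgHom S α syntaxAlg toRTm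
  toRTm-isAlgHom = proj₁ (proj₂ (proj₂ (initial RTmPsh RTmPsh-isPsh syntaxAlg syntaxAlg-isHom)))

  termOf : ∀ {n} → Ob TV n → Tm n
  termOf x = tm (app toRTm x)

  termOf-act : ∀ {m n} (f : Surj m n) (x : Ob TV m) → termOf (act TV f x) ≡ ren (fun f) (termOf x)
  termOf-act = IsHom.hom-nat toRTm-isHom

  genericVar : Ob TV 1
  genericVar = app α (inj₁ (idS 1))

  termOf-genericVar : termOf genericVar ≡ var zero
  termOf-genericVar = toRTm-isAlgHom (inj₁ (idS 1))

  termOf-op : ∀ {n} ω (xs : Ob (prodΣ (arity S ω) TV) n) →
              termOf (app α (inj₂ (ω , xs))) ≡ op ω (toArgs (arity S ω) (app (prodΣh (arity S ω) toRTm) xs) id)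
  termOf-op ω xs = toRTm-isAlgHom (inj₂ (ω , xs))

  -- Reading relevant terms back into TV

  -- A subterm need not use every variable of its context, so it is realised in TV over
  -- its own variables and relabelled afterwards.
  record Realiser {n} (t : Tm n) : Set where
    field
      size       : ℕ
      elem       : Ob TV size
      vars       : Fin size → Fin n
      vars-cover : ∀ j → Occurs j t → Σ (Fin size) λ i → vars i ≡ j

  record ArgsRealiser {ks n} (as : Args ks n) : Set where
    field
      size       : ℕ
      elems      : Ob (prodΣ ks TV) size
      vars       : Fin size → Fin n
      vars-cover : ∀ j → OccursA j as → Σ (Fin size) λ i → vars i ≡ j

  -- The variables of a binder body split into free ones, relabelled by label₁, and
  -- bound ones, which regrouping moves to the end as δ^ k requires.
  module Bind (k : ℕ) {n : ℕ} (a : Tm (extend k n)) (r : Realiser a) (bound : ∀ b → Occurs (joinᵏ k {n} (inj₂ b)) a) where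
    open Realiser r public
    open Partition (partition size (splitᵏ k ∘ vars)) public

    regroupᶠ : Fin size → Fin (extend k size₁)
    regroupᶠ = joinᵏ k ∘ Sum.map₂ label₂ ∘ split

    regroup-surj : ∀ y → Σ (Fin size) λ i → regroupᶠ i ≡ y
    regroup-surj y = onSide (splitᵏ k y) (joinᵏ-splitᵏ k y)
      where
      onSide : ∀ s → joinᵏ k s ≡ y → Σ (Fin size) λ i → regroupᶠ i ≡ y
      onSide (inj₁ j) eq = unsplit (inj₁ j) , trans (cong (joinᵏ k ∘ Sum.map₂ label₂) (split-unsplit (inj₁ j))) eq
      onSide (inj₂ b) eq with vars-cover (joinᵏ k (inj₂ b)) (bound b)
      ... | i , vi≡ with map-≡inj₂ label₁ label₂ (split i) (trans (label-split i) (trans (cong (splitᵏ k) vi≡) (splitᵏ-joinᵏ k (inj₂ b))))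
      ...   | _ , split-i≡ , label≡ = i , trans (cong (joinᵏ k ∘ Sum.map₂ label₂) split-i≡) (trans (cong (joinᵏ k ∘ inj₂) label≡) eq)

    regroup : Surj size (extend k size₁)
    regroup = mkSurj regroupᶠ regroup-surj

    bodyElem : Ob (δ^ k TV) size₁
    bodyElem = toδ^ k (act TV regroup elem)

    label₁-cover : ∀ j → Occurs (joinᵏ k (inj₁ j)) a → Σ (Fin size₁) λ i → label₁ i ≡ j
    label₁-cover j o with vars-cover (joinᵏ k (inj₁ j)) o
    ... | i , vi≡ with map-≡inj₁ label₁ label₂ (split i) (trans (label-split i) (trans (cong (splitᵏ k) vi≡) (splitᵏ-joinᵏ k (inj₁ j))))
    ...   | i′ , _ , label≡ = i′ , label≡

    liftᵏ-label₁-regroup : liftᵏ k label₁ ∘ regroupᶠ ≗ vars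
    liftᵏ-label₁-regroup i = begin
      liftᵏ k label₁ (joinᵏ k (Sum.map₂ label₂ (split i)))        ≡⟨ liftᵏ-joinᵏ k label₁ _ ⟩
      joinᵏ k (Sum.map₁ label₁ (Sum.map₂ label₂ (split i)))       ≡⟨ cong (joinᵏ k) (map-map (split i)) ⟩
      joinᵏ k (Sum.map label₁ label₂ (split i))                   ≡⟨ cong (joinᵏ k) (label-split i) ⟩
      joinᵏ k (splitᵏ k (vars i))                                 ≡⟨ joinᵏ-splitᵏ k (vars i) ⟩
      vars i                                                      ∎
      where open ≡-Reasoning

  op-realiser : ∀ {n} ω (as : Args (arity S ω) n) → ArgsRealiser as → Realiser (op ω as)
  op-realiser ω as r = record { size = size ; elem = app α (inj₂ (ω , elems)) ; vars = vars ; vars-cover = vars-cover }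
    where open ArgsRealiser r

  single-realiser : ∀ k {n} (a : Tm (extend k n)) (r : Realiser a) (bound : ∀ b → Occurs (joinᵏ k {n} (inj₂ b)) a) →
                    ArgsRealiser {k ∷ []} (cons {k} a nil)
  single-realiser k a r bound = record { size = size₁ ; elems = bodyElem ; vars = label₁ ; vars-cover = cover }
    where
    open Bind k a r bound
    cover : ∀ j → OccursA j (cons {k} a nil) → Σ (Fin size₁) λ i → label₁ i ≡ j
    cover j (inj₁ o) = label₁-cover j o

  cons-realiser : ∀ k l ks {n} (a : Tm (extend k n)) (r : Realiser a) (bound : ∀ b → Occurs (joinᵏ k {n} (inj₂ b)) a)
                  (as : Args (l ∷ ks) n) → ArgsRealiser as → ArgsRealiser (cons {k} a as)
  cons-realiser k l ks a r bound as ras = record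
    { size = size₁ + R.size ; elems = ⟨ bodyElem , R.elems , idS _ ⟩ ; vars = varsᶜ ; vars-cover = cover }
    where
    open Bind k a r bound
    module R = ArgsRealiser ras
    varsᶜ : Fin (size₁ + R.size) → Fin _
    varsᶜ = [ label₁ , R.vars ]′ ∘ splitAt size₁
    cover : ∀ j → OccursA j (cons {k} a as) → Σ (Fin (size₁ + R.size)) λ i → varsᶜ i ≡ j
    cover j (inj₁ o) with label₁-cover j o
    ... | i , e = i ↑ˡ R.size , trans (cong [ label₁ , R.vars ]′ (splitAt-↑ˡ size₁ i R.size)) e
    cover j (inj₂ o) with R.vars-cover j o
    ... | i , e = size₁ ↑ʳ i , trans (cong [ label₁ , R.vars ]′ (splitAt-↑ʳ size₁ R.size i)) e

  mutual
    realise : ∀ {n} (t : Tm n) → BindersUsed t → Realiser t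
    realise (var j)   _ = record { size = 1 ; elem = genericVar ; vars = λ _ → j ; vars-cover = λ _ o → zero , o }
    realise (op ω as) w = op-realiser ω as (realiseA as w)

    realiseA : ∀ {ks n} (as : Args ks n) → BindersUsedA as → ArgsRealiser as
    realiseA nil _ = record { size = 0 ; elems = idS 0 ; vars = λ () ; vars-cover = λ _ () }
    realiseA (cons {k} {[]} a nil) (wa , bound , _) = single-realiser k a (realise a wa) bound
    realiseA (cons {k} {l ∷ ks} a as) (wa , bound , ws) = cons-realiser k l ks a (realise a wa) bound as (realiseA as ws)

  varsSurj : ∀ {n} {t : Tm n} (r : Realiser t) → AllOccur t → Surj (Realiser.size r) n
  varsSurj r occ = mkSurj (Realiser.vars r) (λ j → Realiser.vars-cover r j (occ j))

  realiseR : ∀ {n} (u : RTm n) → Realiser (tm u)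
  realiseR u = realise (tm u) (bindersUsed u)

  readbackSurj : ∀ {n} (u : RTm n) → Surj (Realiser.size (realiseR u)) n
  readbackSurj u = varsSurj (realiseR u) (allOccur u)

  fromRTmᶠ : ∀ {n} → RTm n → Ob TV n
  fromRTmᶠ u = act TV (readbackSurj u) (Realiser.elem (realiseR u))

  fromRTm : Hom RTmPsh TV
  fromRTm = mkHom fromRTmᶠ

  bind-termOf : ∀ k {n} (a : Tm (extend k n)) (r : Realiser a) (bound : ∀ b → Occurs (joinᵏ k {n} (inj₂ b)) a) →
                ren (Realiser.vars r) (termOf (Realiser.elem r)) ≡ a →
                ren (liftᵏ k (Bind.label₁ k a r bound)) (tmᵏ k (app (δ^h k toRTm) (Bind.bodyElem k a r bound))) ≡ a
  bind-termOf k a r bound ih = begin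
    ren (liftᵏ k label₁) (tmᵏ k (app (δ^h k toRTm) bodyElem))  ≡⟨ cong (ren (liftᵏ k label₁) ∘ tm) (fromδ^-δ^h k toRTm bodyElem) ⟩
    ren (liftᵏ k label₁) (termOf (fromδ^ k bodyElem))          ≡⟨ cong (ren (liftᵏ k label₁) ∘ termOf) (fromδ^-toδ^ k _) ⟩
    ren (liftᵏ k label₁) (termOf (act TV regroup elem))        ≡⟨ cong (ren (liftᵏ k label₁)) (termOf-act regroup elem) ⟩
    ren (liftᵏ k label₁) (ren regroupᶠ (termOf elem))          ≡⟨ ren-∘ (liftᵏ k label₁) regroupᶠ (termOf elem) ⟩
    ren (liftᵏ k label₁ ∘ regroupᶠ) (termOf elem)              ≡⟨ ren-cong liftᵏ-label₁-regroup (termOf elem) ⟩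
    ren vars (termOf elem)                                     ≡⟨ ih ⟩
    a                                                          ∎
    where
    open Bind k a r bound
    open ≡-Reasoning

  mutual
    termOf-realise : ∀ {n} (t : Tm n) (w : BindersUsed t) → ren (Realiser.vars (realise t w)) (termOf (Realiser.elem (realise t w))) ≡ t
    termOf-realise (var j) w = cong (ren (λ _ → j)) termOf-genericVar
    termOf-realise (op ω as) w =
      trans (cong (ren (ArgsRealiser.vars r)) (termOf-op ω (ArgsRealiser.elems r)))
            (cong (op ω) (trans (renA-toArgs (arity S ω) _ id (ArgsRealiser.vars r)) (termOf-realiseA as w)))
      where
      r : ArgsRealiser as
      r = realiseA as w

    termOf-realiseA : ∀ {ks n} (as : Args ks n) (w : BindersUsedA as) →
                      toArgs ks (app (prodΣh ks toRTm) (ArgsRealiser.elems (realiseA as w))) (ArgsRealiser.vars (realiseA as w)) ≡ as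
    termOf-realiseA nil w = refl
    termOf-realiseA (cons {k} {[]} a nil) (wa , bound , _) = cong (λ z → cons z nil) (bind-termOf k a (realise a wa) bound (termOf-realise a wa))
    termOf-realiseA (cons {k} {l ∷ ks} a as) (wa , bound , ws) =
      cong₂ cons (trans (ren-cong (liftᵏ-cong k (λ i → cong [ label₁ , R.vars ]′ (splitAt-↑ˡ size₁ i R.size))) _) (bind-termOf k a (realise a wa) bound (termOf-realise a wa)))
                 (trans (toArgs-≗ (l ∷ ks) _ (cong [ label₁ , R.vars ]′ ∘ splitAt-↑ʳ size₁ R.size)) (termOf-realiseA as ws))
      where
      open Bind k a (realise a wa) bound
      module R = ArgsRealiser (realiseA as ws)

  termOf-fromRTm : ∀ {n} (u : RTm n) → termOf (fromRTmᶠ u) ≡ tm u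
  termOf-fromRTm u = trans (termOf-act (readbackSurj u) (Realiser.elem (realiseR u))) (termOf-realise (tm u) (bindersUsed u))

  -- Realisers of the same term are related by a bijection of their variables
  -- (realise-ren); this makes readback well defined and natural.
  record Reindexing (X : Psh) {n n′} (ρ : Fin n → Fin n′) {m m′}
                    (x : Ob X m) (e : Fin m → Fin n) (x′ : Ob X m′) (e′ : Fin m′ → Fin n′) : Set where
    field
      π      : Fin m → Fin m′
      π⁻¹    : Fin m′ → Fin m
      π∘π⁻¹  : ∀ j → π (π⁻¹ j) ≡ j
      π⁻¹∘π  : ∀ i → π⁻¹ (π i) ≡ i
      act-π  : Eq X (act X (surjOfSection π π⁻¹ π∘π⁻¹) x) x′
      vars-π : ∀ i → e′ (π i) ≡ ρ (e i)

  module BindReindex (k : ℕ) {n n′} (ρ : Fin n → Fin n′) (a : Tm (extend k n)) (a′ : Tm (extend k n′))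
                     (r : Realiser a) (r′ : Realiser a′)
                     (bound : ∀ b → Occurs (joinᵏ k {n} (inj₂ b)) a) (bound′ : ∀ b → Occurs (joinᵏ k {n′} (inj₂ b)) a′)
                     (R : Reindexing TV (liftᵏ k ρ) (Realiser.elem r) (Realiser.vars r) (Realiser.elem r′) (Realiser.vars r′)) where
    module B  = Bind k a r bound
    module B′ = Bind k a′ r′ bound′
    open Reindexing R

    side-π : ∀ i → splitᵏ k (B′.vars (π i)) ≡ Sum.map₁ ρ (splitᵏ k (B.vars i))
    side-π i = trans (cong (splitᵏ k) (vars-π i)) (splitᵏ-liftᵏ k ρ (B.vars i))

    labels-π : ∀ i → Sum.map B′.label₁ B′.label₂ (B′.split (π i)) ≡ Sum.map₁ ρ (Sum.map B.label₁ B.label₂ (B.split i))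
    labels-π i = trans (B′.label-split (π i)) (trans (side-π i) (cong (Sum.map₁ ρ) (sym (B.label-split i))))

    free-π : ∀ i j → B.split i ≡ inj₁ j → Σ (Fin B′.size₁) λ j′ → B′.split (π i) ≡ inj₁ j′ × B′.label₁ j′ ≡ ρ (B.label₁ j)
    free-π i j eq = map-≡inj₁ B′.label₁ B′.label₂ (B′.split (π i)) (trans (labels-π i) (cong (Sum.map₁ ρ ∘ Sum.map B.label₁ B.label₂) eq))

    bound-π : ∀ i j → B.split i ≡ inj₂ j → Σ (Fin B′.size₂) λ j′ → B′.split (π i) ≡ inj₂ j′ × B′.label₂ j′ ≡ B.label₂ j
    bound-π i j eq = map-≡inj₂ B′.label₁ B′.label₂ (B′.split (π i)) (trans (labels-π i) (cong (Sum.map₁ ρ ∘ Sum.map B.label₁ B.label₂) eq))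

    free-π⁻¹ : ∀ i′ j′ → B′.split i′ ≡ inj₁ j′ → Σ (Fin B.size₁) λ j → B.split (π⁻¹ i′) ≡ inj₁ j
    free-π⁻¹ i′ j′ eq with map-≡inj₁ ρ id (splitᵏ k (B.vars (π⁻¹ i′)))
                             (trans (sym (side-π (π⁻¹ i′))) (trans (cong (splitᵏ k ∘ B′.vars) (π∘π⁻¹ i′))
                                    (trans (sym (B′.label-split i′)) (cong (Sum.map B′.label₁ B′.label₂) eq))))
    ... | c , ec , _ with map-≡inj₁ B.label₁ B.label₂ (B.split (π⁻¹ i′)) (trans (B.label-split (π⁻¹ i′)) ec)
    ...   | j , ej , _ = j , ej

    πᶠ : Fin B.size₁ → Fin B′.size₁
    πᶠ j = proj₁ (free-π (B.unsplit (inj₁ j)) j (B.split-unsplit (inj₁ j)))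

    πᶠ-spec : ∀ i j → B.split i ≡ inj₁ j → B′.split (π i) ≡ inj₁ (πᶠ j)
    πᶠ-spec i j eq = subst (λ z → B′.split (π z) ≡ inj₁ (πᶠ j)) (trans (cong B.unsplit (sym eq)) (B.unsplit-split i))
                           (proj₁ (proj₂ (free-π (B.unsplit (inj₁ j)) j (B.split-unsplit (inj₁ j)))))

    πᶠ⁻¹ : Fin B′.size₁ → Fin B.size₁
    πᶠ⁻¹ j′ = proj₁ (free-π⁻¹ (B′.unsplit (inj₁ j′)) j′ (B′.split-unsplit (inj₁ j′)))

    πᶠ⁻¹-spec : ∀ i′ j′ → B′.split i′ ≡ inj₁ j′ → B.split (π⁻¹ i′) ≡ inj₁ (πᶠ⁻¹ j′)
    πᶠ⁻¹-spec i′ j′ eq = subst (λ z → B.split (π⁻¹ z) ≡ inj₁ (πᶠ⁻¹ j′)) (trans (cong B′.unsplit (sym eq)) (B′.unsplit-split i′))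
                               (proj₂ (free-π⁻¹ (B′.unsplit (inj₁ j′)) j′ (B′.split-unsplit (inj₁ j′))))

    πᶠ∘πᶠ⁻¹ : ∀ j′ → πᶠ (πᶠ⁻¹ j′) ≡ j′
    πᶠ∘πᶠ⁻¹ j′ = inj₁-injective (trans (sym (πᶠ-spec (π⁻¹ i′) (πᶠ⁻¹ j′) (πᶠ⁻¹-spec i′ j′ (B′.split-unsplit (inj₁ j′)))))
                                       (trans (cong B′.split (π∘π⁻¹ i′)) (B′.split-unsplit (inj₁ j′))))
      where
      i′ : Fin B′.size
      i′ = B′.unsplit (inj₁ j′)

    πᶠ⁻¹∘πᶠ : ∀ j → πᶠ⁻¹ (πᶠ j) ≡ j
    πᶠ⁻¹∘πᶠ j = inj₁-injective (trans (sym (πᶠ⁻¹-spec (π i) (πᶠ j) (πᶠ-spec i j (B.split-unsplit (inj₁ j)))))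
                                      (trans (cong B.split (π⁻¹∘π i)) (B.split-unsplit (inj₁ j))))
      where
      i : Fin B.size
      i = B.unsplit (inj₁ j)

    πᶠS : Surj B.size₁ B′.size₁
    πᶠS = surjOfSection πᶠ πᶠ⁻¹ πᶠ∘πᶠ⁻¹

    regroup-π : ∀ i → liftᵏ k πᶠ (B.regroupᶠ i) ≡ B′.regroupᶠ (π i)
    regroup-π i = onSplit (B.split i) refl
      where
      onSplit : ∀ s → B.split i ≡ s → liftᵏ k πᶠ (joinᵏ k (Sum.map₂ B.label₂ s)) ≡ B′.regroupᶠ (π i)
      onSplit (inj₁ j) eq = trans (liftᵏ-joinᵏ k πᶠ (inj₁ j)) (cong (joinᵏ k ∘ Sum.map₂ B′.label₂) (sym (πᶠ-spec i j eq)))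
      onSplit (inj₂ j) eq with bound-π i j eq
      ... | j′ , e₁ , e₂ = trans (liftᵏ-joinᵏ k πᶠ (inj₂ (B.label₂ j)))
                                 (trans (cong (joinᵏ k ∘ inj₂) (sym e₂)) (cong (joinᵏ k ∘ Sum.map₂ B′.label₂) (sym e₁)))

    πS : Surj B.size B′.size
    πS = surjOfSection π π⁻¹ π∘π⁻¹

    act-πᶠ : Eq (δ^ k TV) (act (δ^ k TV) πᶠS B.bodyElem) B′.bodyElem
    act-πᶠ = Eq-fromδ^ k (begin
      fromδ^ k (act (δ^ k TV) πᶠS B.bodyElem)                ≡⟨ fromδ^-act k πᶠS B.bodyElem ⟩
      act TV (extendS k πᶠS) (fromδ^ k B.bodyElem)          ≈⟨ act-cong (λ _ → refl) (≡⇒≈ (fromδ^-toδ^ k _)) ⟩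
      act TV (extendS k πᶠS) (act TV B.regroup B.elem)      ≈⟨ act-act B.regroup (extendS k πᶠS) (B′.regroup ∘S πS) B.elem
                                                                 (λ i → trans (fun-extendS k πᶠS _) (regroup-π i)) ⟩
      act TV (B′.regroup ∘S πS) B.elem                      ≈⟨ act-∘ πS B′.regroup B.elem ⟩
      act TV B′.regroup (act TV πS B.elem)                  ≈⟨ act-cong (λ _ → refl) act-π ⟩
      act TV B′.regroup B′.elem                             ≡⟨ fromδ^-toδ^ k _ ⟨
      fromδ^ k B′.bodyElem                                  ∎)
      where open ≈-Reasoning

    reindexing : Reindexing (δ^ k TV) ρ B.bodyElem B.label₁ B′.bodyElem B′.label₁
    reindexing = record
      { π = πᶠ ; π⁻¹ = πᶠ⁻¹ ; π∘π⁻¹ = πᶠ∘πᶠ⁻¹ ; π⁻¹∘π = πᶠ⁻¹∘πᶠ ; act-π = act-πᶠ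
      ; vars-π = λ j → proj₂ (proj₂ (free-π (B.unsplit (inj₁ j)) j (B.split-unsplit (inj₁ j)))) }

  prodΣ-refl : ∀ ks {n} (u : Ob (prodΣ ks TV) n) → Eq (prodΣ ks TV) u u
  prodΣ-refl []           u = λ _ → refl
  prodΣ-refl (k ∷ [])     u = Eq-fromδ^ k ≈.refl
  prodΣ-refl (k ∷ l ∷ ks) u = d-refl

  prodΣ-trans : ∀ ks {n} {u v w : Ob (prodΣ ks TV) n} → Eq (prodΣ ks TV) u v → Eq (prodΣ ks TV) v w → Eq (prodΣ ks TV) u w
  prodΣ-trans []           e e′ = λ i → trans (e i) (e′ i)
  prodΣ-trans (k ∷ [])     e e′ = Eq-fromδ^ k (≈.trans (fromδ^-Eq k e) (fromδ^-Eq k e′))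
  prodΣ-trans (k ∷ l ∷ ks) e e′ = d-trans e e′

  prodΣ-act-≗ : ∀ ks {m n} {f f′ : Surj m n} (u : Ob (prodΣ ks TV) m) → fun f ≗ fun f′ →
                Eq (prodΣ ks TV) (act (prodΣ ks TV) f u) (act (prodΣ ks TV) f′ u)
  prodΣ-act-≗ [] u e = e ∘ fun u
  prodΣ-act-≗ (k ∷ []) {f = f} {f′} u e = Eq-fromδ^ k (begin
    fromδ^ k (act (δ^ k TV) f u)        ≡⟨ fromδ^-act k f u ⟩
    act TV (extendS k f) (fromδ^ k u)   ≈⟨ act-≗ (fromδ^ k u) (λ i → trans (fun-extendS k f i) (trans (liftᵏ-cong k e i) (sym (fun-extendS k f′ i)))) ⟩
    act TV (extendS k f′) (fromδ^ k u)  ≡⟨ fromδ^-act k f′ u ⟨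
    fromδ^ k (act (δ^ k TV) f′ u)       ∎)
    where open ≈-Reasoning
  prodΣ-act-≗ (k ∷ l ∷ ks) (⟨_,_,_⟩ x y F) e = d-cong (prodΣ-refl (k ∷ []) x) (prodΣ-refl (l ∷ ks) y) (e ∘ fun F)

  cons-reindexing : ∀ k l ks {n n′} (ρ : Fin n → Fin n′) {p p′ q q′}
                    {x : Ob (δ^ k TV) p} {e} {x′ : Ob (δ^ k TV) p′} {e′}
                    {xs : Ob (prodΣ (l ∷ ks) TV) q} {es} {xs′ : Ob (prodΣ (l ∷ ks) TV) q′} {es′} →
                    Reindexing (δ^ k TV) ρ x e x′ e′ → Reindexing (prodΣ (l ∷ ks) TV) ρ xs es xs′ es′ →
                    Reindexing (prodΣ (k ∷ l ∷ ks) TV) ρ ⟨ x , xs , idS (p + q) ⟩ ([ e , es ]′ ∘ splitAt p)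
                                                         ⟨ x′ , xs′ , idS (p′ + q′) ⟩ ([ e′ , es′ ]′ ∘ splitAt p′)
  cons-reindexing k l ks ρ {p} {p′} {q} {q′} {x} {e} {x′} {e′} {xs} {es} {xs′} {es′} R₁ R₂ = record
    { π = R₁.π ⊗ᶠ R₂.π ; π⁻¹ = R₁.π⁻¹ ⊗ᶠ R₂.π⁻¹ ; π∘π⁻¹ = π∘π⁻¹ ; π⁻¹∘π = π⁻¹∘π ; act-π = act-π ; vars-π = vars-π }
    where
    module R₁ = Reindexing R₁
    module R₂ = Reindexing R₂
    π∘π⁻¹ : ∀ j → (R₁.π ⊗ᶠ R₂.π) ((R₁.π⁻¹ ⊗ᶠ R₂.π⁻¹) j) ≡ j
    π∘π⁻¹ j = trans (⊗ᶠ-∘ R₁.π R₂.π R₁.π⁻¹ R₂.π⁻¹ j) (⊗ᶠ-id R₁.π∘π⁻¹ R₂.π∘π⁻¹ j)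
    π⁻¹∘π : ∀ j → (R₁.π⁻¹ ⊗ᶠ R₂.π⁻¹) ((R₁.π ⊗ᶠ R₂.π) j) ≡ j
    π⁻¹∘π j = trans (⊗ᶠ-∘ R₁.π⁻¹ R₂.π⁻¹ R₁.π R₂.π j) (⊗ᶠ-id R₁.π⁻¹∘π R₂.π⁻¹∘π j)
    π₁ : Surj p p′
    π₁ = surjOfSection R₁.π R₁.π⁻¹ R₁.π∘π⁻¹
    π₂ : Surj q q′
    π₂ = surjOfSection R₂.π R₂.π⁻¹ R₂.π∘π⁻¹
    act-π : DayEq (δ^ k TV) (prodΣ (l ∷ ks) TV) ⟨ x , xs , surjOfSection (R₁.π ⊗ᶠ R₂.π) (R₁.π⁻¹ ⊗ᶠ R₂.π⁻¹) π∘π⁻¹ ∘S idS (p + q) ⟩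
                                                ⟨ x′ , xs′ , idS (p′ + q′) ⟩
    act-π = d-trans (d-sym (d-trans (d-left π₁ x (act (prodΣ (l ∷ ks) TV) π₂ xs) (idS (p′ + q′)))
                           (d-trans (d-right π₂ x xs (idS (p′ + q′) ∘S (π₁ ⊗S idS q′)))
                                    (d-cong (prodΣ-refl (k ∷ []) x) (prodΣ-refl (l ∷ ks) xs) (⊗ᶠ-∘ R₁.π id id R₂.π)))))
                    (d-cong R₁.act-π R₂.act-π (λ _ → refl))
    vars-π : ∀ i → [ e′ , es′ ]′ (splitAt p′ ((R₁.π ⊗ᶠ R₂.π) i)) ≡ ρ ([ e , es ]′ (splitAt p i))
    vars-π i = trans (cong [ e′ , es′ ]′ (splitAt-join p′ q′ (Sum.map R₁.π R₂.π (splitAt p i)))) (onSplit (splitAt p i))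
      where
      onSplit : ∀ s → [ e′ , es′ ]′ (Sum.map R₁.π R₂.π s) ≡ ρ ([ e , es ]′ s)
      onSplit (inj₁ y) = R₁.vars-π y
      onSplit (inj₂ y) = R₂.vars-π y

  op-reindexing : ∀ {n n′} (ρ : Fin n → Fin n′) ω {m m′} {xs : Ob (prodΣ (arity S ω) TV) m} {e} {xs′ : Ob (prodΣ (arity S ω) TV) m′} {e′} →
                  Reindexing (prodΣ (arity S ω) TV) ρ xs e xs′ e′ →
                  Reindexing TV ρ (app α (inj₂ (ω , xs))) e (app α (inj₂ (ω , xs′))) e′
  op-reindexing ρ ω {xs = xs} R = record
    { π = π ; π⁻¹ = π⁻¹ ; π∘π⁻¹ = π∘π⁻¹ ; π⁻¹∘π = π⁻¹∘π ; vars-π = vars-π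
    ; act-π = ≈.trans (≈.sym (IsHom.hom-nat α-hom (surjOfSection π π⁻¹ π∘π⁻¹) (inj₂ (ω , xs)))) (IsHom.hom-cong α-hom (PW.inj₂ (same act-π))) }
    where open Reindexing R

  mutual
    realise-ren : ∀ {n n′} (ρ : Fin n → Fin n′) (t : Tm n) (w : BindersUsed t) (w′ : BindersUsed (ren ρ t)) →
                  Reindexing TV ρ (Realiser.elem (realise t w)) (Realiser.vars (realise t w))
                                  (Realiser.elem (realise (ren ρ t) w′)) (Realiser.vars (realise (ren ρ t) w′))
    realise-ren ρ (var j) w w′ = record
      { π = id ; π⁻¹ = id ; π∘π⁻¹ = λ _ → refl ; π⁻¹∘π = λ _ → refl ; act-π = ≈.trans (act-≗ genericVar (λ _ → refl)) (act-id genericVar)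
      ; vars-π = λ _ → refl }
    realise-ren ρ (op ω as) w w′ = op-reindexing ρ ω (realiseA-renA ρ as w w′)

    realiseA-renA : ∀ {ks n n′} (ρ : Fin n → Fin n′) (as : Args ks n) (w : BindersUsedA as) (w′ : BindersUsedA (renA ρ as)) →
                    Reindexing (prodΣ ks TV) ρ (ArgsRealiser.elems (realiseA as w)) (ArgsRealiser.vars (realiseA as w))
                                               (ArgsRealiser.elems (realiseA (renA ρ as) w′)) (ArgsRealiser.vars (realiseA (renA ρ as) w′))
    realiseA-renA ρ nil w w′ = record { π = λ () ; π⁻¹ = λ () ; π∘π⁻¹ = λ () ; π⁻¹∘π = λ () ; act-π = λ () ; vars-π = λ () }
    realiseA-renA ρ (cons {k} {[]} a nil) (wa , bound , _) (wa′ , bound′ , _) =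
      BindReindex.reindexing k ρ a _ (realise a wa) (realise _ wa′) bound bound′ (realise-ren (liftᵏ k ρ) a wa wa′)
    realiseA-renA ρ (cons {k} {l ∷ ks} a as) (wa , bound , ws) (wa′ , bound′ , ws′) =
      cons-reindexing k l ks ρ (BindReindex.reindexing k ρ a _ (realise a wa) (realise _ wa′) bound bound′ (realise-ren (liftᵏ k ρ) a wa wa′))
                               (realiseA-renA ρ as ws ws′)

  -- The step showing that fromRTm commutes with the algebra structures.
  FactorsThrough : ∀ ks {m₀ n} (u : Ob (prodΣ ks RTmPsh) m₀) (ρ : Fin m₀ → Fin n) {as : Args ks n} → ArgsRealiser as → Set
  FactorsThrough ks {m₀} u ρ r =
    Σ (Surj (ArgsRealiser.size r) m₀) λ π →
      Eq (prodΣ ks TV) (act (prodΣ ks TV) π (ArgsRealiser.elems r)) (app (prodΣh ks fromRTm) u) × (ArgsRealiser.vars r ≗ ρ ∘ fun π)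

  module BindFactors (k : ℕ) {m₀ n} (a : Ob (δ^ k RTmPsh) m₀) (ρ : Fin m₀ → Fin n)
                     (w′ : BindersUsed (ren (liftᵏ k ρ) (tmᵏ k a))) (bound′ : ∀ b → Occurs (joinᵏ k {n} (inj₂ b)) (ren (liftᵏ k ρ) (tmᵏ k a))) where
    private
      t : Tm (extend k m₀)
      t = tmᵏ k a
      ua : RTm (extend k m₀)
      ua = fromδ^ k a
      r : Realiser t
      r = realise t (bindersUsed ua)
      r′ : Realiser (ren (liftᵏ k ρ) t)
      r′ = realise (ren (liftᵏ k ρ) t) w′
    module B′ = Bind k (ren (liftᵏ k ρ) t) r′ bound′
    open Reindexing (realise-ren (liftᵏ k ρ) t (bindersUsed ua) w′)
    open Realiser r using (vars; elem)

    side-π : ∀ i → splitᵏ k (B′.vars (π i)) ≡ Sum.map₁ ρ (splitᵏ k (vars i))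
    side-π i = trans (cong (splitᵏ k) (vars-π i)) (splitᵏ-liftᵏ k ρ (vars i))

    free-π⁻¹ : ∀ i′ j → B′.split i′ ≡ inj₁ j → Σ (Fin m₀) λ j₀ → splitᵏ k (vars (π⁻¹ i′)) ≡ inj₁ j₀ × ρ j₀ ≡ B′.label₁ j
    free-π⁻¹ i′ j eq = map-≡inj₁ ρ id (splitᵏ k (vars (π⁻¹ i′)))
      (trans (sym (side-π (π⁻¹ i′))) (trans (cong (splitᵏ k ∘ B′.vars) (π∘π⁻¹ i′))
             (trans (sym (B′.label-split i′)) (cong (Sum.map B′.label₁ B′.label₂) eq))))

    πᵏ : Fin B′.size₁ → Fin m₀
    πᵏ j = proj₁ (free-π⁻¹ (B′.unsplit (inj₁ j)) j (B′.split-unsplit (inj₁ j)))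

    πᵏ-spec : ∀ i j → B′.split (π i) ≡ inj₁ j → splitᵏ k (vars i) ≡ inj₁ (πᵏ j)
    πᵏ-spec i j eq = subst (λ z → splitᵏ k (vars z) ≡ inj₁ (πᵏ j)) (π⁻¹∘π i)
      (subst (λ z → splitᵏ k (vars (π⁻¹ z)) ≡ inj₁ (πᵏ j)) (trans (cong B′.unsplit (sym eq)) (B′.unsplit-split (π i)))
             (proj₁ (proj₂ (free-π⁻¹ (B′.unsplit (inj₁ j)) j (B′.split-unsplit (inj₁ j))))))

    πᵏ-surj : ∀ j₀ → Σ (Fin B′.size₁) λ j → πᵏ j ≡ j₀
    πᵏ-surj j₀ with Realiser.vars-cover r (joinᵏ k (inj₁ j₀)) (allOccur ua (joinᵏ k (inj₁ j₀)))
    ... | i , ei with map-≡inj₁ B′.label₁ B′.label₂ (B′.split (π i))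
                      (trans (B′.label-split (π i)) (trans (side-π i) (cong (Sum.map₁ ρ) (trans (cong (splitᵏ k) ei) (splitᵏ-joinᵏ k (inj₁ j₀))))))
    ...   | j , eq , _ = j , inj₁-injective (trans (sym (πᵏ-spec i j eq)) (trans (cong (splitᵏ k) ei) (splitᵏ-joinᵏ k (inj₁ j₀))))

    πᵏS : Surj B′.size₁ m₀
    πᵏS = mkSurj πᵏ πᵏ-surj

    regroup-πᵏ : ∀ i → liftᵏ k πᵏ (B′.regroupᶠ (π i)) ≡ vars i
    regroup-πᵏ i = onSplit (B′.split (π i)) refl
      where
      onSplit : ∀ s → B′.split (π i) ≡ s → liftᵏ k πᵏ (joinᵏ k (Sum.map₂ B′.label₂ s)) ≡ vars i
      onSplit (inj₁ j) eq = trans (liftᵏ-joinᵏ k πᵏ (inj₁ j)) (trans (cong (joinᵏ k) (sym (πᵏ-spec i j eq))) (joinᵏ-splitᵏ k (vars i)))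
      onSplit (inj₂ j) eq with map-≡inj₂ ρ id (splitᵏ k (vars i))
                                 (trans (sym (side-π i)) (trans (sym (B′.label-split (π i))) (cong (Sum.map B′.label₁ B′.label₂) eq)))
      ... | b , e₁ , e₂ = trans (liftᵏ-joinᵏ k πᵏ (inj₂ (B′.label₂ j)))
                                (trans (cong (joinᵏ k ∘ inj₂) (sym e₂)) (trans (cong (joinᵏ k) (sym e₁)) (joinᵏ-splitᵏ k (vars i))))

    πS : Surj (Realiser.size r) B′.size
    πS = surjOfSection π π⁻¹ π∘π⁻¹

    act-πᵏ : Eq (δ^ k TV) (act (δ^ k TV) πᵏS B′.bodyElem) (app (δ^h k fromRTm) a)
    act-πᵏ = Eq-fromδ^ k (begin
      fromδ^ k (act (δ^ k TV) πᵏS B′.bodyElem)                   ≡⟨ fromδ^-act k πᵏS B′.bodyElem ⟩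
      act TV (extendS k πᵏS) (fromδ^ k B′.bodyElem)             ≈⟨ act-cong (λ _ → refl) (≡⇒≈ (fromδ^-toδ^ k _)) ⟩
      act TV (extendS k πᵏS) (act TV B′.regroup B′.elem)        ≈⟨ act-cong (λ _ → refl) (act-cong (λ _ → refl) (≈.sym act-π)) ⟩
      act TV (extendS k πᵏS) (act TV B′.regroup (act TV πS elem)) ≈⟨ act-cong (λ _ → refl) (≈.sym (act-∘ πS B′.regroup elem)) ⟩
      act TV (extendS k πᵏS) (act TV (B′.regroup ∘S πS) elem)   ≈⟨ act-act (B′.regroup ∘S πS) (extendS k πᵏS) (readbackSurj ua) elem
                                                                    (λ i → trans (fun-extendS k πᵏS _) (regroup-πᵏ i)) ⟩
      fromRTmᶠ ua                                               ≡⟨ fromδ^-δ^h k fromRTm a ⟨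
      fromδ^ k (app (δ^h k fromRTm) a)                          ∎)
      where open ≈-Reasoning

    factors : Σ (Surj B′.size₁ m₀) λ π → Eq (δ^ k TV) (act (δ^ k TV) π B′.bodyElem) (app (δ^h k fromRTm) a) × (B′.label₁ ≗ ρ ∘ fun π)
    factors = πᵏS , act-πᵏ , λ j → sym (proj₂ (proj₂ (free-π⁻¹ (B′.unsplit (inj₁ j)) j (B′.split-unsplit (inj₁ j)))))

  cons-factors : ∀ k l ks {m₀ n m₁ m₂} (a : Ob (δ^ k RTmPsh) m₁) (rs : Ob (prodΣ (l ∷ ks) RTmPsh) m₂) (F : Surj (m₁ + m₂) m₀) (ρ : Fin m₀ → Fin n)
                 (w : BindersUsed (ren (liftᵏ k (ρ ∘ fun F ∘ (_↑ˡ m₂))) (tmᵏ k a)))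
                 (bound : ∀ b → Occurs (joinᵏ k {n} (inj₂ b)) (ren (liftᵏ k (ρ ∘ fun F ∘ (_↑ˡ m₂))) (tmᵏ k a)))
                 (ws : BindersUsedA (toArgs (l ∷ ks) rs (ρ ∘ fun F ∘ (m₁ ↑ʳ_)))) →
                 FactorsThrough (l ∷ ks) rs (ρ ∘ fun F ∘ (m₁ ↑ʳ_)) (realiseA (toArgs (l ∷ ks) rs (ρ ∘ fun F ∘ (m₁ ↑ʳ_))) ws) →
                 FactorsThrough (k ∷ l ∷ ks) ⟨ a , rs , F ⟩ ρ (realiseA (toArgs (k ∷ l ∷ ks) ⟨ a , rs , F ⟩ ρ) (w , bound , ws))
  cons-factors k l ks {m₁ = m₁} {m₂} a rs F ρ w bound ws (π₂ , act-π₂ , vars-π₂) =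
    F ∘S (π₁ ⊗S π₂) , d-trans (d-sym regroupDay) (d-cong act-π₁ act-π₂ (λ _ → refl)) , vars-π
    where
    open BindFactors k a (ρ ∘ fun F ∘ (_↑ˡ m₂)) w bound using (module B′; factors)
    π₁ : Surj B′.size₁ m₁
    π₁ = proj₁ factors
    act-π₁ : Eq (δ^ k TV) (act (δ^ k TV) π₁ B′.bodyElem) (app (δ^h k fromRTm) a)
    act-π₁ = proj₁ (proj₂ factors)
    vars-π₁ : B′.label₁ ≗ ρ ∘ fun F ∘ (_↑ˡ m₂) ∘ fun π₁
    vars-π₁ = proj₂ (proj₂ factors)
    R : ArgsRealiser (toArgs (l ∷ ks) rs (ρ ∘ fun F ∘ (m₁ ↑ʳ_)))
    R = realiseA (toArgs (l ∷ ks) rs (ρ ∘ fun F ∘ (m₁ ↑ʳ_))) ws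
    regroupDay : DayEq (δ^ k TV) (prodΣ (l ∷ ks) TV)
                   ⟨ act (δ^ k TV) π₁ B′.bodyElem , act (prodΣ (l ∷ ks) TV) π₂ (ArgsRealiser.elems R) , F ⟩
                   ⟨ B′.bodyElem , ArgsRealiser.elems R , (F ∘S (π₁ ⊗S π₂)) ∘S idS _ ⟩
    regroupDay = d-trans (d-left π₁ B′.bodyElem (act (prodΣ (l ∷ ks) TV) π₂ (ArgsRealiser.elems R)) F)
                   (d-trans (d-right π₂ B′.bodyElem (ArgsRealiser.elems R) (F ∘S (π₁ ⊗S idS m₂)))
                      (d-cong (prodΣ-refl (k ∷ []) B′.bodyElem) (prodΣ-refl (l ∷ ks) (ArgsRealiser.elems R))
                              (cong (fun F) ∘ ⊗ᶠ-∘ (fun π₁) id id (fun π₂))))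
    vars-π : ∀ i → [ B′.label₁ , ArgsRealiser.vars R ]′ (splitAt B′.size₁ i) ≡ ρ (fun F (join m₁ m₂ (Sum.map (fun π₁) (fun π₂) (splitAt B′.size₁ i))))
    vars-π i = onSplit (splitAt B′.size₁ i)
      where
      onSplit : ∀ s → [ B′.label₁ , ArgsRealiser.vars R ]′ s ≡ ρ (fun F (join m₁ m₂ (Sum.map (fun π₁) (fun π₂) s)))
      onSplit (inj₁ x) = vars-π₁ x
      onSplit (inj₂ y) = vars-π₂ y

  realiseA-toArgs : ∀ ks {m₀ n} (u : Ob (prodΣ ks RTmPsh) m₀) (ρ : Fin m₀ → Fin n) (w : BindersUsedA (toArgs ks u ρ)) →
                    FactorsThrough ks u ρ (realiseA (toArgs ks u ρ) w)
  realiseA-toArgs [] u ρ w = u , (λ ()) , (λ ())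
  realiseA-toArgs (k ∷ []) u ρ (wa , bound , _) = BindFactors.factors k u ρ wa bound
  realiseA-toArgs (k ∷ l ∷ ks) (⟨_,_,_⟩ {m₁} a rs F) ρ (wa , bound , ws) =
    cons-factors k l ks a rs F ρ wa bound ws (realiseA-toArgs (l ∷ ks) rs (ρ ∘ fun F ∘ (m₁ ↑ʳ_)) ws)

  act-reindexing : ∀ {n n′} {ρ : Fin n → Fin n′} {m m′} {x : Ob TV m} {e} {x′ : Ob TV m′} {e′} → Reindexing TV ρ x e x′ e′ →
                   (E : Surj m n) (E′ : Surj m′ n′) (F : Surj n n′) → fun E ≗ e → fun E′ ≗ e′ → fun F ≗ ρ →
                   act TV E′ x′ ≈ act TV F (act TV E x)
  act-reindexing {x = x} {x′ = x′} R E E′ F eE eE′ eF = begin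
    act TV E′ x′                         ≈⟨ act-cong (λ _ → refl) act-π ⟨
    act TV E′ (act TV πS x)              ≈⟨ act-∘ πS E′ x ⟨
    act TV (E′ ∘S πS) x                  ≈⟨ act-≗ x (λ i → trans (eE′ (π i)) (trans (vars-π i) (trans (sym (eF _)) (cong (fun F) (sym (eE i)))))) ⟩
    act TV (F ∘S E) x                    ≈⟨ act-∘ E F x ⟩
    act TV F (act TV E x)                ∎
    where
    open Reindexing R
    open ≈-Reasoning
    πS = surjOfSection π π⁻¹ π∘π⁻¹

  realise-ren≡ : ∀ {n n′} (ρ : Fin n → Fin n′) (t : Tm n) (w : BindersUsed t) (t′ : Tm n′) (w′ : BindersUsed t′) → ren ρ t ≡ t′ →
                 Reindexing TV ρ (Realiser.elem (realise t w)) (Realiser.vars (realise t w))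
                                 (Realiser.elem (realise t′ w′)) (Realiser.vars (realise t′ w′))
  realise-ren≡ ρ t w .(ren ρ t) w′ refl = realise-ren ρ t w w′

  fromRTm-resp : ∀ {n} {u v : RTm n} → tm u ≡ tm v → fromRTmᶠ u ≈ fromRTmᶠ v
  fromRTm-resp {n} {u} {v} u≡v = ≈.sym (≈.trans
    (act-reindexing (realise-ren≡ id (tm u) (bindersUsed u) (tm v) (bindersUsed v) (trans (ren-id (λ _ → refl) (tm u)) u≡v))
                    (readbackSurj u) (readbackSurj v) (idS n) (λ _ → refl) (λ _ → refl) (λ _ → refl))
    (act-id _))

  fromRTm-nat : ∀ {m n} (f : Surj m n) (u : RTm m) → fromRTmᶠ (renR f u) ≈ act TV f (fromRTmᶠ u)
  fromRTm-nat f u =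
    act-reindexing (realise-ren (fun f) (tm u) (bindersUsed u) (bindersUsed (renR f u)))
                   (readbackSurj u) (readbackSurj (renR f u)) f (λ _ → refl) (λ _ → refl) (λ _ → refl)

  prodΣh-∘ : ∀ ks {n} (u : Ob (prodΣ ks TV) n) →
             Eq (prodΣ ks TV) (app (prodΣh ks fromRTm) (app (prodΣh ks toRTm) u)) (app (prodΣh ks (fromRTm ∘h toRTm)) u)
  prodΣh-∘ [] u = λ _ → refl
  prodΣh-∘ (k ∷ []) u = Eq-fromδ^ k (≡⇒≈ (trans (fromδ^-δ^h k fromRTm _)
                                          (trans (cong fromRTmᶠ (fromδ^-δ^h k toRTm u)) (sym (fromδ^-δ^h k (fromRTm ∘h toRTm) u)))))
  prodΣh-∘ (k ∷ l ∷ ks) (⟨_,_,_⟩ x y F) = d-cong (prodΣh-∘ (k ∷ []) x) (prodΣh-∘ (l ∷ ks) y) (λ _ → refl)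

  prodΣh-id : ∀ ks {n} (u : Ob (prodΣ ks TV) n) → Eq (prodΣ ks TV) u (app (prodΣh ks idh) u)
  prodΣh-id [] u = λ _ → refl
  prodΣh-id (k ∷ []) u = Eq-fromδ^ k (≡⇒≈ (sym (fromδ^-δ^h k idh u)))
  prodΣh-id (k ∷ l ∷ ks) (⟨_,_,_⟩ x y F) = d-cong (prodΣh-id (k ∷ []) x) (prodΣh-id (l ∷ ks) y) (λ _ → refl)

  fromRTm-syntaxAlg : ∀ {n} (w : Ob (V ⊕ ΣF S TV) n) →
                      fromRTmᶠ (app syntaxAlg (app (idh {V} ⊕h ΣFh S toRTm) w)) ≈ app α (app (idh {V} ⊕h ΣFh S (fromRTm ∘h toRTm)) w)
  fromRTm-syntaxAlg (inj₁ v) =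
    ≈.trans (≈.sym (IsHom.hom-nat α-hom (readbackSurj (rtm (var (fun v zero)) (var-allOccur v) tt)) (inj₁ (idS 1))))
            (IsHom.hom-cong α-hom (PW.inj₁ λ { zero → refl }))
  fromRTm-syntaxAlg (inj₂ (ω , u)) =
    ≈.trans (≈.sym (IsHom.hom-nat α-hom E (inj₂ (ω , ArgsRealiser.elems r))))
            (IsHom.hom-cong α-hom (PW.inj₂ (same (prodΣ-trans ks (prodΣ-act-≗ ks (ArgsRealiser.elems r) (proj₂ (proj₂ factors)))
                                                              (prodΣ-trans ks (proj₁ (proj₂ factors)) (prodΣh-∘ ks u))))))
    where
    ks : List ℕ
    ks = arity S ω
    hu : Ob (prodΣ ks RTmPsh) _
    hu = app (prodΣh ks toRTm) u
    r : ArgsRealiser (toArgs ks hu id)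
    r = realiseA (toArgs ks hu id) (toArgs-bindersUsed ks hu id)
    E : Surj (ArgsRealiser.size r) _
    E = readbackSurj (opR ω hu)
    factors : FactorsThrough ks hu id r
    factors = realiseA-toArgs ks hu id (toArgs-bindersUsed ks hu id)

  fromRTm-toRTm : ∀ {n} (x : Ob TV n) → fromRTmᶠ (app toRTm x) ≈ x
  fromRTm-toRTm x = ≈.trans (unique (fromRTm ∘h toRTm) roundTrip-isHom roundTrip-isAlgHom x) (≈.sym (unique idh id-isHom id-isAlgHom x))
    where
    unique : (h : Hom TV TV) → IsHom h → IsAlgHom S α α h → h ≈h proj₁ (initial TV TV-psh α α-hom)
    unique = proj₂ (proj₂ (proj₂ (initial TV TV-psh α α-hom)))
    roundTrip-isHom : IsHom (fromRTm ∘h toRTm)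
    roundTrip-isHom = record
      { hom-cong = fromRTm-resp ∘ IsHom.hom-cong toRTm-isHom
      ; hom-nat  = λ f x → ≈.trans (fromRTm-resp (IsHom.hom-nat toRTm-isHom f x)) (fromRTm-nat f (app toRTm x)) }
    roundTrip-isAlgHom : IsAlgHom S α α (fromRTm ∘h toRTm)
    roundTrip-isAlgHom w = ≈.trans (fromRTm-resp (toRTm-isAlgHom w)) (fromRTm-syntaxAlg w)
    id-isHom : IsHom (idh {TV})
    id-isHom = record { hom-cong = id ; hom-nat = λ _ _ → ≈.refl }
    id-isAlgHom : IsAlgHom S α α (idh {TV})
    id-isAlgHom (inj₁ v)       = IsHom.hom-cong α-hom (PW.inj₁ (λ _ → refl))
    id-isAlgHom (inj₂ (ω , u)) = IsHom.hom-cong α-hom (PW.inj₂ (same (prodΣh-id (arity S ω) u)))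

  -- The relevant substitution structure on TV

  σᶠ : ∀ {n} → Ob (δ TV ⊗ TV) n → Ob TV n
  σᶠ (⟨_,_,_⟩ y x F) = fromRTmᶠ (plugR (app toRTm y) (app toRTm x) F)

  σ : Hom (δ TV ⊗ TV) TV
  σ = mkHom σᶠ

  ν : Hom J (δ TV)
  ν = mkHom λ j → act TV (j ⊗S idS 1) genericVar

  termOf-σ : ∀ {m₁ m₂ n} (y : Ob TV (m₁ + 1)) (x : Ob TV m₂) (F : Surj (m₁ + m₂) n) →
             termOf (σᶠ ⟨ y , x , F ⟩) ≡ plug {m₁} (termOf y) (termOf x) (fun F)
  termOf-σ y x F = termOf-fromRTm (plugR (app toRTm y) (app toRTm x) F)

  termOf-ν : ∀ {m} (j : Surj 0 m) → termOf (app ν j) ≡ var (m ↑ʳ zero)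
  termOf-ν j = trans (termOf-act (j ⊗S idS 1) genericVar) (cong (ren _) termOf-genericVar)

  σ-resp : ∀ {n} {u v : Ob (δ TV ⊗ TV) n} → Eq (δ TV ⊗ TV) u v → σᶠ u ≈ σᶠ v
  σ-resp d-refl          = ≈.refl
  σ-resp (d-sym e)       = ≈.sym (σ-resp e)
  σ-resp (d-trans e e′)  = ≈.trans (σ-resp e) (σ-resp e′)
  σ-resp (d-cong {m₁} {x' = y′} {y' = x′} {f = F} ey ex eF) = fromRTm-resp
    (trans (cong₂ (λ Y X → plug {m₁} Y X (fun F)) (IsHom.hom-cong toRTm-isHom ey) (IsHom.hom-cong toRTm-isHom ex))
           (plug-cong (termOf y′) (termOf x′) eF))
  σ-resp (d-left G y x F) = fromRTm-resp
    (trans (cong (λ Y → plug Y (termOf x) (fun F)) (termOf-act (G ⊗S idS 1) y)) (plug-renˡ (fun G) (termOf y) (termOf x) (fun F)))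
  σ-resp (d-right {m₁} G y x F) = fromRTm-resp
    (trans (cong (λ X → plug {m₁} (termOf y) X (fun F)) (termOf-act G x)) (plug-renʳ (fun G) (termOf y) (termOf x) (fun F)))

  σ-nat : ∀ {m n} (f : Surj m n) (u : Ob (δ TV ⊗ TV) m) → σᶠ (act (δ TV ⊗ TV) f u) ≈ act TV f (σᶠ u)
  σ-nat f (⟨_,_,_⟩ {m₁} y x F) =
    ≈.trans (fromRTm-resp (sym (ren-plug (fun f) (termOf y) (termOf x) (fun F)))) (fromRTm-nat f (plugR (app toRTm y) (app toRTm x) F))

  σ-isHom : IsHom σ
  σ-isHom = record { hom-cong = σ-resp ; hom-nat = σ-nat }

  ν-isHom : IsHom ν
  ν-isHom = record { hom-cong = λ _ → act-≗ genericVar (λ _ → refl) ; hom-nat = nat }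
    where
    nat : ∀ {m n} (f : Surj m n) (j : Surj 0 m) → app ν (f ∘S j) ≈ act TV (f ⊗S idS 1) (app ν j)
    nat f j = ≈.sym (act-act (j ⊗S idS 1) (f ⊗S idS 1) ((f ∘S j) ⊗S idS 1) genericVar λ { zero → ⊗S-↑ʳ f (idS 1) zero })

  σ-unitˡ : σ ∘h (ν ⊗h idh) ≈h lam TV
  σ-unitˡ (⟨_,_,_⟩ {m₁} {m₂} j x F) = ≈.trans (fromRTm-resp termEq) (fromRTm-toRTm _)
    where
    open ≡-Reasoning
    termEq : plug {m₁} (termOf (app ν j)) (termOf x) (fun F) ≡ termOf (act TV (F ∘S (j ⊗S idS m₂)) x)
    termEq = begin
      plug {m₁} (termOf (app ν j)) (termOf x) (fun F)   ≡⟨ cong (λ Y → plug {m₁} Y (termOf x) (fun F)) (termOf-ν j) ⟩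
      plugSub {m₁} (termOf x) (fun F) (m₁ ↑ʳ zero)      ≡⟨ plugSub-last {m₁} (termOf x) (fun F) ⟩
      ren (fun (F ∘S (j ⊗S idS m₂))) (termOf x)         ≡⟨ termOf-act (F ∘S (j ⊗S idS m₂)) x ⟨
      termOf (act TV (F ∘S (j ⊗S idS m₂)) x)            ∎

  σ-unitʳ : δh σ ∘h strL (δ TV) TV ∘h (idh ⊗h ν) ≈h rho (δ TV)
  σ-unitʳ {n} (⟨_,_,_⟩ {m₁} {m₂} y j F) = ≈.trans (fromRTm-resp termEq) (fromRTm-toRTm _)
    where
    open ≡-Reasoning
    M : Fin (m₁ + (m₂ + 1)) → Fin (n + 1)
    M = fun (strLMap {m₁} {m₂} F)
    F′ : Surj m₁ n
    F′ = F ∘S (idS m₁ ⊗S j) ∘S castS (sym (+-identityʳ m₁))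
    onVar : plugSub {m₁} (var (m₂ ↑ʳ zero)) M ≗ var ∘ fun (F′ ⊗S idS 1)
    onVar = ≗-split onˡ λ { zero → onLast }
      where
      onˡ : ∀ i → plugSub {m₁} (var (m₂ ↑ʳ zero)) M (i ↑ˡ 1) ≡ var (fun (F′ ⊗S idS 1) (i ↑ˡ 1))
      onˡ i = begin
        plugSub {m₁} (var (m₂ ↑ʳ zero)) M (i ↑ˡ 1)     ≡⟨ plugSub-↑ˡ (var (m₂ ↑ʳ zero)) M i ⟩
        var (M (i ↑ˡ (m₂ + 1)))                        ≡⟨ cong var (strLMap-↑ˡ {m₁} {m₂} F i) ⟩
        var (fun F (i ↑ˡ m₂) ↑ˡ 1)                     ≡⟨ cong (λ z → var (fun F z ↑ˡ 1)) (⊗S-↑ˡ (idS m₁) j i) ⟨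
        var (fun F (fun (idS m₁ ⊗S j) (i ↑ˡ 0)) ↑ˡ 1)  ≡⟨ cong (λ z → var (fun F (fun (idS m₁ ⊗S j) z) ↑ˡ 1))
                                                               (cast-↑ˡ0 (sym (+-identityʳ m₁)) i) ⟨
        var (fun F′ i ↑ˡ 1)                            ≡⟨ cong var (⊗S-↑ˡ F′ (idS 1) i) ⟨
        var (fun (F′ ⊗S idS 1) (i ↑ˡ 1))               ∎
      onLast : plugSub {m₁} (var (m₂ ↑ʳ zero)) M (m₁ ↑ʳ zero) ≡ var (fun (F′ ⊗S idS 1) (m₁ ↑ʳ zero))
      onLast = begin
        plugSub {m₁} (var (m₂ ↑ʳ zero)) M (m₁ ↑ʳ zero)  ≡⟨ plugSub-last {m₁} (var (m₂ ↑ʳ zero)) M ⟩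
        var (M (m₁ ↑ʳ (m₂ ↑ʳ zero)))                    ≡⟨ cong var (strLMap-last {m₁} {m₂} F) ⟩
        var (n ↑ʳ zero)                                 ≡⟨ cong var (⊗S-↑ʳ F′ (idS 1) zero) ⟨
        var (fun (F′ ⊗S idS 1) (m₁ ↑ʳ zero))            ∎
    termEq : plug {m₁} (termOf y) (termOf (app ν j)) M ≡ termOf (act TV (F′ ⊗S idS 1) y)
    termEq = begin
      plug {m₁} (termOf y) (termOf (app ν j)) M  ≡⟨ cong (λ X → plug {m₁} (termOf y) X M) (termOf-ν j) ⟩
      plug {m₁} (termOf y) (var (m₂ ↑ʳ zero)) M  ≡⟨ sub-var onVar (termOf y) ⟩
      ren (fun (F′ ⊗S idS 1)) (termOf y)         ≡⟨ termOf-act (F′ ⊗S idS 1) y ⟨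
      termOf (act TV (F′ ⊗S idS 1) y)            ∎

  σ-assoc : σ ∘h (idh ⊗h σ) ≈h σ ∘h (δh σ ⊗h idh) ∘h (strL (δ TV) TV ⊗h idh) ∘h assoc⁻¹ (δ TV) (δ TV) TV
  σ-assoc (⟨_,_,_⟩ {a} y (⟨_,_,_⟩ {b} y′ x f) F) = fromRTm-resp (begin
    plug {a} (termOf y) (termOf (σᶠ ⟨ y′ , x , f ⟩)) (fun F)
      ≡⟨ cong (λ W → plug {a} (termOf y) W (fun F)) (termOf-σ y′ x f) ⟩
    plug {a} (termOf y) (plug {b} (termOf y′) (termOf x) (fun f)) (fun F)
      ≡⟨ plug-assoc (termOf y) (termOf y′) (termOf x) f F ⟨
    plug {a + b} (plug {a} (termOf y) (termOf y′) (fun H)) (termOf x) (fun (assocMap {a} {b} F f))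
      ≡⟨ cong (λ W → plug {a + b} W (termOf x) (fun (assocMap {a} {b} F f))) (termOf-σ y y′ H) ⟨
    plug {a + b} (termOf (σᶠ ⟨ y , y′ , H ⟩)) (termOf x) (fun (assocMap {a} {b} F f)) ∎)
    where
    open ≡-Reasoning
    H : Surj (a + (b + 1)) ((a + b) + 1)
    H = strLMap {a} {b} (idS (a + b))

  σ-exchange : σ ∘h (δh σ ⊗h idh) ∘h (strR (δ TV) TV ⊗h idh) ∘h assoc⁻¹ (δ (δ TV)) TV TV
               ≈h σ ∘h (δh σ ⊗h idh) ∘h (strR (δ TV) TV ⊗h idh) ∘h assoc⁻¹ (δ (δ TV)) TV TV
                    ∘h (idh ⊗h gam TV TV) ∘h (swapH TV ⊗h idh)
  σ-exchange (⟨_,_,_⟩ {a} z (⟨_,_,_⟩ {b} {c} x₁ x₂ f) F) = fromRTm-resp (begin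
    plug {a + b} (termOf (σᶠ ⟨ z , x₁ , K₁ ⟩)) (termOf x₂) (fun (assocMap {a} {b} F f))
      ≡⟨ cong (λ W → plug {a + b} W (termOf x₂) (fun (assocMap {a} {b} F f))) (termOf-σ z x₁ K₁) ⟩
    plugTwice (termOf z) (termOf x₁) (termOf x₂) f F
      ≡⟨ plug-exchange (termOf z) (termOf x₁) (termOf x₂) f F ⟩
    plugTwice (ren (fun (swapMap a)) (termOf z)) (termOf x₂) (termOf x₁) (f ∘S swapB c b) F
      ≡⟨ cong (λ Z → plugTwice Z (termOf x₂) (termOf x₁) (f ∘S swapB c b) F) (termOf-act (swapMap a) z) ⟨
    plugTwice (termOf (act TV (swapMap a) z)) (termOf x₂) (termOf x₁) (f ∘S swapB c b) F
      ≡⟨ cong (λ W → plug {a + c} W (termOf x₁) (fun (assocMap {a} {c} F (f ∘S swapB c b)))) (termOf-σ (act TV (swapMap a) z) x₂ K₂) ⟨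
    plug {a + c} (termOf (σᶠ ⟨ act TV (swapMap a) z , x₂ , K₂ ⟩)) (termOf x₁) (fun (assocMap {a} {c} F (f ∘S swapB c b))) ∎)
    where
    open ≡-Reasoning
    K₁ : Surj ((a + 1) + b) ((a + b) + 1)
    K₁ = strRMap {a} {b} (idS (a + b))
    K₂ : Surj ((a + 1) + c) ((a + c) + 1)
    K₂ = strRMap {a} {c} (idS (a + c))

  σ-contract : σ ∘h (δh σ ⊗h idh) ∘h (rhoδ (δ TV) TV ⊗h idh) ∘h assoc⁻¹ (δ (δ TV)) (δ TV) TV
               ≈h σ ∘h (δh σ ⊗h σ) ∘h strSub (δ TV) TV ∘h (swapH TV ⊗h idh)
  σ-contract (⟨_,_,_⟩ {a} z (⟨_,_,_⟩ {b} {c} y x f) F) = fromRTm-resp (begin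
    plug {a + b} (termOf (σᶠ ⟨ z , y , rhoMap a b ⟩)) (termOf x) (fun (assocMap {a} {b} F f))
      ≡⟨ cong (λ W → plug {a + b} W (termOf x) (fun (assocMap {a} {b} F f))) (termOf-σ z y (rhoMap a b)) ⟩
    plug {a + b} (plug {a + 1} (termOf z) (termOf y) (fun (rhoMap a b))) (termOf x) (fun (assocMap {a} {b} F f))
      ≡⟨ plug-contract (termOf z) (termOf y) (termOf x) f F ⟩
    plugTwice (ren (fun (swapMap a)) (termOf z)) (termOf x) (plug {b} (termOf y) (termOf x) id) (dupMap {b} {c} f) F
      ≡⟨ cong₂ (λ Z W → plugTwice Z (termOf x) W (dupMap {b} {c} f) F) (termOf-act (swapMap a) z) (termOf-σ y x (idS (b + c))) ⟨
    plugTwice (termOf (act TV (swapMap a) z)) (termOf x) (termOf (σᶠ ⟨ y , x , idS (b + c) ⟩)) (dupMap {b} {c} f) F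
      ≡⟨ cong (λ W → plug {a + c} W _ (fun (assocMap {a} {c} F (dupMap {b} {c} f)))) (termOf-σ (act TV (swapMap a) z) x K) ⟨
    plug {a + c} (termOf (σᶠ ⟨ act TV (swapMap a) z , x , K ⟩)) (termOf (σᶠ ⟨ y , x , idS (b + c) ⟩)) (fun (assocMap {a} {c} F (dupMap {b} {c} f))) ∎)
    where
    open ≡-Reasoning
    K : Surj ((a + 1) + c) ((a + c) + 1)
    K = strRMap {a} {c} (idS (a + c))

mainTheorem10 : (S : BindingSig) (TV : Psh) → IsPsh TV →
    (α : Hom (V ⊕ ΣF S TV) TV) → IsHom α → IsInitialAlg S TV α →
    Σ (Hom (δ TV ⊗ TV) TV) λ σ → Σ (Hom J (δ TV)) λ ν →
      IsHom σ × IsHom ν × IsRelSubstAlg TV σ ν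
mainTheorem10 S TV TV-psh α α-hom initial =
  σ , ν , σ-isHom , ν-isHom ,
  record { ax-a = σ-unitˡ ; ax-b = σ-unitʳ ; ax-c = σ-assoc ; ax-d = σ-exchange ; ax-f = σ-contract }
  where open InitialAlgebra S TV TV-psh α α-hom initial
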